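{- Let $\Sigma$ be a countable signature (a set of atomic types together with typed function symbols $f:A\to B$). The equational calculus $\mathsf{ME}_\nu$ of the concurrent metalanguage over $\Sigma$ is sound and strongly complete with respect to $\mathsf{ME}_\nu$-models: for every set $\Phi$ of well-typed equations $\Gamma\rhd t=s$, an equation $\Gamma\rhd t=s$ is derivable in $\mathsf{ME}_\nu$ from the equations in $\Phi$ if and only if it is satisfied by every $\mathsf{ME}_\nu$-model that satisfies all equations of $\Phi$.
   Context: Types are generated by $P ::= W \mid 1 \mid P\times P \mid P+P \mid TP \mid T_\nu P$, with $W$ ranging over atomic types of $\Sigma$. A context is a list $\Gamma=(x_1:A_1,\dots,x_n:A_n)$. Terms (programs) $\Gamma\rhd t:A$ are formed by: variables; $f(t):B$ for $f:A\to B$ in $\Sigma$ and $t:A$; $\star:1$; pairing $\langle t,u\rangle:A\times B$, $\mathsf{fst}\,t:A$, $\mathsf{snd}\,t:B$ for $t:A\times B$; $\mathsf{inl}\,t:A+B$, $\mathsf{inr}\,t:A+B$; $\mathsf{case}\ s\ \mathsf{of}\ \mathsf{inl}\,x\mapsto t;\ \mathsf{inr}\,y\mapsto u : C$ for $s:A+B$, $\Gamma,x:A\rhd t:C$, $\Gamma,y:B\rhd u:C$; $\mathsf{ret}\,t:TA$ for $t:A$; $\mathsf{do}\ x\gets p;\ q : TB$ for $p:TA$ and $\Gamma,x:A\rhd q:TB$; $\varnothing:TA$ (deadlock); $p+q:TA$ for $p,q:TA$ (choice); $\mathsf{out}(p):T(T_\nu A+A)$ for $p:T_\nu A$; and $\mathsf{unfold}\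 x:=p\ \mathsf{in}\ q : T_\nu B$ for $\Gamma\rhd p:A$ and $\Gamma,x:A\rhd q:T(A+B)$ (with $x$ bound in $q$). An $\mathsf{ME}_\nu$-model consists of: a distributive category $\mathcal C$ (finite products, binary coproducts, with $\mathit{dist}:X\times(Y+Z)\to X\times Y+X\times Z$ inverse to the canonical map); a strong monad $(T,\eta,(-)^\star,\tau)$ on $\mathcal C$ which is semi-additive, i.e. equipped with natural transformations $\delta:1\to T$ and $\varpi:T\times T\to T$ making each $TA$ an internal bounded join-semilattice such that $f^\star\delta=\delta$, $f^\star\varpi=\varpi\langle f^\star,f^\star\rangle$, $\tau(f\times\delta)=\delta$, $\tau(f\times\varpi)=\varpi\langle\tau(f\times\pi_1),\tau(f\times\pi_2)\rangle$; and for every object $A$ a final coalgebra $\mathsf{out}_A:RA\to T(RA+A)$ of the functor $T(-+A)$ (for a coalgebra $f:X\to T(X+A)$ write $[\![f]\!]:X\to RA$ for the unique coalgebra morphism); plus interpretations of atomic types as objects and of function symbols as morphisms. Types are interpreted by products, coproducts, $[\![TA]\!]=T[\![A]\!]$, $[\![T_\nu A]\!]=R[\![A]\!]$, $[\![\Gamma]\!]=\prod[\![A_i]\!]$. Terms are interpreted as usual for variables, application, pairs, injections; $\mathsf{case}$ by $[\,[\![t]\!],[\![u]\!]\,]\circ\mathit{dist}\circ\langle\mathrm{id},[\![s]\!]\rangle$; $\mathsf{do}$ by $[\![q]\!]^\star\circ\tau\circ\langle\mathrm{id},[\![p]\!]\rangle$; $\mathsf{ret}$ by $\eta$; $+$,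 $\varnothing$ by $\varpi,\delta$; $\mathsf{out}(p)$ by $\mathsf{out}_{[\![A]\!]}\circ[\![p]\!]$; and $[\![\mathsf{unfold}\ x:=p\ \mathsf{in}\ q]\!]=R\pi_2\circ[\![f]\!]\circ\langle\mathrm{id},[\![p]\!]\rangle$ where $f=T(\mathit{dist})\circ\tau\circ\langle\pi_1,g\rangle:[\![\Gamma]\!]\times[\![A]\!]\to T([\![\Gamma]\!]\times[\![A]\!]+[\![\Gamma]\!]\times[\![B]\!])$ and $g=[\![\Gamma,x:A\rhd q]\!]$. A model satisfies $\Gamma\rhd t=s$ if $[\![t]\!]=[\![s]\!]$. $\mathsf{ME}_\nu$ is equational logic (reflexivity, symmetry, transitivity, congruence, substitution) plus the axioms: $\mathsf{case}$ of $\mathsf{inl}\,p$ (resp. $\mathsf{inr}\,p$) reduces to $q[p/x]$ (resp. $r[p/y]$); $\mathsf{case}\ p\ \mathsf{of}\ \mathsf{inl}\,x\mapsto\mathsf{inl}\,x;\ \mathsf{inr}\,y\mapsto\mathsf{inr}\,y = p$; $\mathsf{case}\ p\ \mathsf{of}\ \mathsf{inl}\,x\mapsto t[q/z];\ \mathsf{inr}\,y\mapsto t[r/z] = t[\mathsf{case}\ p\ \mathsf{of}\ \mathsf{inl}\,x\mapsto q;\ \mathsf{inr}\,y\mapsto r/z]$ ($x,y$ not free in $r$); $\mathsf{fst}\langle p,q\rangle=p$, $\mathsf{snd}\langle p,q\rangle=q$, $\langle\mathsf{fst}\,p,\mathsf{snd}\,p\rangle=p$; $p=\star$ for $p:1$;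 $\mathsf{do}\ x\gets p;\ \mathsf{ret}\,x=p$; $\mathsf{do}\ x\gets\mathsf{ret}\,a;\ p=p[a/x]$; $\mathsf{do}\ x\gets(\mathsf{do}\ y\gets p;\ q);\ r=\mathsf{do}\ y\gets p;\ x\gets q;\ r$ ($y$ not free in $r$); $p+\varnothing=p$, $p+q=q+p$, $p+p=p$, $p+(q+r)=(p+q)+r$, $\mathsf{do}\ x\gets\varnothing;\ r=\varnothing$, $\mathsf{do}\ x\gets(p+q);\ r=(\mathsf{do}\ x\gets p;\ r)+(\mathsf{do}\ x\gets q;\ r)$; and the bidirectional co-iteration rule: for $\Gamma,x:A\rhd p:T_\nu B$ and $\Gamma,x:A\rhd q:T(A+B)$, the equation $\Gamma,x:A\rhd \mathsf{out}(p)=\mathsf{do}\ z\gets q;\ \mathsf{case}\ z\ \mathsf{of}\ \mathsf{inl}\,x\mapsto\mathsf{ret}(\mathsf{inl}\,p);\ \mathsf{inr}\,y\mapsto\mathsf{ret}(\mathsf{inr}\,y)$ holds iff $\Gamma,y:A\rhd p[y/x]=\mathsf{unfold}\ x:=y\ \mathsf{in}\ q$ holds (each may be inferred from the other). -}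

module Defs where

open import Level using (Level; _⊔_) renaming (suc to lsuc; zero to lzero)
open import Data.Nat using (ℕ)
open import Data.Product using (Σ; _×_; _,_)
open import Data.List using (List; []; _∷_)
open import Function.Definitions using (Injective)
open import Relation.Binary.PropositionalEquality using (_≡_)
open import Relation.Binary.Core using (Rel)
open import Relation.Binary.Structures using (IsEquivalence)

Countable : Set → Set
Countable X = Σ (X → ℕ) (λ f → Injective _≡_ _≡_ f)

infixr 7 _×ᵗ_
infixr 6 _+ᵗ_

data Ty (W : Set) : Set where
  atom  : W → Ty W
  unit  : Ty W
  _×ᵗ_  : Ty W → Ty W → Ty W
  _+ᵗ_  : Ty W → Ty W → Ty W
  Tᵗ    : Ty W → Ty W
  Tνᵗ   : Ty W → Ty W

record Signature : Set₁ where
  field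
    Atom           : Set
    Fun            : Ty Atom → Ty Atom → Set
    Atom-countable : Countable Atom
    Fun-countable  : Countable (Σ (Ty Atom × Ty Atom) (λ { (A , B) → Fun A B }))

module Syntax (Sg : Signature) where
  open Signature Sg

  Type : Set
  Type = Ty Atom

  -- contexts x₁:A₁,…,xₙ:Aₙ ; the last variable is the head of the list
  Ctx : Set
  Ctx = List Type

  infixl 5 _,,_
  _,,_ : Ctx → Type → Ctx
  Γ ,, A = A ∷ Γ

  infix 4 _∋_
  data _∋_ : Ctx → Type → Set where
    here  : ∀ {Γ A} → (Γ ,, A) ∋ A
    there : ∀ {Γ A B} → Γ ∋ A → (Γ ,, B) ∋ A

  data Tm (Γ : Ctx) : Type → Set where
    var    : ∀ {A} → Γ ∋ A → Tm Γ A
    app    : ∀ {A B} → Fun A B → Tm Γ A → Tm Γ B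
    star   : Tm Γ unit
    pair   : ∀ {A B} → Tm Γ A → Tm Γ B → Tm Γ (A ×ᵗ B)
    fst    : ∀ {A B} → Tm Γ (A ×ᵗ B) → Tm Γ A
    snd    : ∀ {A B} → Tm Γ (A ×ᵗ B) → Tm Γ B
    inl    : ∀ {A B} → Tm Γ A → Tm Γ (A +ᵗ B)
    inr    : ∀ {A B} → Tm Γ B → Tm Γ (A +ᵗ B)
    case   : ∀ {A B C} → Tm Γ (A +ᵗ B) → Tm (Γ ,, A) C → Tm (Γ ,, B) C → Tm Γ C
    ret    : ∀ {A} → Tm Γ A → Tm Γ (Tᵗ A)
    bind   : ∀ {A B} → Tm Γ (Tᵗ A) → Tm (Γ ,, A) (Tᵗ B) → Tm Γ (Tᵗ B)
    nil    : ∀ {A} → Tm Γ (Tᵗ A)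
    plus   : ∀ {A} → Tm Γ (Tᵗ A) → Tm Γ (Tᵗ A) → Tm Γ (Tᵗ A)
    out    : ∀ {A} → Tm Γ (Tνᵗ A) → Tm Γ (Tᵗ (Tνᵗ A +ᵗ A))
    unfold : ∀ {A B} → Tm Γ A → Tm (Γ ,, A) (Tᵗ (A +ᵗ B)) → Tm Γ (Tνᵗ B)

  Ren : Ctx → Ctx → Set
  Ren Γ Δ = ∀ {A} → Γ ∋ A → Δ ∋ A

  ext : ∀ {Γ Δ B} → Ren Γ Δ → Ren (Γ ,, B) (Δ ,, B)
  ext ρ here      = here
  ext ρ (there v) = there (ρ v)

  rename : ∀ {Γ Δ A} → Ren Γ Δ → Tm Γ A → Tm Δ A
  rename ρ (var v)      = var (ρ v)
  rename ρ (app f t)    = app f (rename ρ t)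
  rename ρ star         = star
  rename ρ (pair t u)   = pair (rename ρ t) (rename ρ u)
  rename ρ (fst t)      = fst (rename ρ t)
  rename ρ (snd t)      = snd (rename ρ t)
  rename ρ (inl t)      = inl (rename ρ t)
  rename ρ (inr t)      = inr (rename ρ t)
  rename ρ (case s t u) = case (rename ρ s) (rename (ext ρ) t) (rename (ext ρ) u)
  rename ρ (ret t)      = ret (rename ρ t)
  rename ρ (bind p q)   = bind (rename ρ p) (rename (ext ρ) q)
  rename ρ nil          = nil
  rename ρ (plus p q)   = plus (rename ρ p) (rename ρ q)
  rename ρ (out p)      = out (rename ρ p)
  rename ρ (unfold p q) = unfold (rename ρ p) (rename (ext ρ) q)

  Sub : Ctx → Ctx → Set
  Sub Γ Δ = ∀ {A} → Γ ∋ A → Tm Δ A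

  exts : ∀ {Γ Δ B} → Sub Γ Δ → Sub (Γ ,, B) (Δ ,, B)
  exts σ here      = var here
  exts σ (there v) = rename there (σ v)

  sub : ∀ {Γ Δ A} → Sub Γ Δ → Tm Γ A → Tm Δ A
  sub σ (var v)      = σ v
  sub σ (app f t)    = app f (sub σ t)
  sub σ star         = star
  sub σ (pair t u)   = pair (sub σ t) (sub σ u)
  sub σ (fst t)      = fst (sub σ t)
  sub σ (snd t)      = snd (sub σ t)
  sub σ (inl t)      = inl (sub σ t)
  sub σ (inr t)      = inr (sub σ t)
  sub σ (case s t u) = case (sub σ s) (sub (exts σ) t) (sub (exts σ) u)
  sub σ (ret t)      = ret (sub σ t)
  sub σ (bind p q)   = bind (sub σ p) (sub (exts σ) q)
  sub σ nil          = nil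
  sub σ (plus p q)   = plus (sub σ p) (sub σ q)
  sub σ (out p)      = out (sub σ p)
  sub σ (unfold p q) = unfold (sub σ p) (sub (exts σ) q)

  _[_] : ∀ {Γ A B} → Tm (Γ ,, B) A → Tm Γ B → Tm Γ A
  _[_] {Γ} {A} {B} t u = sub σ t
    where
      σ : Sub (Γ ,, B) Γ
      σ here      = u
      σ (there v) = var v

  _[_]ᵂ : ∀ {Γ C D E} → Tm (Γ ,, C) D → Tm (Γ ,, E) C → Tm (Γ ,, E) D
  _[_]ᵂ {Γ} {C} {D} {E} t q = sub σ t
    where
      σ : Sub (Γ ,, C) (Γ ,, E)
      σ here      = q
      σ (there v) = var (there v)

  weak₁ : ∀ {Γ A B C} → Tm (Γ ,, A) C → Tm (Γ ,, B ,, A) C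
  weak₁ = rename (ext there)

  -- in the co-iteration rule, p lives in Γ,x:A and is used in Γ,x:A,z:A+B,x:A
  -- (the branch inl x ↦ … rebinds x, so x there denotes the new variable)
  coitRen : ∀ {Γ A B} → Ren (Γ ,, A) (Γ ,, A ,, (A +ᵗ B) ,, A)
  coitRen here      = here
  coitRen (there v) = there (there (there v))

  record Equation : Set where
    constructor _▷_≐_
    field
      ctx : Ctx
      {ty} : Type
      lhs : Tm ctx ty
      rhs : Tm ctx ty

  EqSet : Set₁
  EqSet = Equation → Set

  infix 3 _⊢_≈_
  data _⊢_≈_ (Φ : EqSet) : ∀ {Γ A} → Tm Γ A → Tm Γ A → Set where
    hyp : ∀ {Γ A} {t s : Tm Γ A} → Φ (Γ ▷ t ≐ s) → Φ ⊢ t ≈ s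
    ≈refl  : ∀ {Γ A} {t : Tm Γ A} → Φ ⊢ t ≈ t
    ≈sym   : ∀ {Γ A} {t s : Tm Γ A} → Φ ⊢ t ≈ s → Φ ⊢ s ≈ t
    ≈trans : ∀ {Γ A} {t s u : Tm Γ A} → Φ ⊢ t ≈ s → Φ ⊢ s ≈ u → Φ ⊢ t ≈ u
    ≈subst : ∀ {Γ Δ A} {t s : Tm Γ A} (σ : Sub Γ Δ) → Φ ⊢ t ≈ s → Φ ⊢ sub σ t ≈ sub σ s
    c-app    : ∀ {Γ A B} (f : Fun A B) {t t' : Tm Γ A} → Φ ⊢ t ≈ t' → Φ ⊢ app f t ≈ app f t'
    c-pair   : ∀ {Γ A B} {t t' : Tm Γ A} {u u' : Tm Γ B} →
               Φ ⊢ t ≈ t' → Φ ⊢ u ≈ u' → Φ ⊢ pair t u ≈ pair t' u'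
    c-fst    : ∀ {Γ A B} {t t' : Tm Γ (A ×ᵗ B)} → Φ ⊢ t ≈ t' → Φ ⊢ fst t ≈ fst t'
    c-snd    : ∀ {Γ A B} {t t' : Tm Γ (A ×ᵗ B)} → Φ ⊢ t ≈ t' → Φ ⊢ snd t ≈ snd t'
    c-inl    : ∀ {Γ A B} {t t' : Tm Γ A} → Φ ⊢ t ≈ t' → Φ ⊢ inl {B = B} t ≈ inl t'
    c-inr    : ∀ {Γ A B} {t t' : Tm Γ B} → Φ ⊢ t ≈ t' → Φ ⊢ inr {A = A} t ≈ inr t'
    c-case   : ∀ {Γ A B C} {s s' : Tm Γ (A +ᵗ B)} {t t' : Tm (Γ ,, A) C} {u u' : Tm (Γ ,, B) C} →
               Φ ⊢ s ≈ s' → Φ ⊢ t ≈ t' → Φ ⊢ u ≈ u' → Φ ⊢ case s t u ≈ case s' t' u'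
    c-ret    : ∀ {Γ A} {t t' : Tm Γ A} → Φ ⊢ t ≈ t' → Φ ⊢ ret t ≈ ret t'
    c-bind   : ∀ {Γ A B} {p p' : Tm Γ (Tᵗ A)} {q q' : Tm (Γ ,, A) (Tᵗ B)} →
               Φ ⊢ p ≈ p' → Φ ⊢ q ≈ q' → Φ ⊢ bind p q ≈ bind p' q'
    c-plus   : ∀ {Γ A} {p p' q q' : Tm Γ (Tᵗ A)} →
               Φ ⊢ p ≈ p' → Φ ⊢ q ≈ q' → Φ ⊢ plus p q ≈ plus p' q'
    c-out    : ∀ {Γ A} {p p' : Tm Γ (Tνᵗ A)} → Φ ⊢ p ≈ p' → Φ ⊢ out p ≈ out p'
    c-unfold : ∀ {Γ A B} {p p' : Tm Γ A} {q q' : Tm (Γ ,, A) (Tᵗ (A +ᵗ B))} →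
               Φ ⊢ p ≈ p' → Φ ⊢ q ≈ q' → Φ ⊢ unfold p q ≈ unfold p' q'
    case-inl : ∀ {Γ A B C} (p : Tm Γ A) (q : Tm (Γ ,, A) C) (r : Tm (Γ ,, B) C) →
               Φ ⊢ case (inl p) q r ≈ q [ p ]
    case-inr : ∀ {Γ A B C} (p : Tm Γ B) (q : Tm (Γ ,, A) C) (r : Tm (Γ ,, B) C) →
               Φ ⊢ case (inr p) q r ≈ r [ p ]
    case-η   : ∀ {Γ A B} (p : Tm Γ (A +ᵗ B)) →
               Φ ⊢ case p (inl (var here)) (inr (var here)) ≈ p
    case-nat : ∀ {Γ A B C D} (p : Tm Γ (A +ᵗ B)) (t : Tm (Γ ,, C) D)
               (q : Tm (Γ ,, A) C) (r : Tm (Γ ,, B) C) →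
               Φ ⊢ case p (t [ q ]ᵂ) (t [ r ]ᵂ) ≈ t [ case p q r ]
    fst-β    : ∀ {Γ A B} (p : Tm Γ A) (q : Tm Γ B) → Φ ⊢ fst (pair p q) ≈ p
    snd-β    : ∀ {Γ A B} (p : Tm Γ A) (q : Tm Γ B) → Φ ⊢ snd (pair p q) ≈ q
    pair-η   : ∀ {Γ A B} (p : Tm Γ (A ×ᵗ B)) → Φ ⊢ pair (fst p) (snd p) ≈ p
    unit-η   : ∀ {Γ} (p : Tm Γ unit) → Φ ⊢ p ≈ star
    bind-ret : ∀ {Γ A} (p : Tm Γ (Tᵗ A)) → Φ ⊢ bind p (ret (var here)) ≈ p
    ret-bind : ∀ {Γ A B} (a : Tm Γ A) (p : Tm (Γ ,, A) (Tᵗ B)) → Φ ⊢ bind (ret a) p ≈ p [ a ]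
    bind-assoc : ∀ {Γ A B C} (p : Tm Γ (Tᵗ A)) (q : Tm (Γ ,, A) (Tᵗ B)) (r : Tm (Γ ,, B) (Tᵗ C)) →
               Φ ⊢ bind (bind p q) r ≈ bind p (bind q (weak₁ r))
    plus-nil   : ∀ {Γ A} (p : Tm Γ (Tᵗ A)) → Φ ⊢ plus p nil ≈ p
    plus-comm  : ∀ {Γ A} (p q : Tm Γ (Tᵗ A)) → Φ ⊢ plus p q ≈ plus q p
    plus-idem  : ∀ {Γ A} (p : Tm Γ (Tᵗ A)) → Φ ⊢ plus p p ≈ p
    plus-assoc : ∀ {Γ A} (p q r : Tm Γ (Tᵗ A)) → Φ ⊢ plus p (plus q r) ≈ plus (plus p q) r
    bind-nil   : ∀ {Γ A B} (r : Tm (Γ ,, A) (Tᵗ B)) → Φ ⊢ bind nil r ≈ nil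
    bind-plus  : ∀ {Γ A B} (p q : Tm Γ (Tᵗ A)) (r : Tm (Γ ,, A) (Tᵗ B)) →
               Φ ⊢ bind (plus p q) r ≈ plus (bind p r) (bind q r)
    coit→ : ∀ {Γ A B} (p : Tm (Γ ,, A) (Tνᵗ B)) (q : Tm (Γ ,, A) (Tᵗ (A +ᵗ B))) →
            Φ ⊢ out p ≈ bind q (case (var here) (ret (inl (rename coitRen p))) (ret (inr (var here)))) →
            Φ ⊢ p ≈ unfold (var here) (weak₁ q)
    coit← : ∀ {Γ A B} (p : Tm (Γ ,, A) (Tνᵗ B)) (q : Tm (Γ ,, A) (Tᵗ (A +ᵗ B))) →
            Φ ⊢ p ≈ unfold (var here) (weak₁ q) →
            Φ ⊢ out p ≈ bind q (case (var here) (ret (inl (rename coitRen p))) (ret (inr (var here))))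


record DistCat (o ℓ e : Level) : Set (lsuc (o ⊔ ℓ ⊔ e)) where
  infixr 9 _∘_
  infix  4 _≈_
  field
    Obj   : Set o
    Hom   : Obj → Obj → Set ℓ
    _≈_   : ∀ {A B} → Rel (Hom A B) e
    ≈-equiv : ∀ {A B} → IsEquivalence (_≈_ {A} {B})
    id    : ∀ {A} → Hom A A
    _∘_   : ∀ {A B C} → Hom B C → Hom A B → Hom A C
    assoc : ∀ {A B C D} {f : Hom A B} {g : Hom B C} {h : Hom C D} →
            (h ∘ g) ∘ f ≈ h ∘ (g ∘ f)
    identityˡ : ∀ {A B} {f : Hom A B} → id ∘ f ≈ f
    identityʳ : ∀ {A B} {f : Hom A B} → f ∘ id ≈ f
    ∘-resp-≈  : ∀ {A B C} {f h : Hom B C} {g i : Hom A B} → f ≈ h → g ≈ i → f ∘ g ≈ h ∘ i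
    𝟙        : Obj
    !        : ∀ {A} → Hom A 𝟙
    !-unique : ∀ {A} (f : Hom A 𝟙) → f ≈ !
    _⊗_      : Obj → Obj → Obj
    π₁       : ∀ {A B} → Hom (A ⊗ B) A
    π₂       : ∀ {A B} → Hom (A ⊗ B) B
    ⟨_,_⟩    : ∀ {X A B} → Hom X A → Hom X B → Hom X (A ⊗ B)
    project₁ : ∀ {X A B} {f : Hom X A} {g : Hom X B} → π₁ ∘ ⟨ f , g ⟩ ≈ f
    project₂ : ∀ {X A B} {f : Hom X A} {g : Hom X B} → π₂ ∘ ⟨ f , g ⟩ ≈ g
    ⟨⟩-unique : ∀ {X A B} {f : Hom X A} {g : Hom X B} {h : Hom X (A ⊗ B)} →
                π₁ ∘ h ≈ f → π₂ ∘ h ≈ g → h ≈ ⟨ f , g ⟩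
    _⊕_      : Obj → Obj → Obj
    i₁       : ∀ {A B} → Hom A (A ⊕ B)
    i₂       : ∀ {A B} → Hom B (A ⊕ B)
    [_,_]    : ∀ {A B X} → Hom A X → Hom B X → Hom (A ⊕ B) X
    inject₁  : ∀ {A B X} {f : Hom A X} {g : Hom B X} → [ f , g ] ∘ i₁ ≈ f
    inject₂  : ∀ {A B X} {f : Hom A X} {g : Hom B X} → [ f , g ] ∘ i₂ ≈ g
    []-unique : ∀ {A B X} {f : Hom A X} {g : Hom B X} {h : Hom (A ⊕ B) X} →
                h ∘ i₁ ≈ f → h ∘ i₂ ≈ g → h ≈ [ f , g ]
    dist     : ∀ {X Y Z} → Hom (X ⊗ (Y ⊕ Z)) ((X ⊗ Y) ⊕ (X ⊗ Z))
    dist∘can : ∀ {X Y Z} →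
               dist ∘ [ ⟨ π₁ , i₁ ∘ π₂ ⟩ , ⟨ π₁ , i₂ ∘ π₂ ⟩ ] ≈ id {(X ⊗ Y) ⊕ (X ⊗ Z)}
    can∘dist : ∀ {X Y Z} →
               [ ⟨ π₁ , i₁ ∘ π₂ ⟩ , ⟨ π₁ , i₂ ∘ π₂ ⟩ ] ∘ dist ≈ id {X ⊗ (Y ⊕ Z)}

module DistCatOps {o ℓ e} (C : DistCat o ℓ e) where
  open DistCat C
  _×ₘ_ : ∀ {A B A' B'} → Hom A A' → Hom B B' → Hom (A ⊗ B) (A' ⊗ B')
  f ×ₘ g = ⟨ f ∘ π₁ , g ∘ π₂ ⟩
  _+ₘ_ : ∀ {A B A' B'} → Hom A A' → Hom B B' → Hom (A ⊕ B) (A' ⊕ B')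
  f +ₘ g = [ i₁ ∘ f , i₂ ∘ g ]
  α : ∀ {A B X} → Hom ((A ⊗ B) ⊗ X) (A ⊗ (B ⊗ X))
  α = ⟨ π₁ ∘ π₁ , ⟨ π₂ ∘ π₁ , π₂ ⟩ ⟩

record StrongMonad {o ℓ e} (C : DistCat o ℓ e) : Set (o ⊔ ℓ ⊔ e) where
  open DistCat C
  open DistCatOps C
  infix 10 _⋆
  field
    T    : Obj → Obj
    η    : ∀ {A} → Hom A (T A)
    _⋆   : ∀ {A B} → Hom A (T B) → Hom (T A) (T B)
    ⋆-resp-≈ : ∀ {A B} {f g : Hom A (T B)} → f ≈ g → f ⋆ ≈ g ⋆
    ⋆-η      : ∀ {A B} {f : Hom A (T B)} → f ⋆ ∘ η ≈ f
    η-⋆      : ∀ {A} → η ⋆ ≈ id {T A}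
    ⋆-assoc  : ∀ {A B X} {f : Hom A (T B)} {g : Hom B (T X)} → (g ⋆ ∘ f) ⋆ ≈ g ⋆ ∘ f ⋆
    τ        : ∀ {A B} → Hom (A ⊗ T B) (T (A ⊗ B))
    τ-natural : ∀ {A A' B B'} {f : Hom A A'} {g : Hom B B'} →
                τ ∘ (f ×ₘ ((η ∘ g) ⋆)) ≈ (η ∘ (f ×ₘ g)) ⋆ ∘ τ
    τ-unit   : ∀ {A} → (η ∘ π₂) ⋆ ∘ τ {𝟙} {A} ≈ π₂
    τ-assoc  : ∀ {A B X} → (η ∘ α) ⋆ ∘ τ {A ⊗ B} {X} ≈ τ ∘ (id ×ₘ τ) ∘ α
    τ-η      : ∀ {A B} → τ ∘ (id ×ₘ η) ≈ η {A ⊗ B}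
    τ-⋆      : ∀ {A B X} {f : Hom B (T X)} →
               τ ∘ (id {A} ×ₘ (f ⋆)) ≈ (τ ∘ (id ×ₘ f)) ⋆ ∘ τ

  Tmap : ∀ {A B} → Hom A B → Hom (T A) (T B)
  Tmap f = (η ∘ f) ⋆

-- Semi-additivity: δ : 1 → T and ϖ : T × T → T natural, making each TA an
-- internal bounded join-semilattice (stated with generalized elements),
-- compatible with Kleisli lifting and strength.
record SemiAdditive {o ℓ e} (C : DistCat o ℓ e) (M : StrongMonad C) : Set (o ⊔ ℓ ⊔ e) where
  open DistCat C
  open DistCatOps C
  open StrongMonad M
  field
    δ : ∀ {A} → Hom 𝟙 (T A)
    ϖ : ∀ {A} → Hom (T A ⊗ T A) (T A)
    δ-natural : ∀ {A B} {f : Hom A B} → Tmap f ∘ δ ≈ δ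
    ϖ-natural : ∀ {A B} {f : Hom A B} → Tmap f ∘ ϖ ≈ ϖ ∘ (Tmap f ×ₘ Tmap f)
    ϖ-unit  : ∀ {X A} {f : Hom X (T A)} → ϖ ∘ ⟨ f , δ ∘ ! ⟩ ≈ f
    ϖ-comm  : ∀ {X A} {f g : Hom X (T A)} → ϖ ∘ ⟨ f , g ⟩ ≈ ϖ ∘ ⟨ g , f ⟩
    ϖ-idem  : ∀ {X A} {f : Hom X (T A)} → ϖ ∘ ⟨ f , f ⟩ ≈ f
    ϖ-assoc : ∀ {X A} {f g h : Hom X (T A)} →
              ϖ ∘ ⟨ f , ϖ ∘ ⟨ g , h ⟩ ⟩ ≈ ϖ ∘ ⟨ ϖ ∘ ⟨ f , g ⟩ , h ⟩
    ⋆-δ : ∀ {A B} {f : Hom A (T B)} → f ⋆ ∘ δ ≈ δ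
    ⋆-ϖ : ∀ {A B} {f : Hom A (T B)} → f ⋆ ∘ ϖ ≈ ϖ ∘ ⟨ f ⋆ ∘ π₁ , f ⋆ ∘ π₂ ⟩
    τ-δ : ∀ {X A B} {f : Hom X A} → τ ∘ (f ×ₘ δ {B}) ≈ δ ∘ !
    τ-ϖ : ∀ {X A B} {f : Hom X A} →
          τ ∘ (f ×ₘ ϖ {B}) ≈ ϖ ∘ ⟨ τ ∘ (f ×ₘ π₁) , τ ∘ (f ×ₘ π₂) ⟩

record FinalCoalgebras {o ℓ e} (C : DistCat o ℓ e) (M : StrongMonad C) : Set (o ⊔ ℓ ⊔ e) where
  open DistCat C
  open DistCatOps C
  open StrongMonad M
  field
    R      : Obj → Obj
    outC   : ∀ {A} → Hom (R A) (T (R A ⊕ A))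
    coit   : ∀ {X A} → Hom X (T (X ⊕ A)) → Hom X (R A)
    coit-hom    : ∀ {X A} {f : Hom X (T (X ⊕ A))} →
                  outC ∘ coit f ≈ Tmap (coit f +ₘ id) ∘ f
    coit-unique : ∀ {X A} {f : Hom X (T (X ⊕ A))} {h : Hom X (R A)} →
                  outC ∘ h ≈ Tmap (h +ₘ id) ∘ f → h ≈ coit f

  Rmap : ∀ {A B} → Hom A B → Hom (R A) (R B)
  Rmap f = coit (Tmap (id +ₘ f) ∘ outC)

record Structure (o ℓ e : Level) : Set (lsuc (o ⊔ ℓ ⊔ e)) where
  field
    cat  : DistCat o ℓ e
    mon  : StrongMonad cat
    sadd : SemiAdditive cat mon
    fin  : FinalCoalgebras cat mon
  open DistCat cat public
  open DistCatOps cat public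
  open StrongMonad mon public
  open SemiAdditive sadd public
  open FinalCoalgebras fin public

module Interp {o ℓ e} (S : Structure o ℓ e) {W : Set} (atomI : W → Structure.Obj S) where
  open Structure S
  ⟦_⟧ty : Ty W → Obj
  ⟦ atom w ⟧ty = atomI w
  ⟦ unit ⟧ty   = 𝟙
  ⟦ A ×ᵗ B ⟧ty = ⟦ A ⟧ty ⊗ ⟦ B ⟧ty
  ⟦ A +ᵗ B ⟧ty = ⟦ A ⟧ty ⊕ ⟦ B ⟧ty
  ⟦ Tᵗ A ⟧ty   = T ⟦ A ⟧ty
  ⟦ Tνᵗ A ⟧ty  = R ⟦ A ⟧ty

record Model (Sg : Signature) (o ℓ e : Level) : Set (lsuc (o ⊔ ℓ ⊔ e)) where
  open Signature Sg
  field
    str   : Structure o ℓ e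
    atomI : Atom → Structure.Obj str
  open Structure str public
  open Interp str atomI public
  field
    funI  : ∀ {A B} → Fun A B → Hom ⟦ A ⟧ty ⟦ B ⟧ty

module Semantics (Sg : Signature) {o ℓ e} (M : Model Sg o ℓ e) where
  open Signature Sg
  open Syntax Sg
  open Model M

  ⟦_⟧ctx : Ctx → Obj
  ⟦ [] ⟧ctx    = 𝟙
  ⟦ A ∷ Γ ⟧ctx = ⟦ Γ ⟧ctx ⊗ ⟦ A ⟧ty

  ⟦_⟧var : ∀ {Γ A} → Γ ∋ A → Hom ⟦ Γ ⟧ctx ⟦ A ⟧ty
  ⟦ here ⟧var    = π₂
  ⟦ there v ⟧var = ⟦ v ⟧var ∘ π₁

  ⟦_⟧tm : ∀ {Γ A} → Tm Γ A → Hom ⟦ Γ ⟧ctx ⟦ A ⟧ty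
  ⟦ var v ⟧tm      = ⟦ v ⟧var
  ⟦ app f t ⟧tm    = funI f ∘ ⟦ t ⟧tm
  ⟦ star ⟧tm       = !
  ⟦ pair t u ⟧tm   = ⟨ ⟦ t ⟧tm , ⟦ u ⟧tm ⟩
  ⟦ fst t ⟧tm      = π₁ ∘ ⟦ t ⟧tm
  ⟦ snd t ⟧tm      = π₂ ∘ ⟦ t ⟧tm
  ⟦ inl t ⟧tm      = i₁ ∘ ⟦ t ⟧tm
  ⟦ inr t ⟧tm      = i₂ ∘ ⟦ t ⟧tm
  ⟦ case s t u ⟧tm = [ ⟦ t ⟧tm , ⟦ u ⟧tm ] ∘ dist ∘ ⟨ id , ⟦ s ⟧tm ⟩
  ⟦ ret t ⟧tm      = η ∘ ⟦ t ⟧tm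
  ⟦ bind p q ⟧tm   = ⟦ q ⟧tm ⋆ ∘ τ ∘ ⟨ id , ⟦ p ⟧tm ⟩
  ⟦ nil ⟧tm        = δ ∘ !
  ⟦ plus p q ⟧tm   = ϖ ∘ ⟨ ⟦ p ⟧tm , ⟦ q ⟧tm ⟩
  ⟦ out p ⟧tm      = outC ∘ ⟦ p ⟧tm
  ⟦ unfold p q ⟧tm = Rmap π₂ ∘ coit (Tmap dist ∘ τ ∘ ⟨ π₁ , ⟦ q ⟧tm ⟩) ∘ ⟨ id , ⟦ p ⟧tm ⟩

Satisfies : ∀ (Sg : Signature) {o ℓ e} → Model Sg o ℓ e → Syntax.Equation Sg → Set e
Satisfies Sg M (Syntax._▷_≐_ Γ t s) = Model._≈_ M (Semantics.⟦_⟧tm Sg M t) (Semantics.⟦_⟧tm Sg M s)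

SatisfiesAll : ∀ (Sg : Signature) {o ℓ e} → Model Sg o ℓ e → Syntax.EqSet Sg → Set e
SatisfiesAll Sg M Φ = ∀ E → Φ E → Satisfies Sg M E

-- Soundness is an induction on derivations: substitution is interpreted by precomposition, each
-- axiom holds for the morphisms interpreting the term formers, and the co-iteration rule says precisely
-- that ⟦p⟧ is the coiteration of the coalgebra interpreting q, i.e. the unique coalgebra morphism.
--
-- For completeness, types and terms in one free variable modulo Φ-derivable equality form an
-- MEν-model, the syntactic category: products, coproducts, the strong monad and its semi-additive
-- structure come from the corresponding axioms, and unfold provides final coalgebras of T(- + A)
-- because the co-iteration rule holds in both directions. This model satisfies Φ, and it interprets
-- a term t in context Γ, up to derivable equality, as t with its variables replaced by projections
-- out of a tuple of type Γ; substituting the tuple back recovers t, so every equation valid in it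
-- is derivable.

module Submission where

open import Defs
open import Level using (Level; Lift; lift; lower)
open import Function.Bundles using (_⇔_; mk⇔)
open import Relation.Binary.PropositionalEquality as P using (_≡_; refl; cong; cong₂)
open import Relation.Binary.Bundles using (Setoid)
open import Relation.Binary.Structures using (IsEquivalence)
import Relation.Binary.Reasoning.Setoid as SetoidReasoning
open import Data.List using ([]; _∷_)

module Substitution (Sg : Signature) where
  open Syntax Sg

  private variable
    Γ Δ Θ : Ctx
    A B C E : Type

  cong₃ : ∀ {a b c d} {X : Set a} {Y : Set b} {Z : Set c} {U : Set d}
          (f : X → Y → Z → U) {x x' y y' z z'} → x ≡ x' → y ≡ y' → z ≡ z' → f x y z ≡ f x' y' z'
  cong₃ f refl refl refl = refl

  infix 4 _≗ʳ_ _≗ˢ_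
  _≗ʳ_ : Ren Γ Δ → Ren Γ Δ → Set
  _≗ʳ_ {Γ} ρ ρ' = ∀ {A} (v : Γ ∋ A) → ρ v ≡ ρ' v
  _≗ˢ_ : Sub Γ Δ → Sub Γ Δ → Set
  _≗ˢ_ {Γ} σ σ' = ∀ {A} (v : Γ ∋ A) → σ v ≡ σ' v

  ext-cong : {ρ ρ' : Ren Γ Δ} → ρ ≗ʳ ρ' → ext {B = B} ρ ≗ʳ ext ρ'
  ext-cong e here      = refl
  ext-cong e (there v) = cong there (e v)

  rename-cong : {ρ ρ' : Ren Γ Δ} → ρ ≗ʳ ρ' → (t : Tm Γ A) → rename ρ t ≡ rename ρ' t
  rename-cong e (var v)      = cong var (e v)
  rename-cong e (app f t)    = cong (app f) (rename-cong e t)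
  rename-cong e star         = refl
  rename-cong e (pair t u)   = cong₂ pair (rename-cong e t) (rename-cong e u)
  rename-cong e (fst t)      = cong fst (rename-cong e t)
  rename-cong e (snd t)      = cong snd (rename-cong e t)
  rename-cong e (inl t)      = cong inl (rename-cong e t)
  rename-cong e (inr t)      = cong inr (rename-cong e t)
  rename-cong e (case s t u) = cong₃ case (rename-cong e s) (rename-cong (ext-cong e) t) (rename-cong (ext-cong e) u)
  rename-cong e (ret t)      = cong ret (rename-cong e t)
  rename-cong e (bind p q)   = cong₂ bind (rename-cong e p) (rename-cong (ext-cong e) q)
  rename-cong e nil          = refl
  rename-cong e (plus p q)   = cong₂ plus (rename-cong e p) (rename-cong e q)
  rename-cong e (out p)      = cong out (rename-cong e p)
  rename-cong e (unfold p q) = cong₂ unfold (rename-cong e p) (rename-cong (ext-cong e) q)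

  exts-cong : {σ σ' : Sub Γ Δ} → σ ≗ˢ σ' → exts {B = B} σ ≗ˢ exts σ'
  exts-cong e here      = refl
  exts-cong e (there v) = cong (rename there) (e v)

  sub-cong : {σ σ' : Sub Γ Δ} → σ ≗ˢ σ' → (t : Tm Γ A) → sub σ t ≡ sub σ' t
  sub-cong e (var v)      = e v
  sub-cong e (app f t)    = cong (app f) (sub-cong e t)
  sub-cong e star         = refl
  sub-cong e (pair t u)   = cong₂ pair (sub-cong e t) (sub-cong e u)
  sub-cong e (fst t)      = cong fst (sub-cong e t)
  sub-cong e (snd t)      = cong snd (sub-cong e t)
  sub-cong e (inl t)      = cong inl (sub-cong e t)
  sub-cong e (inr t)      = cong inr (sub-cong e t)
  sub-cong e (case s t u) = cong₃ case (sub-cong e s) (sub-cong (exts-cong e) t) (sub-cong (exts-cong e) u)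
  sub-cong e (ret t)      = cong ret (sub-cong e t)
  sub-cong e (bind p q)   = cong₂ bind (sub-cong e p) (sub-cong (exts-cong e) q)
  sub-cong e nil          = refl
  sub-cong e (plus p q)   = cong₂ plus (sub-cong e p) (sub-cong e q)
  sub-cong e (out p)      = cong out (sub-cong e p)
  sub-cong e (unfold p q) = cong₂ unfold (sub-cong e p) (sub-cong (exts-cong e) q)

  ext-ext : (ρ : Ren Δ Θ) (ρ' : Ren Γ Δ) {A : Type} (v : (Γ ,, B) ∋ A) →
            ext ρ (ext ρ' v) ≡ ext (λ w → ρ (ρ' w)) v
  ext-ext ρ ρ' here      = refl
  ext-ext ρ ρ' (there v) = refl

  rename-rename : (ρ : Ren Δ Θ) (ρ' : Ren Γ Δ) (t : Tm Γ A) →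
                  rename ρ (rename ρ' t) ≡ rename (λ v → ρ (ρ' v)) t
  rename-rename ρ ρ' (var v)      = refl
  rename-rename ρ ρ' (app f t)    = cong (app f) (rename-rename ρ ρ' t)
  rename-rename ρ ρ' star         = refl
  rename-rename ρ ρ' (pair t u)   = cong₂ pair (rename-rename ρ ρ' t) (rename-rename ρ ρ' u)
  rename-rename ρ ρ' (fst t)      = cong fst (rename-rename ρ ρ' t)
  rename-rename ρ ρ' (snd t)      = cong snd (rename-rename ρ ρ' t)
  rename-rename ρ ρ' (inl t)      = cong inl (rename-rename ρ ρ' t)
  rename-rename ρ ρ' (inr t)      = cong inr (rename-rename ρ ρ' t)
  rename-rename ρ ρ' (case s t u) = cong₃ case (rename-rename ρ ρ' s) (under t) (under u)
    where
      under : ∀ {B C} (t : Tm (_ ,, B) C) → rename (ext ρ) (rename (ext ρ') t) ≡ rename (ext (λ v → ρ (ρ' v))) t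
      under t = P.trans (rename-rename (ext ρ) (ext ρ') t) (rename-cong (ext-ext ρ ρ') t)
  rename-rename ρ ρ' (ret t)      = cong ret (rename-rename ρ ρ' t)
  rename-rename ρ ρ' (bind p q)   =
    cong₂ bind (rename-rename ρ ρ' p) (P.trans (rename-rename (ext ρ) (ext ρ') q) (rename-cong (ext-ext ρ ρ') q))
  rename-rename ρ ρ' nil          = refl
  rename-rename ρ ρ' (plus p q)   = cong₂ plus (rename-rename ρ ρ' p) (rename-rename ρ ρ' q)
  rename-rename ρ ρ' (out p)      = cong out (rename-rename ρ ρ' p)
  rename-rename ρ ρ' (unfold p q) =
    cong₂ unfold (rename-rename ρ ρ' p) (P.trans (rename-rename (ext ρ) (ext ρ') q) (rename-cong (ext-ext ρ ρ') q))

  exts-ext : (σ : Sub Δ Θ) (ρ : Ren Γ Δ) {A : Type} (v : (Γ ,, B) ∋ A) →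
             exts σ (ext ρ v) ≡ exts (λ w → σ (ρ w)) v
  exts-ext σ ρ here      = refl
  exts-ext σ ρ (there v) = refl

  sub-rename : (σ : Sub Δ Θ) (ρ : Ren Γ Δ) (t : Tm Γ A) → sub σ (rename ρ t) ≡ sub (λ v → σ (ρ v)) t
  sub-rename σ ρ (var v)      = refl
  sub-rename σ ρ (app f t)    = cong (app f) (sub-rename σ ρ t)
  sub-rename σ ρ star         = refl
  sub-rename σ ρ (pair t u)   = cong₂ pair (sub-rename σ ρ t) (sub-rename σ ρ u)
  sub-rename σ ρ (fst t)      = cong fst (sub-rename σ ρ t)
  sub-rename σ ρ (snd t)      = cong snd (sub-rename σ ρ t)
  sub-rename σ ρ (inl t)      = cong inl (sub-rename σ ρ t)
  sub-rename σ ρ (inr t)      = cong inr (sub-rename σ ρ t)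
  sub-rename σ ρ (case s t u) = cong₃ case (sub-rename σ ρ s) (under t) (under u)
    where
      under : ∀ {B C} (t : Tm (_ ,, B) C) → sub (exts σ) (rename (ext ρ) t) ≡ sub (exts (λ v → σ (ρ v))) t
      under t = P.trans (sub-rename (exts σ) (ext ρ) t) (sub-cong (exts-ext σ ρ) t)
  sub-rename σ ρ (ret t)      = cong ret (sub-rename σ ρ t)
  sub-rename σ ρ (bind p q)   =
    cong₂ bind (sub-rename σ ρ p) (P.trans (sub-rename (exts σ) (ext ρ) q) (sub-cong (exts-ext σ ρ) q))
  sub-rename σ ρ nil          = refl
  sub-rename σ ρ (plus p q)   = cong₂ plus (sub-rename σ ρ p) (sub-rename σ ρ q)
  sub-rename σ ρ (out p)      = cong out (sub-rename σ ρ p)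
  sub-rename σ ρ (unfold p q) =
    cong₂ unfold (sub-rename σ ρ p) (P.trans (sub-rename (exts σ) (ext ρ) q) (sub-cong (exts-ext σ ρ) q))

  ext-exts : (ρ : Ren Δ Θ) (σ : Sub Γ Δ) {A : Type} (v : (Γ ,, B) ∋ A) →
             rename (ext ρ) (exts σ v) ≡ exts (λ w → rename ρ (σ w)) v
  ext-exts ρ σ here      = refl
  ext-exts ρ σ (there v) = P.trans (rename-rename (ext ρ) there (σ v)) (P.sym (rename-rename there ρ (σ v)))

  rename-sub : (ρ : Ren Δ Θ) (σ : Sub Γ Δ) (t : Tm Γ A) → rename ρ (sub σ t) ≡ sub (λ v → rename ρ (σ v)) t
  rename-sub ρ σ (var v)      = refl
  rename-sub ρ σ (app f t)    = cong (app f) (rename-sub ρ σ t)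
  rename-sub ρ σ star         = refl
  rename-sub ρ σ (pair t u)   = cong₂ pair (rename-sub ρ σ t) (rename-sub ρ σ u)
  rename-sub ρ σ (fst t)      = cong fst (rename-sub ρ σ t)
  rename-sub ρ σ (snd t)      = cong snd (rename-sub ρ σ t)
  rename-sub ρ σ (inl t)      = cong inl (rename-sub ρ σ t)
  rename-sub ρ σ (inr t)      = cong inr (rename-sub ρ σ t)
  rename-sub ρ σ (case s t u) = cong₃ case (rename-sub ρ σ s) (under t) (under u)
    where
      under : ∀ {B C} (t : Tm (_ ,, B) C) → rename (ext ρ) (sub (exts σ) t) ≡ sub (exts (λ v → rename ρ (σ v))) t
      under t = P.trans (rename-sub (ext ρ) (exts σ) t) (sub-cong (ext-exts ρ σ) t)
  rename-sub ρ σ (ret t)      = cong ret (rename-sub ρ σ t)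
  rename-sub ρ σ (bind p q)   =
    cong₂ bind (rename-sub ρ σ p) (P.trans (rename-sub (ext ρ) (exts σ) q) (sub-cong (ext-exts ρ σ) q))
  rename-sub ρ σ nil          = refl
  rename-sub ρ σ (plus p q)   = cong₂ plus (rename-sub ρ σ p) (rename-sub ρ σ q)
  rename-sub ρ σ (out p)      = cong out (rename-sub ρ σ p)
  rename-sub ρ σ (unfold p q) =
    cong₂ unfold (rename-sub ρ σ p) (P.trans (rename-sub (ext ρ) (exts σ) q) (sub-cong (ext-exts ρ σ) q))

  exts-exts : (σ : Sub Δ Θ) (σ' : Sub Γ Δ) {A : Type} (v : (Γ ,, B) ∋ A) →
              sub (exts σ) (exts σ' v) ≡ exts (λ w → sub σ (σ' w)) v
  exts-exts σ σ' here      = refl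
  exts-exts σ σ' (there v) = P.trans (sub-rename (exts σ) there (σ' v)) (P.sym (rename-sub there σ (σ' v)))

  sub-sub : (σ : Sub Δ Θ) (σ' : Sub Γ Δ) (t : Tm Γ A) → sub σ (sub σ' t) ≡ sub (λ v → sub σ (σ' v)) t
  sub-sub σ σ' (var v)      = refl
  sub-sub σ σ' (app f t)    = cong (app f) (sub-sub σ σ' t)
  sub-sub σ σ' star         = refl
  sub-sub σ σ' (pair t u)   = cong₂ pair (sub-sub σ σ' t) (sub-sub σ σ' u)
  sub-sub σ σ' (fst t)      = cong fst (sub-sub σ σ' t)
  sub-sub σ σ' (snd t)      = cong snd (sub-sub σ σ' t)
  sub-sub σ σ' (inl t)      = cong inl (sub-sub σ σ' t)
  sub-sub σ σ' (inr t)      = cong inr (sub-sub σ σ' t)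
  sub-sub σ σ' (case s t u) = cong₃ case (sub-sub σ σ' s) (under t) (under u)
    where
      under : ∀ {B C} (t : Tm (_ ,, B) C) → sub (exts σ) (sub (exts σ') t) ≡ sub (exts (λ v → sub σ (σ' v))) t
      under t = P.trans (sub-sub (exts σ) (exts σ') t) (sub-cong (exts-exts σ σ') t)
  sub-sub σ σ' (ret t)      = cong ret (sub-sub σ σ' t)
  sub-sub σ σ' (bind p q)   =
    cong₂ bind (sub-sub σ σ' p) (P.trans (sub-sub (exts σ) (exts σ') q) (sub-cong (exts-exts σ σ') q))
  sub-sub σ σ' nil          = refl
  sub-sub σ σ' (plus p q)   = cong₂ plus (sub-sub σ σ' p) (sub-sub σ σ' q)
  sub-sub σ σ' (out p)      = cong out (sub-sub σ σ' p)
  sub-sub σ σ' (unfold p q) =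
    cong₂ unfold (sub-sub σ σ' p) (P.trans (sub-sub (exts σ) (exts σ') q) (sub-cong (exts-exts σ σ') q))

  var-ext : (ρ : Ren Γ Δ) {A : Type} (v : (Γ ,, B) ∋ A) → var (ext ρ v) ≡ exts (λ w → var (ρ w)) v
  var-ext ρ here      = refl
  var-ext ρ (there v) = refl

  rename≡sub : (ρ : Ren Γ Δ) (t : Tm Γ A) → rename ρ t ≡ sub (λ v → var (ρ v)) t
  rename≡sub ρ (var v)      = refl
  rename≡sub ρ (app f t)    = cong (app f) (rename≡sub ρ t)
  rename≡sub ρ star         = refl
  rename≡sub ρ (pair t u)   = cong₂ pair (rename≡sub ρ t) (rename≡sub ρ u)
  rename≡sub ρ (fst t)      = cong fst (rename≡sub ρ t)
  rename≡sub ρ (snd t)      = cong snd (rename≡sub ρ t)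
  rename≡sub ρ (inl t)      = cong inl (rename≡sub ρ t)
  rename≡sub ρ (inr t)      = cong inr (rename≡sub ρ t)
  rename≡sub ρ (case s t u) = cong₃ case (rename≡sub ρ s) (under t) (under u)
    where
      under : ∀ {B C} (t : Tm (_ ,, B) C) → rename (ext ρ) t ≡ sub (exts (λ v → var (ρ v))) t
      under t = P.trans (rename≡sub (ext ρ) t) (sub-cong (var-ext ρ) t)
  rename≡sub ρ (ret t)      = cong ret (rename≡sub ρ t)
  rename≡sub ρ (bind p q)   = cong₂ bind (rename≡sub ρ p) (P.trans (rename≡sub (ext ρ) q) (sub-cong (var-ext ρ) q))
  rename≡sub ρ nil          = refl
  rename≡sub ρ (plus p q)   = cong₂ plus (rename≡sub ρ p) (rename≡sub ρ q)
  rename≡sub ρ (out p)      = cong out (rename≡sub ρ p)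
  rename≡sub ρ (unfold p q) = cong₂ unfold (rename≡sub ρ p) (P.trans (rename≡sub (ext ρ) q) (sub-cong (var-ext ρ) q))

  exts-var : {A : Type} (v : (Γ ,, B) ∋ A) → exts var v ≡ var v
  exts-var here      = refl
  exts-var (there v) = refl

  sub-var : (t : Tm Γ A) → sub var t ≡ t
  sub-var (var v)      = refl
  sub-var (app f t)    = cong (app f) (sub-var t)
  sub-var star         = refl
  sub-var (pair t u)   = cong₂ pair (sub-var t) (sub-var u)
  sub-var (fst t)      = cong fst (sub-var t)
  sub-var (snd t)      = cong snd (sub-var t)
  sub-var (inl t)      = cong inl (sub-var t)
  sub-var (inr t)      = cong inr (sub-var t)
  sub-var (case s t u) = cong₃ case (sub-var s) (under t) (under u)
    where
      under : ∀ {B C} (t : Tm (_ ,, B) C) → sub (exts var) t ≡ t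
      under t = P.trans (sub-cong exts-var t) (sub-var t)
  sub-var (ret t)      = cong ret (sub-var t)
  sub-var (bind p q)   = cong₂ bind (sub-var p) (P.trans (sub-cong exts-var q) (sub-var q))
  sub-var nil          = refl
  sub-var (plus p q)   = cong₂ plus (sub-var p) (sub-var q)
  sub-var (out p)      = cong out (sub-var p)
  sub-var (unfold p q) = cong₂ unfold (sub-var p) (P.trans (sub-cong exts-var q) (sub-var q))

  singleSub : Tm Γ B → Sub (Γ ,, B) Γ
  singleSub u here      = u
  singleSub u (there v) = var v

  lastSub : Tm (Γ ,, E) C → Sub (Γ ,, C) (Γ ,, E)
  lastSub q here      = q
  lastSub q (there v) = var (there v)

  []≡sub : (t : Tm (Γ ,, B) A) (u : Tm Γ B) → t [ u ] ≡ sub (singleSub u) t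
  []≡sub t u = sub-cong (λ { here → refl ; (there v) → refl }) t

  []ᵂ≡sub : (t : Tm (Γ ,, C) A) (q : Tm (Γ ,, E) C) → t [ q ]ᵂ ≡ sub (lastSub q) t
  []ᵂ≡sub t q = sub-cong (λ { here → refl ; (there v) → refl }) t

module StructureProperties {o ℓ e} (S : Structure o ℓ e) where
  open Structure S public

  hom-setoid : ∀ {A B} → Setoid ℓ e
  hom-setoid {A} {B} = record { Carrier = Hom A B ; _≈_ = _≈_ ; isEquivalence = ≈-equiv }

  module HomReasoning {A B} = SetoidReasoning (hom-setoid {A} {B})
  open HomReasoning public

  module HomEquivalence {A B} = IsEquivalence (≈-equiv {A} {B})

  refl≈ : ∀ {A B} {f : Hom A B} → f ≈ f
  refl≈ = HomEquivalence.refl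
  sym≈ : ∀ {A B} {f g : Hom A B} → f ≈ g → g ≈ f
  sym≈ = HomEquivalence.sym
  trans≈ : ∀ {A B} {f g h : Hom A B} → f ≈ g → g ≈ h → f ≈ h
  trans≈ = HomEquivalence.trans

  infixr 4 _⟩∘⟨_ refl⟩∘⟨_
  infixl 5 _⟩∘⟨refl
  _⟩∘⟨_ : ∀ {A B C} {f h : Hom B C} {g i : Hom A B} → f ≈ h → g ≈ i → f ∘ g ≈ h ∘ i
  _⟩∘⟨_ = ∘-resp-≈
  refl⟩∘⟨_ : ∀ {A B C} {f : Hom B C} {g i : Hom A B} → g ≈ i → f ∘ g ≈ f ∘ i
  refl⟩∘⟨_ p = ∘-resp-≈ refl≈ p
  _⟩∘⟨refl : ∀ {A B C} {f h : Hom B C} {g : Hom A B} → f ≈ h → f ∘ g ≈ h ∘ g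
  p ⟩∘⟨refl = ∘-resp-≈ p refl≈

  sym-assoc : ∀ {A B C D} {f : Hom A B} {g : Hom B C} {h : Hom C D} → h ∘ (g ∘ f) ≈ (h ∘ g) ∘ f
  sym-assoc = sym≈ assoc

  pullˡ : ∀ {A B C D} {f : Hom A B} {g : Hom B C} {h : Hom C D} {k : Hom B D} →
          h ∘ g ≈ k → h ∘ (g ∘ f) ≈ k ∘ f
  pullˡ p = trans≈ sym-assoc (p ⟩∘⟨refl)

  ⟨⟩-cong : ∀ {X A B} {f f' : Hom X A} {g g' : Hom X B} → f ≈ f' → g ≈ g' → ⟨ f , g ⟩ ≈ ⟨ f' , g' ⟩
  ⟨⟩-cong p q = ⟨⟩-unique (trans≈ project₁ p) (trans≈ project₂ q)

  ⟨⟩∘ : ∀ {Y X A B} {f : Hom X A} {g : Hom X B} {h : Hom Y X} → ⟨ f , g ⟩ ∘ h ≈ ⟨ f ∘ h , g ∘ h ⟩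
  ⟨⟩∘ = ⟨⟩-unique (pullˡ project₁) (pullˡ project₂)

  ⟨⟩-η : ∀ {A B} → ⟨ π₁ , π₂ ⟩ ≈ id {A ⊗ B}
  ⟨⟩-η = sym≈ (⟨⟩-unique identityʳ identityʳ)

  ×∘⟨⟩ : ∀ {X A B A' B'} {f : Hom A A'} {g : Hom B B'} {a : Hom X A} {b : Hom X B} →
         (f ×ₘ g) ∘ ⟨ a , b ⟩ ≈ ⟨ f ∘ a , g ∘ b ⟩
  ×∘⟨⟩ = trans≈ ⟨⟩∘ (⟨⟩-cong (trans≈ assoc (refl⟩∘⟨ project₁)) (trans≈ assoc (refl⟩∘⟨ project₂)))

  ⟨id,⟩∘ : ∀ {Y X A} {s : Hom X A} {h : Hom Y X} → ⟨ id , s ⟩ ∘ h ≈ (h ×ₘ id) ∘ ⟨ id , s ∘ h ⟩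
  ⟨id,⟩∘ = trans≈ ⟨⟩∘ (trans≈ (⟨⟩-cong (trans≈ identityˡ (sym≈ identityʳ)) (sym≈ identityˡ)) (sym≈ ×∘⟨⟩))

  []-cong : ∀ {A B X} {f f' : Hom A X} {g g' : Hom B X} → f ≈ f' → g ≈ g' → [ f , g ] ≈ [ f' , g' ]
  []-cong p q = []-unique (trans≈ inject₁ p) (trans≈ inject₂ q)

  ∘[] : ∀ {A B X Y} {f : Hom A X} {g : Hom B X} {h : Hom X Y} → h ∘ [ f , g ] ≈ [ h ∘ f , h ∘ g ]
  ∘[] = []-unique (trans≈ assoc (refl⟩∘⟨ inject₁)) (trans≈ assoc (refl⟩∘⟨ inject₂))

  []∘+ : ∀ {A B A' B' X} {f : Hom A' X} {g : Hom B' X} {a : Hom A A'} {b : Hom B B'} →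
         [ f , g ] ∘ (a +ₘ b) ≈ [ f ∘ a , g ∘ b ]
  []∘+ = trans≈ ∘[] ([]-cong (pullˡ inject₁) (pullˡ inject₂))

  +∘i₁∘ : ∀ {W A B A' B'} {f : Hom A A'} {g : Hom B B'} {x : Hom W A} → (f +ₘ g) ∘ (i₁ ∘ x) ≈ i₁ ∘ (f ∘ x)
  +∘i₁∘ = trans≈ (pullˡ inject₁) assoc
  +∘i₂∘ : ∀ {W A B A' B'} {f : Hom A A'} {g : Hom B B'} {x : Hom W B} → (f +ₘ g) ∘ (i₂ ∘ x) ≈ i₂ ∘ (g ∘ x)
  +∘i₂∘ = trans≈ (pullˡ inject₂) assoc

  +-cong : ∀ {A B A' B'} {f f' : Hom A A'} {g g' : Hom B B'} → f ≈ f' → g ≈ g' → (f +ₘ g) ≈ (f' +ₘ g')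
  +-cong p q = []-cong (refl⟩∘⟨ p) (refl⟩∘⟨ q)

  +-∘ : ∀ {A B A' B' A'' B''} {f : Hom A' A''} {g : Hom B' B''} {h : Hom A A'} {k : Hom B B'} →
        (f +ₘ g) ∘ (h +ₘ k) ≈ ((f ∘ h) +ₘ (g ∘ k))
  +-∘ = trans≈ ∘[] ([]-cong (trans≈ (pullˡ inject₁) assoc) (trans≈ (pullˡ inject₂) assoc))

  id⊗i₁ : ∀ {X Y Z} → Hom (X ⊗ Y) (X ⊗ (Y ⊕ Z))
  id⊗i₁ = ⟨ π₁ , i₁ ∘ π₂ ⟩
  id⊗i₂ : ∀ {X Y Z} → Hom (X ⊗ Z) (X ⊗ (Y ⊕ Z))
  id⊗i₂ = ⟨ π₁ , i₂ ∘ π₂ ⟩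

  dist⁻¹ : ∀ {X Y Z} → Hom ((X ⊗ Y) ⊕ (X ⊗ Z)) (X ⊗ (Y ⊕ Z))
  dist⁻¹ = [ id⊗i₁ , id⊗i₂ ]

  dist∘id⊗i₁ : ∀ {X Y Z} → dist ∘ id⊗i₁ {X} {Y} {Z} ≈ i₁
  dist∘id⊗i₁ = trans≈ (refl⟩∘⟨ sym≈ inject₁) (trans≈ sym-assoc (trans≈ (dist∘can ⟩∘⟨refl) identityˡ))
  dist∘id⊗i₂ : ∀ {X Y Z} → dist ∘ id⊗i₂ {X} {Y} {Z} ≈ i₂
  dist∘id⊗i₂ = trans≈ (refl⟩∘⟨ sym≈ inject₂) (trans≈ sym-assoc (trans≈ (dist∘can ⟩∘⟨refl) identityˡ))

  id⊗i₁∘ : ∀ {W X Y Z} {a : Hom W X} {b : Hom W Y} → id⊗i₁ {Z = Z} ∘ ⟨ a , b ⟩ ≈ ⟨ a , i₁ ∘ b ⟩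
  id⊗i₁∘ = trans≈ ⟨⟩∘ (⟨⟩-cong project₁ (trans≈ assoc (refl⟩∘⟨ project₂)))
  id⊗i₂∘ : ∀ {W X Y Z} {a : Hom W X} {b : Hom W Z} → id⊗i₂ {Y = Y} ∘ ⟨ a , b ⟩ ≈ ⟨ a , i₂ ∘ b ⟩
  id⊗i₂∘ = trans≈ ⟨⟩∘ (⟨⟩-cong project₁ (trans≈ assoc (refl⟩∘⟨ project₂)))

  dist-i₁ : ∀ {W X Y Z} {a : Hom W X} {b : Hom W Y} → dist {X} {Y} {Z} ∘ ⟨ a , i₁ ∘ b ⟩ ≈ i₁ ∘ ⟨ a , b ⟩
  dist-i₁ = trans≈ (refl⟩∘⟨ sym≈ id⊗i₁∘) (pullˡ dist∘id⊗i₁)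
  dist-i₂ : ∀ {W X Y Z} {a : Hom W X} {b : Hom W Z} → dist {X} {Y} {Z} ∘ ⟨ a , i₂ ∘ b ⟩ ≈ i₂ ∘ ⟨ a , b ⟩
  dist-i₂ = trans≈ (refl⟩∘⟨ sym≈ id⊗i₂∘) (pullˡ dist∘id⊗i₂)

  dist-ext : ∀ {X Y Z W} {f g : Hom (X ⊗ (Y ⊕ Z)) W} →
             f ∘ id⊗i₁ ≈ g ∘ id⊗i₁ → f ∘ id⊗i₂ ≈ g ∘ id⊗i₂ → f ≈ g
  dist-ext {f = f} {g} p q = begin
    f                      ≈⟨ sym≈ identityʳ ⟩
    f ∘ id                 ≈⟨ refl⟩∘⟨ sym≈ can∘dist ⟩
    f ∘ (dist⁻¹ ∘ dist)    ≈⟨ sym-assoc ⟩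
    (f ∘ dist⁻¹) ∘ dist    ≈⟨ trans≈ ∘[] ([]-cong p q) ⟩∘⟨refl ⟩
    [ g ∘ id⊗i₁ , g ∘ id⊗i₂ ] ∘ dist ≈⟨ sym≈ ∘[] ⟩∘⟨refl ⟩
    (g ∘ dist⁻¹) ∘ dist    ≈⟨ assoc ⟩
    g ∘ (dist⁻¹ ∘ dist)    ≈⟨ refl⟩∘⟨ can∘dist ⟩
    g ∘ id                 ≈⟨ identityʳ ⟩
    g                      ∎

  case-i₁ : ∀ {W X Y Z C} {f : Hom (X ⊗ Y) C} {g : Hom (X ⊗ Z) C} {a : Hom W X} {b : Hom W Y} →
            [ f , g ] ∘ (dist ∘ ⟨ a , i₁ ∘ b ⟩) ≈ f ∘ ⟨ a , b ⟩
  case-i₁ = trans≈ (refl⟩∘⟨ dist-i₁) (pullˡ inject₁)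
  case-i₂ : ∀ {W X Y Z C} {f : Hom (X ⊗ Y) C} {g : Hom (X ⊗ Z) C} {a : Hom W X} {b : Hom W Z} →
            [ f , g ] ∘ (dist ∘ ⟨ a , i₂ ∘ b ⟩) ≈ g ∘ ⟨ a , b ⟩
  case-i₂ = trans≈ (refl⟩∘⟨ dist-i₂) (pullˡ inject₂)

  dist-natural : ∀ {X X' Y Z} {h : Hom X X'} →
                 dist {X'} {Y} {Z} ∘ (h ×ₘ id) ≈ ((h ×ₘ id) +ₘ (h ×ₘ id)) ∘ dist
  dist-natural {h = h} = dist-ext
    (begin
      (dist ∘ (h ×ₘ id)) ∘ id⊗i₁   ≈⟨ trans≈ assoc (refl⟩∘⟨ trans≈ ×∘⟨⟩ (⟨⟩-cong refl≈ identityˡ)) ⟩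
      dist ∘ ⟨ h ∘ π₁ , i₁ ∘ π₂ ⟩  ≈⟨ trans≈ dist-i₁ (refl⟩∘⟨ ⟨⟩-cong refl≈ (sym≈ identityˡ)) ⟩
      i₁ ∘ (h ×ₘ id)               ≈⟨ sym≈ (trans≈ assoc (trans≈ (refl⟩∘⟨ dist∘id⊗i₁) inject₁)) ⟩
      (((h ×ₘ id) +ₘ (h ×ₘ id)) ∘ dist) ∘ id⊗i₁ ∎)
    (begin
      (dist ∘ (h ×ₘ id)) ∘ id⊗i₂   ≈⟨ trans≈ assoc (refl⟩∘⟨ trans≈ ×∘⟨⟩ (⟨⟩-cong refl≈ identityˡ)) ⟩
      dist ∘ ⟨ h ∘ π₁ , i₂ ∘ π₂ ⟩  ≈⟨ trans≈ dist-i₂ (refl⟩∘⟨ ⟨⟩-cong refl≈ (sym≈ identityˡ)) ⟩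
      i₂ ∘ (h ×ₘ id)               ≈⟨ sym≈ (trans≈ assoc (trans≈ (refl⟩∘⟨ dist∘id⊗i₂) inject₂)) ⟩
      (((h ×ₘ id) +ₘ (h ×ₘ id)) ∘ dist) ∘ id⊗i₂ ∎)

  Tmap-cong : ∀ {A B} {f g : Hom A B} → f ≈ g → Tmap f ≈ Tmap g
  Tmap-cong p = ⋆-resp-≈ (refl⟩∘⟨ p)

  Tmap-id : ∀ {A} → Tmap (id {A}) ≈ id
  Tmap-id = trans≈ (⋆-resp-≈ identityʳ) η-⋆

  ⋆∘Tmap : ∀ {A B C} {f : Hom B (T C)} {g : Hom A B} → f ⋆ ∘ Tmap g ≈ (f ∘ g) ⋆
  ⋆∘Tmap = trans≈ (sym≈ ⋆-assoc) (⋆-resp-≈ (trans≈ sym-assoc (⋆-η ⟩∘⟨refl)))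

  Tmap-∘ : ∀ {A B C} {f : Hom A B} {g : Hom B C} → Tmap (g ∘ f) ≈ Tmap g ∘ Tmap f
  Tmap-∘ = trans≈ (⋆-resp-≈ sym-assoc) (sym≈ ⋆∘Tmap)

  Tmap-pull : ∀ {X A B C} {f : Hom A B} {g : Hom B C} {h : Hom X (T A)} →
              Tmap g ∘ (Tmap f ∘ h) ≈ Tmap (g ∘ f) ∘ h
  Tmap-pull = pullˡ (sym≈ Tmap-∘)

  Tmap-pull₃ : ∀ {X A B C D} {f : Hom C D} {g : Hom B C} {k : Hom A B} {z : Hom X (T A)} →
               Tmap f ∘ (Tmap g ∘ (Tmap k ∘ z)) ≈ Tmap (f ∘ (g ∘ k)) ∘ z
  Tmap-pull₃ = trans≈ (refl⟩∘⟨ Tmap-pull) Tmap-pull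

  ⋆∘η∘ : ∀ {X A B} {f : Hom A (T B)} {a : Hom X A} → f ⋆ ∘ (η ∘ a) ≈ f ∘ a
  ⋆∘η∘ = pullˡ ⋆-η

  ⟨,⟩-as-id× : ∀ {X A B B'} {g : Hom B B'} {a : Hom X A} {b : Hom X B} → ⟨ a , g ∘ b ⟩ ≈ (id ×ₘ g) ∘ ⟨ a , b ⟩
  ⟨,⟩-as-id× = trans≈ (⟨⟩-cong (sym≈ identityˡ) refl≈) (sym≈ ×∘⟨⟩)

  τ-naturalˡ : ∀ {A A' B} {f : Hom A A'} → τ {B = B} ∘ (f ×ₘ id) ≈ Tmap (f ×ₘ id) ∘ τ
  τ-naturalˡ = trans≈ (refl⟩∘⟨ ⟨⟩-cong refl≈ (sym≈ Tmap-id ⟩∘⟨refl)) τ-natural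

  τ⟨f∘⟩ : ∀ {X A A' B} {f : Hom A A'} {a : Hom X A} {b : Hom X (T B)} →
          τ ∘ ⟨ f ∘ a , b ⟩ ≈ Tmap (f ×ₘ id) ∘ (τ ∘ ⟨ a , b ⟩)
  τ⟨f∘⟩ = trans≈ (refl⟩∘⟨ trans≈ (⟨⟩-cong refl≈ (sym≈ identityˡ)) (sym≈ ×∘⟨⟩))
          (trans≈ sym-assoc (trans≈ (τ-naturalˡ ⟩∘⟨refl) assoc))

  τ⟨η∘⟩ : ∀ {X A B} {a : Hom X A} {b : Hom X B} → τ ∘ ⟨ a , η ∘ b ⟩ ≈ η ∘ ⟨ a , b ⟩
  τ⟨η∘⟩ = trans≈ (refl⟩∘⟨ ⟨,⟩-as-id×) (pullˡ τ-η)

  τ⟨⋆∘⟩ : ∀ {X A B C} {f : Hom B (T C)} {a : Hom X A} {b : Hom X (T B)} →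
          τ ∘ ⟨ a , f ⋆ ∘ b ⟩ ≈ (τ ∘ (id ×ₘ f)) ⋆ ∘ (τ ∘ ⟨ a , b ⟩)
  τ⟨⋆∘⟩ = trans≈ (refl⟩∘⟨ ⟨,⟩-as-id×) (trans≈ sym-assoc (trans≈ (τ-⋆ ⟩∘⟨refl) assoc))

  Tπ₂∘τ : ∀ {A B} → Tmap π₂ ∘ τ {A} {B} ≈ π₂
  Tπ₂∘τ = begin
    Tmap π₂ ∘ τ                      ≈⟨ Tmap-cong (sym≈ (trans≈ project₂ identityˡ)) ⟩∘⟨refl ⟩
    Tmap (π₂ ∘ (! ×ₘ id)) ∘ τ        ≈⟨ sym≈ Tmap-pull ⟩
    Tmap π₂ ∘ (Tmap (! ×ₘ id) ∘ τ)   ≈⟨ refl⟩∘⟨ sym≈ τ-naturalˡ ⟩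
    Tmap π₂ ∘ (τ ∘ (! ×ₘ id))        ≈⟨ pullˡ τ-unit ⟩
    π₂ ∘ (! ×ₘ id)                   ≈⟨ trans≈ project₂ identityˡ ⟩
    π₂                               ∎

  τ⟨δ⟩ : ∀ {X A B} {a : Hom X A} → τ ∘ ⟨ a , δ {B} ∘ ! ⟩ ≈ δ ∘ !
  τ⟨δ⟩ = trans≈ (refl⟩∘⟨ ⟨,⟩-as-id×) (trans≈ (pullˡ τ-δ) (trans≈ assoc (refl⟩∘⟨ !-unique _)))

  τ⟨ϖ⟩ : ∀ {X A B} {a : Hom X A} {b c : Hom X (T B)} →
         τ ∘ ⟨ a , ϖ ∘ ⟨ b , c ⟩ ⟩ ≈ ϖ ∘ ⟨ τ ∘ ⟨ a , b ⟩ , τ ∘ ⟨ a , c ⟩ ⟩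
  τ⟨ϖ⟩ {a = a} {b} {c} = begin
    τ ∘ ⟨ a , ϖ ∘ ⟨ b , c ⟩ ⟩                                    ≈⟨ refl⟩∘⟨ ⟨,⟩-as-id× ⟩
    τ ∘ ((id ×ₘ ϖ) ∘ ⟨ a , ⟨ b , c ⟩ ⟩)                          ≈⟨ pullˡ τ-ϖ ⟩
    (ϖ ∘ ⟨ τ ∘ (id ×ₘ π₁) , τ ∘ (id ×ₘ π₂) ⟩) ∘ ⟨ a , ⟨ b , c ⟩ ⟩ ≈⟨ trans≈ assoc (refl⟩∘⟨ ⟨⟩∘) ⟩
    ϖ ∘ ⟨ (τ ∘ (id ×ₘ π₁)) ∘ ⟨ a , ⟨ b , c ⟩ ⟩ , (τ ∘ (id ×ₘ π₂)) ∘ ⟨ a , ⟨ b , c ⟩ ⟩ ⟩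
      ≈⟨ refl⟩∘⟨ ⟨⟩-cong (trans≈ assoc (refl⟩∘⟨ trans≈ ×∘⟨⟩ (⟨⟩-cong identityˡ project₁)))
                         (trans≈ assoc (refl⟩∘⟨ trans≈ ×∘⟨⟩ (⟨⟩-cong identityˡ project₂))) ⟩
    ϖ ∘ ⟨ τ ∘ ⟨ a , b ⟩ , τ ∘ ⟨ a , c ⟩ ⟩                        ∎

  ⋆∘ϖ : ∀ {X A B} {f : Hom A (T B)} {a b : Hom X (T A)} → f ⋆ ∘ (ϖ ∘ ⟨ a , b ⟩) ≈ ϖ ∘ ⟨ f ⋆ ∘ a , f ⋆ ∘ b ⟩
  ⋆∘ϖ = trans≈ (pullˡ ⋆-ϖ) (trans≈ assoc (refl⟩∘⟨ trans≈ ⟨⟩∘ (⟨⟩-cong (trans≈ assoc (refl⟩∘⟨ project₁))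
                                                                       (trans≈ assoc (refl⟩∘⟨ project₂)))))

  coit-cong : ∀ {X A} {f g : Hom X (T (X ⊕ A))} → f ≈ g → coit f ≈ coit g
  coit-cong p = coit-unique (trans≈ coit-hom (refl⟩∘⟨ p))

  coit-fusion : ∀ {X Y A} {f : Hom X (T (X ⊕ A))} {g : Hom Y (T (Y ⊕ A))} {k : Hom Y X} →
                f ∘ k ≈ Tmap (k +ₘ id) ∘ g → coit f ∘ k ≈ coit g
  coit-fusion {f = f} {g} {k} p = coit-unique (begin
    outC ∘ (coit f ∘ k)                         ≈⟨ pullˡ coit-hom ⟩
    (Tmap (coit f +ₘ id) ∘ f) ∘ k               ≈⟨ trans≈ assoc (refl⟩∘⟨ p) ⟩
    Tmap (coit f +ₘ id) ∘ (Tmap (k +ₘ id) ∘ g)  ≈⟨ Tmap-pull ⟩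
    Tmap ((coit f +ₘ id) ∘ (k +ₘ id)) ∘ g       ≈⟨ Tmap-cong (trans≈ +-∘ (+-cong refl≈ identityˡ)) ⟩∘⟨refl ⟩
    Tmap ((coit f ∘ k) +ₘ id) ∘ g               ∎)

  Rmap-coit : ∀ {X A B} {f : Hom X (T (X ⊕ A))} {k : Hom A B} → Rmap k ∘ coit f ≈ coit (Tmap (id +ₘ k) ∘ f)
  Rmap-coit {f = f} {k} = coit-fusion (begin
    (Tmap (id +ₘ k) ∘ outC) ∘ coit f            ≈⟨ trans≈ assoc (refl⟩∘⟨ coit-hom) ⟩
    Tmap (id +ₘ k) ∘ (Tmap (coit f +ₘ id) ∘ f)  ≈⟨ Tmap-pull ⟩
    Tmap ((id +ₘ k) ∘ (coit f +ₘ id)) ∘ f       ≈⟨ Tmap-cong (trans≈ +-∘ (trans≈ (+-cong identityˡ identityʳ)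
                                                     (sym≈ (trans≈ +-∘ (+-cong identityʳ identityˡ))))) ⟩∘⟨refl ⟩
    Tmap ((coit f +ₘ id) ∘ (id +ₘ k)) ∘ f       ≈⟨ sym≈ Tmap-pull ⟩
    Tmap (coit f +ₘ id) ∘ (Tmap (id +ₘ k) ∘ f)  ∎)

  caseₘ : ∀ {G A B C} → Hom G (A ⊕ B) → Hom (G ⊗ A) C → Hom (G ⊗ B) C → Hom G C
  caseₘ s t u = [ t , u ] ∘ (dist ∘ ⟨ id , s ⟩)

  bindₘ : ∀ {G A B} → Hom G (T A) → Hom (G ⊗ A) (T B) → Hom G (T B)
  bindₘ p q = q ⋆ ∘ (τ ∘ ⟨ id , p ⟩)

  unfoldₘ : ∀ {G A B} → Hom G A → Hom (G ⊗ A) (T (A ⊕ B)) → Hom G (R B)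
  unfoldₘ p q = Rmap π₂ ∘ (coit (Tmap dist ∘ (τ ∘ ⟨ π₁ , q ⟩)) ∘ ⟨ id , p ⟩)

  -- The coalgebra on G ⊗ A that unfolds q while keeping the context G
  unfoldCoalg : ∀ {G A B} → Hom (G ⊗ A) (T (A ⊕ B)) → Hom (G ⊗ A) (T ((G ⊗ A) ⊕ B))
  unfoldCoalg q = Tmap (id +ₘ π₂) ∘ (Tmap dist ∘ (τ ∘ ⟨ π₁ , q ⟩))

  unfoldₘ-coit : ∀ {G A B} {p : Hom G A} {q : Hom (G ⊗ A) (T (A ⊕ B))} →
                 unfoldₘ p q ≈ coit (unfoldCoalg q) ∘ ⟨ id , p ⟩
  unfoldₘ-coit = pullˡ Rmap-coit

  caseₘ-cong : ∀ {G A B C} {s s' : Hom G (A ⊕ B)} {t t' : Hom (G ⊗ A) C} {u u' : Hom (G ⊗ B) C} →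
               s ≈ s' → t ≈ t' → u ≈ u' → caseₘ s t u ≈ caseₘ s' t' u'
  caseₘ-cong ps pt pu = []-cong pt pu ⟩∘⟨ refl⟩∘⟨ ⟨⟩-cong refl≈ ps

  bindₘ-cong : ∀ {G A B} {p p' : Hom G (T A)} {q q' : Hom (G ⊗ A) (T B)} →
               p ≈ p' → q ≈ q' → bindₘ p q ≈ bindₘ p' q'
  bindₘ-cong pp pq = ⋆-resp-≈ pq ⟩∘⟨ refl⟩∘⟨ ⟨⟩-cong refl≈ pp

  unfoldₘ-cong : ∀ {G A B} {p p' : Hom G A} {q q' : Hom (G ⊗ A) (T (A ⊕ B))} →
                 p ≈ p' → q ≈ q' → unfoldₘ p q ≈ unfoldₘ p' q'
  unfoldₘ-cong pp pq = refl⟩∘⟨ coit-cong (refl⟩∘⟨ refl⟩∘⟨ ⟨⟩-cong refl≈ pq) ⟩∘⟨ ⟨⟩-cong refl≈ pp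

  -- The semantic counterpart of substitution

  module ContextNaturality {X Y : Obj} (h : Hom Y X) where

    ∘-natural : ∀ {A B} {k : Hom A B} {t : Hom X A} {t' : Hom Y A} → t' ≈ t ∘ h → k ∘ t' ≈ (k ∘ t) ∘ h
    ∘-natural p = trans≈ (refl⟩∘⟨ p) sym-assoc

    !-natural : ! ≈ ! ∘ h
    !-natural = sym≈ (!-unique _)

    ⟨⟩-natural : ∀ {A B} {t : Hom X A} {t' : Hom Y A} {u : Hom X B} {u' : Hom Y B} →
                 t' ≈ t ∘ h → u' ≈ u ∘ h → ⟨ t' , u' ⟩ ≈ ⟨ t , u ⟩ ∘ h
    ⟨⟩-natural p q = trans≈ (⟨⟩-cong p q) (sym≈ ⟨⟩∘)

    δ!-natural : ∀ {A} → δ {A} ∘ ! ≈ (δ ∘ !) ∘ h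
    δ!-natural = ∘-natural !-natural

    ϖ⟨⟩-natural : ∀ {A} {t u : Hom X (T A)} {t' u' : Hom Y (T A)} →
                 t' ≈ t ∘ h → u' ≈ u ∘ h → ϖ ∘ ⟨ t' , u' ⟩ ≈ (ϖ ∘ ⟨ t , u ⟩) ∘ h
    ϖ⟨⟩-natural p q = ∘-natural (⟨⟩-natural p q)

    ⟨id,⟩∘h : ∀ {A} {s : Hom X A} {s' : Hom Y A} → s' ≈ s ∘ h → ⟨ id , s ⟩ ∘ h ≈ (h ×ₘ id) ∘ ⟨ id , s' ⟩
    ⟨id,⟩∘h ps = trans≈ ⟨id,⟩∘ (refl⟩∘⟨ ⟨⟩-cong refl≈ (sym≈ ps))

    caseₘ-natural : ∀ {A B C} {s : Hom X (A ⊕ B)} {s' : Hom Y (A ⊕ B)} {t : Hom (X ⊗ A) C}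
                    {t' : Hom (Y ⊗ A) C} {u : Hom (X ⊗ B) C} {u' : Hom (Y ⊗ B) C} →
                    s' ≈ s ∘ h → t' ≈ t ∘ (h ×ₘ id) → u' ≈ u ∘ (h ×ₘ id) →
                    caseₘ s' t' u' ≈ caseₘ s t u ∘ h
    caseₘ-natural {s = s} {s'} {t} {t'} {u} {u'} ps pt pu = sym≈ (begin
      ([ t , u ] ∘ (dist ∘ ⟨ id , s ⟩)) ∘ h                          ≈⟨ trans≈ assoc (refl⟩∘⟨ assoc) ⟩
      [ t , u ] ∘ (dist ∘ (⟨ id , s ⟩ ∘ h))                          ≈⟨ refl⟩∘⟨ refl⟩∘⟨ ⟨id,⟩∘h ps ⟩
      [ t , u ] ∘ (dist ∘ ((h ×ₘ id) ∘ ⟨ id , s' ⟩))                 ≈⟨ refl⟩∘⟨ trans≈ (pullˡ dist-natural) assoc ⟩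
      [ t , u ] ∘ (((h ×ₘ id) +ₘ (h ×ₘ id)) ∘ (dist ∘ ⟨ id , s' ⟩)) ≈⟨ pullˡ []∘+ ⟩
      [ t ∘ (h ×ₘ id) , u ∘ (h ×ₘ id) ] ∘ (dist ∘ ⟨ id , s' ⟩)      ≈⟨ []-cong (sym≈ pt) (sym≈ pu) ⟩∘⟨refl ⟩
      [ t' , u' ] ∘ (dist ∘ ⟨ id , s' ⟩)                             ∎)

    bindₘ-natural : ∀ {A B} {p : Hom X (T A)} {p' : Hom Y (T A)} {q : Hom (X ⊗ A) (T B)}
                    {q' : Hom (Y ⊗ A) (T B)} →
                    p' ≈ p ∘ h → q' ≈ q ∘ (h ×ₘ id) → bindₘ p' q' ≈ bindₘ p q ∘ h
    bindₘ-natural {p = p} {p'} {q} {q'} pp pq = sym≈ (begin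
      (q ⋆ ∘ (τ ∘ ⟨ id , p ⟩)) ∘ h                       ≈⟨ trans≈ assoc (refl⟩∘⟨ assoc) ⟩
      q ⋆ ∘ (τ ∘ (⟨ id , p ⟩ ∘ h))                       ≈⟨ refl⟩∘⟨ refl⟩∘⟨ ⟨id,⟩∘h pp ⟩
      q ⋆ ∘ (τ ∘ ((h ×ₘ id) ∘ ⟨ id , p' ⟩))              ≈⟨ refl⟩∘⟨ trans≈ (pullˡ τ-naturalˡ) assoc ⟩
      q ⋆ ∘ (Tmap (h ×ₘ id) ∘ (τ ∘ ⟨ id , p' ⟩))         ≈⟨ pullˡ ⋆∘Tmap ⟩
      (q ∘ (h ×ₘ id)) ⋆ ∘ (τ ∘ ⟨ id , p' ⟩)              ≈⟨ ⋆-resp-≈ (sym≈ pq) ⟩∘⟨refl ⟩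
      q' ⋆ ∘ (τ ∘ ⟨ id , p' ⟩)                           ∎)

    unfoldCoalg-natural : ∀ {A B} {q : Hom (X ⊗ A) (T (A ⊕ B))} {q' : Hom (Y ⊗ A) (T (A ⊕ B))} →
                          q' ≈ q ∘ (h ×ₘ id) → unfoldCoalg q ∘ (h ×ₘ id) ≈ Tmap ((h ×ₘ id) +ₘ id) ∘ unfoldCoalg q'
    unfoldCoalg-natural {q = q} {q'} pq = begin
      unfoldCoalg q ∘ (h ×ₘ id)
        ≈⟨ trans≈ assoc (refl⟩∘⟨ trans≈ assoc (refl⟩∘⟨ assoc)) ⟩
      Tmap (id +ₘ π₂) ∘ (Tmap dist ∘ (τ ∘ (⟨ π₁ , q ⟩ ∘ (h ×ₘ id))))
        ≈⟨ refl⟩∘⟨ refl⟩∘⟨ refl⟩∘⟨ trans≈ ⟨⟩∘ (⟨⟩-cong project₁ (sym≈ pq)) ⟩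
      Tmap (id +ₘ π₂) ∘ (Tmap dist ∘ (τ ∘ ⟨ h ∘ π₁ , q' ⟩))
        ≈⟨ trans≈ (refl⟩∘⟨ refl⟩∘⟨ τ⟨f∘⟩) Tmap-pull₃ ⟩
      Tmap ((id +ₘ π₂) ∘ (dist ∘ (h ×ₘ id))) ∘ (τ ∘ ⟨ π₁ , q' ⟩)
        ≈⟨ Tmap-cong reorder ⟩∘⟨refl ⟩
      Tmap (((h ×ₘ id) +ₘ id) ∘ ((id +ₘ π₂) ∘ dist)) ∘ (τ ∘ ⟨ π₁ , q' ⟩)
        ≈⟨ sym≈ Tmap-pull₃ ⟩
      Tmap ((h ×ₘ id) +ₘ id) ∘ unfoldCoalg q' ∎
      where
        reorder : (id +ₘ π₂) ∘ (dist ∘ (h ×ₘ id)) ≈ ((h ×ₘ id) +ₘ id) ∘ ((id +ₘ π₂) ∘ dist)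
        reorder = begin
          (id +ₘ π₂) ∘ (dist ∘ (h ×ₘ id))                   ≈⟨ refl⟩∘⟨ dist-natural ⟩
          (id +ₘ π₂) ∘ (((h ×ₘ id) +ₘ (h ×ₘ id)) ∘ dist)    ≈⟨ pullˡ +-∘ ⟩
          ((id ∘ (h ×ₘ id)) +ₘ (π₂ ∘ (h ×ₘ id))) ∘ dist     ≈⟨ +-cong identityˡ (trans≈ project₂ identityˡ) ⟩∘⟨refl ⟩
          ((h ×ₘ id) +ₘ π₂) ∘ dist                          ≈⟨ sym≈ (+-cong identityʳ identityˡ) ⟩∘⟨refl ⟩
          (((h ×ₘ id) ∘ id) +ₘ (id ∘ π₂)) ∘ dist            ≈⟨ sym≈ (pullˡ +-∘) ⟩
          ((h ×ₘ id) +ₘ id) ∘ ((id +ₘ π₂) ∘ dist)           ∎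

    unfoldₘ-natural : ∀ {A B} {p : Hom X A} {p' : Hom Y A} {q : Hom (X ⊗ A) (T (A ⊕ B))}
                      {q' : Hom (Y ⊗ A) (T (A ⊕ B))} →
                      p' ≈ p ∘ h → q' ≈ q ∘ (h ×ₘ id) → unfoldₘ p' q' ≈ unfoldₘ p q ∘ h
    unfoldₘ-natural {p = p} {p'} {q} {q'} pp pq = begin
      unfoldₘ p' q'                                ≈⟨ unfoldₘ-coit ⟩
      coit (unfoldCoalg q') ∘ ⟨ id , p' ⟩          ≈⟨ sym≈ (coit-fusion (unfoldCoalg-natural pq)) ⟩∘⟨refl ⟩
      (coit (unfoldCoalg q) ∘ (h ×ₘ id)) ∘ ⟨ id , p' ⟩ ≈⟨ trans≈ assoc (refl⟩∘⟨ sym≈ (⟨id,⟩∘h pp)) ⟩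
      coit (unfoldCoalg q) ∘ (⟨ id , p ⟩ ∘ h)      ≈⟨ sym-assoc ⟩
      (coit (unfoldCoalg q) ∘ ⟨ id , p ⟩) ∘ h      ≈⟨ sym≈ unfoldₘ-coit ⟩∘⟨refl ⟩
      unfoldₘ p q ∘ h                              ∎

  caseₘ-i₁ : ∀ {G A B C} {a : Hom G A} {t : Hom (G ⊗ A) C} {u : Hom (G ⊗ B) C} →
             caseₘ (i₁ ∘ a) t u ≈ t ∘ ⟨ id , a ⟩
  caseₘ-i₁ = case-i₁
  caseₘ-i₂ : ∀ {G A B C} {b : Hom G B} {t : Hom (G ⊗ A) C} {u : Hom (G ⊗ B) C} →
             caseₘ (i₂ ∘ b) t u ≈ u ∘ ⟨ id , b ⟩
  caseₘ-i₂ = case-i₂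

  [i₁π₂,i₂π₂]∘dist : ∀ {X Y Z} → [ i₁ ∘ π₂ , i₂ ∘ π₂ ] ∘ dist ≈ π₂ {X} {Y ⊕ Z}
  [i₁π₂,i₂π₂]∘dist = dist-ext
    (trans≈ assoc (trans≈ (refl⟩∘⟨ dist∘id⊗i₁) (trans≈ inject₁ (sym≈ project₂))))
    (trans≈ assoc (trans≈ (refl⟩∘⟨ dist∘id⊗i₂) (trans≈ inject₂ (sym≈ project₂))))

  [π₁,π₁]∘dist : ∀ {X Y Z} → [ π₁ , π₁ ] ∘ dist ≈ π₁ {X} {Y ⊕ Z}
  [π₁,π₁]∘dist = dist-ext
    (trans≈ assoc (trans≈ (refl⟩∘⟨ dist∘id⊗i₁) (trans≈ inject₁ (sym≈ project₁))))
    (trans≈ assoc (trans≈ (refl⟩∘⟨ dist∘id⊗i₂) (trans≈ inject₂ (sym≈ project₁))))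

  caseₘ-η : ∀ {G A B} {s : Hom G (A ⊕ B)} → caseₘ s (i₁ ∘ π₂) (i₂ ∘ π₂) ≈ s
  caseₘ-η = trans≈ (pullˡ [i₁π₂,i₂π₂]∘dist) project₂

  caseₘ-commute : ∀ {G A B C D} {s : Hom G (A ⊕ B)} {t : Hom (G ⊗ C) D} {q : Hom (G ⊗ A) C} {r : Hom (G ⊗ B) C} →
                  caseₘ s (t ∘ ⟨ π₁ , q ⟩) (t ∘ ⟨ π₁ , r ⟩) ≈ t ∘ ⟨ id , caseₘ s q r ⟩
  caseₘ-commute {s = s} {t} {q} {r} = trans≈ (sym≈ ∘[] ⟩∘⟨refl) (trans≈ assoc (refl⟩∘⟨ ⟨⟩-unique first second))
    where
      first : π₁ ∘ ([ ⟨ π₁ , q ⟩ , ⟨ π₁ , r ⟩ ] ∘ (dist ∘ ⟨ id , s ⟩)) ≈ id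
      first = begin
        π₁ ∘ ([ ⟨ π₁ , q ⟩ , ⟨ π₁ , r ⟩ ] ∘ (dist ∘ ⟨ id , s ⟩)) ≈⟨ pullˡ (trans≈ ∘[] ([]-cong project₁ project₁)) ⟩
        [ π₁ , π₁ ] ∘ (dist ∘ ⟨ id , s ⟩)                        ≈⟨ pullˡ [π₁,π₁]∘dist ⟩
        π₁ ∘ ⟨ id , s ⟩                                          ≈⟨ project₁ ⟩
        id                                                       ∎
      second : π₂ ∘ ([ ⟨ π₁ , q ⟩ , ⟨ π₁ , r ⟩ ] ∘ (dist ∘ ⟨ id , s ⟩)) ≈ caseₘ s q r
      second = pullˡ (trans≈ ∘[] ([]-cong project₂ project₂))

  bindₘ-η : ∀ {G A} {p : Hom G (T A)} → bindₘ p (η ∘ π₂) ≈ p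
  bindₘ-η = trans≈ (pullˡ Tπ₂∘τ) project₂

  bindₘ-ret : ∀ {G A B} {a : Hom G A} {q : Hom (G ⊗ A) (T B)} → bindₘ (η ∘ a) q ≈ q ∘ ⟨ id , a ⟩
  bindₘ-ret = trans≈ (refl⟩∘⟨ τ⟨η∘⟩) ⋆∘η∘

  bindₘ-δ : ∀ {G A B} {q : Hom (G ⊗ A) (T B)} → bindₘ (δ ∘ !) q ≈ δ ∘ !
  bindₘ-δ = trans≈ (refl⟩∘⟨ τ⟨δ⟩) (pullˡ ⋆-δ)

  bindₘ-ϖ : ∀ {G A B} {p p' : Hom G (T A)} {q : Hom (G ⊗ A) (T B)} →
            bindₘ (ϖ ∘ ⟨ p , p' ⟩) q ≈ ϖ ∘ ⟨ bindₘ p q , bindₘ p' q ⟩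
  bindₘ-ϖ = trans≈ (refl⟩∘⟨ τ⟨ϖ⟩) ⋆∘ϖ

  bindₘ-assoc : ∀ {G A B C} {p : Hom G (T A)} {q : Hom (G ⊗ A) (T B)} {r : Hom (G ⊗ B) (T C)} →
                bindₘ (bindₘ p q) r ≈ bindₘ p (bindₘ q (r ∘ (π₁ ×ₘ id)))
  bindₘ-assoc {p = p} {q} {r} = begin
    r ⋆ ∘ (τ ∘ ⟨ id , q ⋆ ∘ (τ ∘ ⟨ id , p ⟩) ⟩)                          ≈⟨ refl⟩∘⟨ τ⟨⋆∘⟩ ⟩
    r ⋆ ∘ ((τ ∘ (id ×ₘ q)) ⋆ ∘ (τ ∘ ⟨ id , τ ∘ ⟨ id , p ⟩ ⟩))             ≈⟨ sym-assoc ⟩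
    (r ⋆ ∘ (τ ∘ (id ×ₘ q)) ⋆) ∘ (τ ∘ ⟨ id , τ ∘ ⟨ id , p ⟩ ⟩)             ≈⟨ sym≈ ⋆-assoc ⟩∘⟨ nested-τ ⟩
    (r ⋆ ∘ (τ ∘ (id ×ₘ q))) ⋆ ∘ (Tmap (α ∘ (⟨ id , id ⟩ ×ₘ id)) ∘ (τ ∘ ⟨ id , p ⟩)) ≈⟨ pullˡ ⋆∘Tmap ⟩
    ((r ⋆ ∘ (τ ∘ (id ×ₘ q))) ∘ (α ∘ (⟨ id , id ⟩ ×ₘ id))) ⋆ ∘ (τ ∘ ⟨ id , p ⟩) ≈⟨ ⋆-resp-≈ inner ⟩∘⟨refl ⟩
    ((r ∘ (π₁ ×ₘ id)) ⋆ ∘ (τ ∘ ⟨ id , q ⟩)) ⋆ ∘ (τ ∘ ⟨ id , p ⟩)          ∎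
    where
      α∘diag : ∀ {X Y} → α ∘ (⟨ id , id ⟩ ×ₘ id) ≈ ⟨ π₁ , id {X ⊗ Y} ⟩
      α∘diag = trans≈ ⟨⟩∘ (⟨⟩-cong
        (trans≈ assoc (trans≈ (refl⟩∘⟨ project₁) (trans≈ sym-assoc (trans≈ (project₁ ⟩∘⟨refl) identityˡ))))
        (trans≈ ⟨⟩∘ (trans≈ (⟨⟩-cong
          (trans≈ assoc (trans≈ (refl⟩∘⟨ project₁) (trans≈ sym-assoc (trans≈ (project₂ ⟩∘⟨refl) identityˡ))))
          (trans≈ project₂ identityˡ)) ⟨⟩-η)))
      nested-τ : τ ∘ ⟨ id , τ ∘ ⟨ id , p ⟩ ⟩ ≈ Tmap (α ∘ (⟨ id , id ⟩ ×ₘ id)) ∘ (τ ∘ ⟨ id , p ⟩)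
      nested-τ = begin
        τ ∘ ⟨ id , τ ∘ ⟨ id , p ⟩ ⟩                   ≈⟨ refl⟩∘⟨ ⟨,⟩-as-id× ⟩
        τ ∘ ((id ×ₘ τ) ∘ ⟨ id , ⟨ id , p ⟩ ⟩)         ≈⟨ refl⟩∘⟨ refl⟩∘⟨ sym≈ (trans≈ ⟨⟩∘ (⟨⟩-cong
              (trans≈ assoc (trans≈ (refl⟩∘⟨ project₁) project₁))
              (trans≈ ⟨⟩∘ (⟨⟩-cong (trans≈ assoc (trans≈ (refl⟩∘⟨ project₁) project₂)) project₂)))) ⟩
        τ ∘ ((id ×ₘ τ) ∘ (α ∘ ⟨ ⟨ id , id ⟩ , p ⟩))   ≈⟨ trans≈ (refl⟩∘⟨ sym-assoc) (trans≈ sym-assoc (sym≈ τ-assoc ⟩∘⟨refl)) ⟩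
        (Tmap α ∘ τ) ∘ ⟨ ⟨ id , id ⟩ , p ⟩            ≈⟨ assoc ⟩
        Tmap α ∘ (τ ∘ ⟨ ⟨ id , id ⟩ , p ⟩)            ≈⟨ refl⟩∘⟨ trans≈ (refl⟩∘⟨ ⟨⟩-cong (sym≈ identityʳ) refl≈) τ⟨f∘⟩ ⟩
        Tmap α ∘ (Tmap (⟨ id , id ⟩ ×ₘ id) ∘ (τ ∘ ⟨ id , p ⟩)) ≈⟨ Tmap-pull ⟩
        Tmap (α ∘ (⟨ id , id ⟩ ×ₘ id)) ∘ (τ ∘ ⟨ id , p ⟩) ∎
      inner : (r ⋆ ∘ (τ ∘ (id ×ₘ q))) ∘ (α ∘ (⟨ id , id ⟩ ×ₘ id)) ≈ (r ∘ (π₁ ×ₘ id)) ⋆ ∘ (τ ∘ ⟨ id , q ⟩)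
      inner = begin
        (r ⋆ ∘ (τ ∘ (id ×ₘ q))) ∘ (α ∘ (⟨ id , id ⟩ ×ₘ id)) ≈⟨ trans≈ assoc (refl⟩∘⟨ trans≈ assoc (refl⟩∘⟨ refl⟩∘⟨ α∘diag)) ⟩
        r ⋆ ∘ (τ ∘ ((id ×ₘ q) ∘ ⟨ π₁ , id ⟩))  ≈⟨ refl⟩∘⟨ refl⟩∘⟨ trans≈ ×∘⟨⟩ (⟨⟩-cong (trans≈ identityˡ (sym≈ identityʳ)) identityʳ) ⟩
        r ⋆ ∘ (τ ∘ ⟨ π₁ ∘ id , q ⟩)            ≈⟨ refl⟩∘⟨ τ⟨f∘⟩ ⟩
        r ⋆ ∘ (Tmap (π₁ ×ₘ id) ∘ (τ ∘ ⟨ id , q ⟩)) ≈⟨ pullˡ ⋆∘Tmap ⟩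
        (r ∘ (π₁ ×ₘ id)) ⋆ ∘ (τ ∘ ⟨ id , q ⟩)  ∎

  unfoldₘ-π₂ : ∀ {G A B} {g : Hom (G ⊗ A) (T (A ⊕ B))} {g' : Hom ((G ⊗ A) ⊗ A) (T (A ⊕ B))} →
               g' ≈ g ∘ (π₁ ×ₘ id) → unfoldₘ π₂ g' ≈ coit (unfoldCoalg g)
  unfoldₘ-π₂ {g = g} {g'} eq = begin
    unfoldₘ π₂ g'                                     ≈⟨ unfoldₘ-coit ⟩
    coit (unfoldCoalg g') ∘ ⟨ id , π₂ ⟩               ≈⟨ sym≈ (coit-fusion (ContextNaturality.unfoldCoalg-natural π₁ eq)) ⟩∘⟨refl ⟩
    (coit (unfoldCoalg g) ∘ (π₁ ×ₘ id)) ∘ ⟨ id , π₂ ⟩ ≈⟨ trans≈ assoc (refl⟩∘⟨ trans≈ ×∘⟨⟩ (⟨⟩-cong identityʳ identityˡ)) ⟩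
    coit (unfoldCoalg g) ∘ ⟨ π₁ , π₂ ⟩                ≈⟨ trans≈ (refl⟩∘⟨ ⟨⟩-η) identityʳ ⟩
    coit (unfoldCoalg g)                              ∎

  caseₘ-coit-rule : ∀ {G A B} {P : Hom (G ⊗ A) (R B)} {P' : Hom (((G ⊗ A) ⊗ (A ⊕ B)) ⊗ A) (R B)} →
                    P' ≈ P ∘ ⟨ π₁ ∘ (π₁ ∘ π₁) , π₂ ⟩ →
                    caseₘ π₂ (i₁ ∘ P') (i₂ ∘ π₂) ≈ (P +ₘ id) ∘ ((id +ₘ π₂) ∘ (dist ∘ (π₁ ×ₘ id)))
  caseₘ-coit-rule {G} {A} {B} {P} {P'} eq = dist-ext
    (begin
      caseₘ π₂ (i₁ ∘ P') (i₂ ∘ π₂) ∘ id⊗i₁                 ≈⟨ trans≈ assoc (refl⟩∘⟨ trans≈ assoc (refl⟩∘⟨ ⟨id,π₂⟩∘ project₂)) ⟩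
      [ i₁ ∘ P' , i₂ ∘ π₂ ] ∘ (dist ∘ ⟨ id⊗i₁ , i₁ ∘ π₂ ⟩) ≈⟨ case-i₁ ⟩
      (i₁ ∘ P') ∘ ⟨ id⊗i₁ , π₂ ⟩                            ≈⟨ trans≈ assoc (refl⟩∘⟨ trans≈ (eq ⟩∘⟨refl) (trans≈ assoc (refl⟩∘⟨ π₁π₁π₁∘))) ⟩
      i₁ ∘ (P ∘ ⟨ π₁ ∘ π₁ , π₂ ⟩)                           ≈⟨ sym≈ (trans≈ +∘i₁∘ (refl⟩∘⟨ refl⟩∘⟨ identityˡ)) ⟩
      (P +ₘ id) ∘ (i₁ ∘ (id ∘ ⟨ π₁ ∘ π₁ , π₂ ⟩))            ≈⟨ refl⟩∘⟨ sym≈ +∘i₁∘ ⟩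
      (P +ₘ id) ∘ ((id +ₘ π₂) ∘ (i₁ ∘ ⟨ π₁ ∘ π₁ , π₂ ⟩))    ≈⟨ refl⟩∘⟨ refl⟩∘⟨ sym≈ (trans≈ (refl⟩∘⟨ π₁×id∘) dist-i₁) ⟩
      (P +ₘ id) ∘ ((id +ₘ π₂) ∘ (dist ∘ ((π₁ ×ₘ id) ∘ id⊗i₁))) ≈⟨ reassoc ⟩
      ((P +ₘ id) ∘ ((id +ₘ π₂) ∘ (dist ∘ (π₁ ×ₘ id)))) ∘ id⊗i₁ ∎)
    (begin
      caseₘ π₂ (i₁ ∘ P') (i₂ ∘ π₂) ∘ id⊗i₂                 ≈⟨ trans≈ assoc (refl⟩∘⟨ trans≈ assoc (refl⟩∘⟨ ⟨id,π₂⟩∘ project₂)) ⟩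
      [ i₁ ∘ P' , i₂ ∘ π₂ ] ∘ (dist ∘ ⟨ id⊗i₂ , i₂ ∘ π₂ ⟩) ≈⟨ case-i₂ ⟩
      (i₂ ∘ π₂) ∘ ⟨ id⊗i₂ , π₂ ⟩                            ≈⟨ trans≈ assoc (refl⟩∘⟨ project₂) ⟩
      i₂ ∘ π₂                                               ≈⟨ sym≈ (trans≈ +∘i₂∘ (refl⟩∘⟨ trans≈ identityˡ project₂)) ⟩
      (P +ₘ id) ∘ (i₂ ∘ (π₂ ∘ ⟨ π₁ ∘ π₁ , π₂ ⟩))            ≈⟨ refl⟩∘⟨ sym≈ +∘i₂∘ ⟩
      (P +ₘ id) ∘ ((id +ₘ π₂) ∘ (i₂ ∘ ⟨ π₁ ∘ π₁ , π₂ ⟩))    ≈⟨ refl⟩∘⟨ refl⟩∘⟨ sym≈ (trans≈ (refl⟩∘⟨ π₁×id∘) dist-i₂) ⟩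
      (P +ₘ id) ∘ ((id +ₘ π₂) ∘ (dist ∘ ((π₁ ×ₘ id) ∘ id⊗i₂))) ≈⟨ reassoc ⟩
      ((P +ₘ id) ∘ ((id +ₘ π₂) ∘ (dist ∘ (π₁ ×ₘ id)))) ∘ id⊗i₂ ∎)
    where
      ⟨id,π₂⟩∘ : ∀ {X Y Z} {c : Hom X (Y ⊗ Z)} {z : Hom X Z} → π₂ ∘ c ≈ z → ⟨ id , π₂ ⟩ ∘ c ≈ ⟨ c , z ⟩
      ⟨id,π₂⟩∘ p = trans≈ ⟨⟩∘ (⟨⟩-cong identityˡ p)
      π₁π₁π₁∘ : ⟨ π₁ ∘ (π₁ ∘ π₁) , π₂ ⟩ ∘ ⟨ id⊗i₁ {G ⊗ A} {A} {B} , π₂ ⟩ ≈ ⟨ π₁ ∘ π₁ , π₂ ⟩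
      π₁π₁π₁∘ = trans≈ ⟨⟩∘ (⟨⟩-cong (trans≈ assoc (refl⟩∘⟨ trans≈ assoc (trans≈ (refl⟩∘⟨ project₁) project₁))) project₂)
      π₁×id∘ : ∀ {Y} {j : Hom Y (A ⊕ B)} → (π₁ ×ₘ id) ∘ ⟨ π₁ {G ⊗ A} , j ∘ π₂ ⟩ ≈ ⟨ π₁ ∘ π₁ , j ∘ π₂ ⟩
      π₁×id∘ = trans≈ ×∘⟨⟩ (⟨⟩-cong refl≈ identityˡ)
      reassoc : ∀ {V W X Y Z U} {a : Hom Y Z} {b : Hom X Y} {c : Hom W X} {d : Hom V W} {k : Hom Z U} →
                k ∘ (a ∘ (b ∘ (c ∘ d))) ≈ (k ∘ (a ∘ (b ∘ c))) ∘ d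
      reassoc = sym≈ (trans≈ assoc (refl⟩∘⟨ trans≈ assoc (refl⟩∘⟨ assoc)))

  bindₘ-coit-rule : ∀ {G A B} {g : Hom (G ⊗ A) (T (A ⊕ B))} {P : Hom (G ⊗ A) (R B)}
                    {P' : Hom (((G ⊗ A) ⊗ (A ⊕ B)) ⊗ A) (R B)} → P' ≈ P ∘ ⟨ π₁ ∘ (π₁ ∘ π₁) , π₂ ⟩ →
                    bindₘ g (caseₘ π₂ (η ∘ (i₁ ∘ P')) (η ∘ (i₂ ∘ π₂))) ≈ Tmap (P +ₘ id) ∘ unfoldCoalg g
  bindₘ-coit-rule {g = g} {P} {P'} eq = begin
    bindₘ g (caseₘ π₂ (η ∘ (i₁ ∘ P')) (η ∘ (i₂ ∘ π₂)))
      ≈⟨ ⋆-resp-≈ (trans≈ (sym≈ ∘[] ⟩∘⟨refl) assoc) ⟩∘⟨refl ⟩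
    Tmap (caseₘ π₂ (i₁ ∘ P') (i₂ ∘ π₂)) ∘ (τ ∘ ⟨ id , g ⟩)
      ≈⟨ Tmap-cong (caseₘ-coit-rule eq) ⟩∘⟨refl ⟩
    Tmap ((P +ₘ id) ∘ ((id +ₘ π₂) ∘ (dist ∘ (π₁ ×ₘ id)))) ∘ (τ ∘ ⟨ id , g ⟩)
      ≈⟨ sym≈ Tmap-pull₃ ⟩
    Tmap (P +ₘ id) ∘ (Tmap (id +ₘ π₂) ∘ (Tmap (dist ∘ (π₁ ×ₘ id)) ∘ (τ ∘ ⟨ id , g ⟩)))
      ≈⟨ refl⟩∘⟨ refl⟩∘⟨ trans≈ (Tmap-∘ ⟩∘⟨refl) assoc ⟩
    Tmap (P +ₘ id) ∘ (Tmap (id +ₘ π₂) ∘ (Tmap dist ∘ (Tmap (π₁ ×ₘ id) ∘ (τ ∘ ⟨ id , g ⟩))))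
      ≈⟨ refl⟩∘⟨ refl⟩∘⟨ refl⟩∘⟨ sym≈ (trans≈ (refl⟩∘⟨ ⟨⟩-cong (sym≈ identityʳ) refl≈) τ⟨f∘⟩) ⟩
    Tmap (P +ₘ id) ∘ unfoldCoalg g ∎

-- Soundness

module Soundness (Sg : Signature) {o ℓ e} (M : Model Sg o ℓ e) where
  open Syntax Sg
  open Semantics Sg M
  open StructureProperties (Model.str M)
  open ContextNaturality
  open Substitution Sg

  RenActsBy : ∀ {Γ Δ} → Ren Γ Δ → Hom ⟦ Δ ⟧ctx ⟦ Γ ⟧ctx → Set e
  RenActsBy {Γ} ρ h = ∀ {A} (v : Γ ∋ A) → ⟦ ρ v ⟧var ≈ ⟦ v ⟧var ∘ h

  SubActsBy : ∀ {Γ Δ} → Sub Γ Δ → Hom ⟦ Δ ⟧ctx ⟦ Γ ⟧ctx → Set e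
  SubActsBy {Γ} σ h = ∀ {A} (v : Γ ∋ A) → ⟦ σ v ⟧tm ≈ ⟦ v ⟧var ∘ h

  there-acts : ∀ {Γ B} → RenActsBy (there {Γ} {B = B}) π₁
  there-acts v = refl≈

  ext-acts : ∀ {Γ Δ B} {ρ : Ren Γ Δ} {h} → RenActsBy ρ h → RenActsBy (ext {B = B} ρ) (h ×ₘ id)
  ext-acts H here      = sym≈ (trans≈ project₂ identityˡ)
  ext-acts H (there v) = trans≈ (H v ⟩∘⟨refl) (trans≈ assoc (trans≈ (refl⟩∘⟨ sym≈ project₁) sym-assoc))

  rename-sem : ∀ {Γ Δ A} {ρ : Ren Γ Δ} {h} → RenActsBy ρ h → (t : Tm Γ A) → ⟦ rename ρ t ⟧tm ≈ ⟦ t ⟧tm ∘ h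
  rename-sem {h = h} H (var v)      = H v
  rename-sem {h = h} H (app f t)    = ∘-natural h (rename-sem H t)
  rename-sem {h = h} H star         = !-natural h
  rename-sem {h = h} H (pair t u)   = ⟨⟩-natural h (rename-sem H t) (rename-sem H u)
  rename-sem {h = h} H (fst t)      = ∘-natural h (rename-sem H t)
  rename-sem {h = h} H (snd t)      = ∘-natural h (rename-sem H t)
  rename-sem {h = h} H (inl t)      = ∘-natural h (rename-sem H t)
  rename-sem {h = h} H (inr t)      = ∘-natural h (rename-sem H t)
  rename-sem {h = h} H (case s t u) =
    caseₘ-natural h (rename-sem H s) (rename-sem (ext-acts H) t) (rename-sem (ext-acts H) u)
  rename-sem {h = h} H (ret t)      = ∘-natural h (rename-sem H t)
  rename-sem {h = h} H (bind p q)   = bindₘ-natural h (rename-sem H p) (rename-sem (ext-acts H) q)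
  rename-sem {h = h} H nil          = δ!-natural h
  rename-sem {h = h} H (plus p q)   = ϖ⟨⟩-natural h (rename-sem H p) (rename-sem H q)
  rename-sem {h = h} H (out p)      = ∘-natural h (rename-sem H p)
  rename-sem {h = h} H (unfold p q) = unfoldₘ-natural h (rename-sem H p) (rename-sem (ext-acts H) q)

  exts-acts : ∀ {Γ Δ B} {σ : Sub Γ Δ} {h} → SubActsBy σ h → SubActsBy (exts {B = B} σ) (h ×ₘ id)
  exts-acts H here      = sym≈ (trans≈ project₂ identityˡ)
  exts-acts {B = B} {σ} H (there v) = trans≈ (rename-sem (there-acts {B = B}) (σ v))
    (trans≈ (H v ⟩∘⟨refl) (trans≈ assoc (trans≈ (refl⟩∘⟨ sym≈ project₁) sym-assoc)))

  sub-sem : ∀ {Γ Δ A} {σ : Sub Γ Δ} {h} → SubActsBy σ h → (t : Tm Γ A) → ⟦ sub σ t ⟧tm ≈ ⟦ t ⟧tm ∘ h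
  sub-sem {h = h} H (var v)      = H v
  sub-sem {h = h} H (app f t)    = ∘-natural h (sub-sem H t)
  sub-sem {h = h} H star         = !-natural h
  sub-sem {h = h} H (pair t u)   = ⟨⟩-natural h (sub-sem H t) (sub-sem H u)
  sub-sem {h = h} H (fst t)      = ∘-natural h (sub-sem H t)
  sub-sem {h = h} H (snd t)      = ∘-natural h (sub-sem H t)
  sub-sem {h = h} H (inl t)      = ∘-natural h (sub-sem H t)
  sub-sem {h = h} H (inr t)      = ∘-natural h (sub-sem H t)
  sub-sem {h = h} H (case s t u) = caseₘ-natural h (sub-sem H s) (sub-sem (exts-acts H) t) (sub-sem (exts-acts H) u)
  sub-sem {h = h} H (ret t)      = ∘-natural h (sub-sem H t)
  sub-sem {h = h} H (bind p q)   = bindₘ-natural h (sub-sem H p) (sub-sem (exts-acts H) q)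
  sub-sem {h = h} H nil          = δ!-natural h
  sub-sem {h = h} H (plus p q)   = ϖ⟨⟩-natural h (sub-sem H p) (sub-sem H q)
  sub-sem {h = h} H (out p)      = ∘-natural h (sub-sem H p)
  sub-sem {h = h} H (unfold p q) = unfoldₘ-natural h (sub-sem H p) (sub-sem (exts-acts H) q)

  ⟦_⟧sub : ∀ {Γ Δ} → Sub Γ Δ → Hom ⟦ Δ ⟧ctx ⟦ Γ ⟧ctx
  ⟦_⟧sub {[]}    σ = !
  ⟦_⟧sub {A ∷ Γ} σ = ⟨ ⟦ (λ v → σ (there v)) ⟧sub , ⟦ σ here ⟧tm ⟩

  ⟦⟧sub-acts : ∀ {Γ Δ} (σ : Sub Γ Δ) → SubActsBy σ ⟦ σ ⟧sub
  ⟦⟧sub-acts σ here      = sym≈ project₂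
  ⟦⟧sub-acts σ (there v) = trans≈ (⟦⟧sub-acts (λ w → σ (there w)) v) (trans≈ (refl⟩∘⟨ sym≈ project₁) sym-assoc)

  []-sem : ∀ {Γ A B} (t : Tm (Γ ,, B) A) (u : Tm Γ B) → ⟦ t [ u ] ⟧tm ≈ ⟦ t ⟧tm ∘ ⟨ id , ⟦ u ⟧tm ⟩
  []-sem t u = P.subst (λ z → ⟦ z ⟧tm ≈ ⟦ t ⟧tm ∘ ⟨ id , ⟦ u ⟧tm ⟩) (P.sym ([]≡sub t u)) (sub-sem acts t)
    where
      acts : SubActsBy (singleSub u) ⟨ id , ⟦ u ⟧tm ⟩
      acts here      = sym≈ project₂
      acts (there v) = trans≈ (sym≈ identityʳ) (trans≈ (refl⟩∘⟨ sym≈ project₁) sym-assoc)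

  []ᵂ-sem : ∀ {Γ C D E} (t : Tm (Γ ,, C) D) (q : Tm (Γ ,, E) C) → ⟦ t [ q ]ᵂ ⟧tm ≈ ⟦ t ⟧tm ∘ ⟨ π₁ , ⟦ q ⟧tm ⟩
  []ᵂ-sem t q = P.subst (λ z → ⟦ z ⟧tm ≈ ⟦ t ⟧tm ∘ ⟨ π₁ , ⟦ q ⟧tm ⟩) (P.sym ([]ᵂ≡sub t q)) (sub-sem acts t)
    where
      acts : SubActsBy (lastSub q) ⟨ π₁ , ⟦ q ⟧tm ⟩
      acts here      = sym≈ project₂
      acts (there v) = trans≈ (refl⟩∘⟨ sym≈ project₁) sym-assoc

  weak₁-sem : ∀ {Γ A B C} (t : Tm (Γ ,, A) C) → ⟦ weak₁ {B = B} t ⟧tm ≈ ⟦ t ⟧tm ∘ (π₁ ×ₘ id)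
  weak₁-sem {B = B} t = rename-sem (ext-acts (there-acts {B = B})) t

  coitRen-sem : ∀ {Γ A B C} (t : Tm (Γ ,, A) C) →
                ⟦ rename (coitRen {B = B}) t ⟧tm ≈ ⟦ t ⟧tm ∘ ⟨ π₁ ∘ (π₁ ∘ π₁) , π₂ ⟩
  coitRen-sem t = rename-sem acts t
    where
      acts : RenActsBy coitRen ⟨ π₁ ∘ (π₁ ∘ π₁) , π₂ ⟩
      acts here      = sym≈ project₂
      acts (there v) = trans≈ assoc (trans≈ assoc (trans≈ (refl⟩∘⟨ sym≈ project₁) sym-assoc))

  module _ (Φ : EqSet) (sat : SatisfiesAll Sg M Φ) where

    sound : ∀ {Γ A} {t s : Tm Γ A} → Φ ⊢ t ≈ s → ⟦ t ⟧tm ≈ ⟦ s ⟧tm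
    sound {Γ} {t = t} {s} (hyp x) = sat (Γ ▷ t ≐ s) x
    sound ≈refl                   = refl≈
    sound (≈sym d)                = sym≈ (sound d)
    sound (≈trans d d')           = trans≈ (sound d) (sound d')
    sound (≈subst {t = t} {s} σ d) =
      trans≈ (sub-sem (⟦⟧sub-acts σ) t) (trans≈ (sound d ⟩∘⟨refl) (sym≈ (sub-sem (⟦⟧sub-acts σ) s)))
    sound (c-app f d)             = refl⟩∘⟨ sound d
    sound (c-pair d d')           = ⟨⟩-cong (sound d) (sound d')
    sound (c-fst d)               = refl⟩∘⟨ sound d
    sound (c-snd d)               = refl⟩∘⟨ sound d
    sound (c-inl d)               = refl⟩∘⟨ sound d
    sound (c-inr d)               = refl⟩∘⟨ sound d
    sound (c-case d d' d'')       = caseₘ-cong (sound d) (sound d') (sound d'')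
    sound (c-ret d)               = refl⟩∘⟨ sound d
    sound (c-bind d d')           = bindₘ-cong (sound d) (sound d')
    sound (c-plus d d')           = refl⟩∘⟨ ⟨⟩-cong (sound d) (sound d')
    sound (c-out d)               = refl⟩∘⟨ sound d
    sound (c-unfold d d')         = unfoldₘ-cong (sound d) (sound d')
    sound (case-inl p q r)        = trans≈ caseₘ-i₁ (sym≈ ([]-sem q p))
    sound (case-inr p q r)        = trans≈ caseₘ-i₂ (sym≈ ([]-sem r p))
    sound (case-η p)              = caseₘ-η
    sound (case-nat p t q r)      = trans≈ (caseₘ-cong refl≈ ([]ᵂ-sem t q) ([]ᵂ-sem t r))
                                      (trans≈ caseₘ-commute (sym≈ ([]-sem t (case p q r))))
    sound (fst-β p q)             = project₁
    sound (snd-β p q)             = project₂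
    sound (pair-η p)              = sym≈ (⟨⟩-unique refl≈ refl≈)
    sound (unit-η p)              = !-unique _
    sound (bind-ret p)            = bindₘ-η
    sound (ret-bind a p)          = trans≈ bindₘ-ret (sym≈ ([]-sem p a))
    sound (bind-assoc p q r)      = trans≈ bindₘ-assoc (bindₘ-cong refl≈ (bindₘ-cong refl≈ (sym≈ (weak₁-sem r))))
    sound (plus-nil p)            = ϖ-unit
    sound (plus-comm p q)         = ϖ-comm
    sound (plus-idem p)           = ϖ-idem
    sound (plus-assoc p q r)      = ϖ-assoc
    sound (bind-nil r)            = bindₘ-δ
    sound (bind-plus p q r)       = bindₘ-ϖ
    sound (coit→ p q d)           =
      trans≈ (coit-unique (trans≈ (sound d) (bindₘ-coit-rule (coitRen-sem p)))) (sym≈ (unfoldₘ-π₂ (weak₁-sem q)))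
    sound (coit← p q d)           = begin
      outC ∘ ⟦ p ⟧tm                                   ≈⟨ refl⟩∘⟨ p≈coit ⟩
      outC ∘ coit (unfoldCoalg ⟦ q ⟧tm)                ≈⟨ coit-hom ⟩
      Tmap (coit (unfoldCoalg ⟦ q ⟧tm) +ₘ id) ∘ unfoldCoalg ⟦ q ⟧tm ≈⟨ Tmap-cong (+-cong (sym≈ p≈coit) refl≈) ⟩∘⟨refl ⟩
      Tmap (⟦ p ⟧tm +ₘ id) ∘ unfoldCoalg ⟦ q ⟧tm       ≈⟨ sym≈ (bindₘ-coit-rule (coitRen-sem p)) ⟩
      ⟦ bind q (case (var here) (ret (inl (rename coitRen p))) (ret (inr (var here)))) ⟧tm ∎
      where
        p≈coit : ⟦ p ⟧tm ≈ coit (unfoldCoalg ⟦ q ⟧tm)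
        p≈coit = trans≈ (sound d) (unfoldₘ-π₂ (weak₁-sem q))

module Derivable (Sg : Signature) (Φ : Syntax.EqSet Sg) where
  open Syntax Sg
  open Substitution Sg

  tm-setoid : Ctx → Type → Setoid _ _
  tm-setoid Γ A = record
    { Carrier = Tm Γ A
    ; _≈_ = λ t s → Φ ⊢ t ≈ s
    ; isEquivalence = record { refl = ≈refl ; sym = ≈sym ; trans = ≈trans }
    }

  module DerivableReasoning {Γ A} = SetoidReasoning (tm-setoid Γ A)

  ≡⇒≈ : ∀ {Γ A} {t s : Tm Γ A} → t ≡ s → Φ ⊢ t ≈ s
  ≡⇒≈ refl = ≈refl

  rename-≈ : ∀ {Γ Δ A} (ρ : Ren Γ Δ) {t s : Tm Γ A} → Φ ⊢ t ≈ s → Φ ⊢ rename ρ t ≈ rename ρ s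
  rename-≈ ρ {t} {s} d = ≈trans (≡⇒≈ (rename≡sub ρ t)) (≈trans (≈subst _ d) (≡⇒≈ (P.sym (rename≡sub ρ s))))

  exts-≈ : ∀ {Γ Δ C} {σ σ' : Sub Γ Δ} → (∀ {B} (v : Γ ∋ B) → Φ ⊢ σ v ≈ σ' v) →
           ∀ {B} (v : (Γ ,, C) ∋ B) → Φ ⊢ exts σ v ≈ exts σ' v
  exts-≈ e here      = ≈refl
  exts-≈ e (there v) = rename-≈ there (e v)

  sub-≈ : ∀ {Γ Δ A} {σ σ' : Sub Γ Δ} → (∀ {B} (v : Γ ∋ B) → Φ ⊢ σ v ≈ σ' v) →
          (t : Tm Γ A) → Φ ⊢ sub σ t ≈ sub σ' t
  sub-≈ e (var v)      = e v
  sub-≈ e (app f t)    = c-app f (sub-≈ e t)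
  sub-≈ e star         = ≈refl
  sub-≈ e (pair t u)   = c-pair (sub-≈ e t) (sub-≈ e u)
  sub-≈ e (fst t)      = c-fst (sub-≈ e t)
  sub-≈ e (snd t)      = c-snd (sub-≈ e t)
  sub-≈ e (inl t)      = c-inl (sub-≈ e t)
  sub-≈ e (inr t)      = c-inr (sub-≈ e t)
  sub-≈ e (case s t u) = c-case (sub-≈ e s) (sub-≈ (exts-≈ e) t) (sub-≈ (exts-≈ e) u)
  sub-≈ e (ret t)      = c-ret (sub-≈ e t)
  sub-≈ e (bind p q)   = c-bind (sub-≈ e p) (sub-≈ (exts-≈ e) q)
  sub-≈ e nil          = ≈refl
  sub-≈ e (plus p q)   = c-plus (sub-≈ e p) (sub-≈ e q)
  sub-≈ e (out p)      = c-out (sub-≈ e p)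
  sub-≈ e (unfold p q) = c-unfold (sub-≈ e p) (sub-≈ (exts-≈ e) q)

  onlySub : ∀ {Δ A} → Tm Δ A → Sub ([] ,, A) Δ
  onlySub u here = u

  infixl 8 _⟪_⟫
  _⟪_⟫ : ∀ {Δ A B} → Tm ([] ,, A) B → Tm Δ A → Tm Δ B
  f ⟪ u ⟫ = sub (onlySub u) f

  sub-as-⟪⟫ : ∀ {Δ A B} (σ : Sub ([] ,, A) Δ) (f : Tm ([] ,, A) B) → sub σ f ≡ f ⟪ σ here ⟫
  sub-as-⟪⟫ σ f = sub-cong (λ { here → refl }) f

  sub-⟪⟫ : ∀ {Δ Θ A B} (σ : Sub Δ Θ) (f : Tm ([] ,, A) B) (u : Tm Δ A) → sub σ (f ⟪ u ⟫) ≡ f ⟪ sub σ u ⟫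
  sub-⟪⟫ σ f u = P.trans (sub-sub σ (onlySub u) f) (sub-as-⟪⟫ _ f)

  rename-⟪⟫ : ∀ {Δ Θ A B} (ρ : Ren Δ Θ) (f : Tm ([] ,, A) B) (u : Tm Δ A) → rename ρ (f ⟪ u ⟫) ≡ f ⟪ rename ρ u ⟫
  rename-⟪⟫ ρ f u = P.trans (rename-sub ρ (onlySub u) f) (sub-as-⟪⟫ _ f)

  rename-as-⟪⟫ : ∀ {Δ A B} (ρ : Ren ([] ,, A) Δ) (f : Tm ([] ,, A) B) → rename ρ f ≡ f ⟪ var (ρ here) ⟫
  rename-as-⟪⟫ ρ f = P.trans (rename≡sub ρ f) (sub-as-⟪⟫ _ f)

  ⟪var⟫ : ∀ {A B} (f : Tm ([] ,, A) B) → f ⟪ var here ⟫ ≡ f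
  ⟪var⟫ f = P.trans (P.sym (sub-as-⟪⟫ var f)) (sub-var f)

  ⟪⟫⟪⟫ : ∀ {Δ A B C} (g : Tm ([] ,, B) C) (f : Tm ([] ,, A) B) (u : Tm Δ A) → g ⟪ f ⟫ ⟪ u ⟫ ≡ g ⟪ f ⟪ u ⟫ ⟫
  ⟪⟫⟪⟫ g f u = sub-⟪⟫ (onlySub u) g f

  ⟪⟫-≈ : ∀ {Δ A B} {f f' : Tm ([] ,, A) B} {u u' : Tm Δ A} → Φ ⊢ f ≈ f' → Φ ⊢ u ≈ u' → Φ ⊢ f ⟪ u ⟫ ≈ f' ⟪ u' ⟫
  ⟪⟫-≈ {f' = f'} d e = ≈trans (≈subst _ d) (sub-≈ (λ { here → e }) f')

  []-⟪var⟫ : ∀ {Δ A B} (f : Tm ([] ,, A) B) (u : Tm Δ A) → (f ⟪ var {Δ ,, A} here ⟫) [ u ] ≡ f ⟪ u ⟫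
  []-⟪var⟫ f u = P.trans ([]≡sub (f ⟪ var here ⟫) u) (sub-⟪⟫ _ f (var here))

  weak₁-[] : ∀ {Γ A B C} (t : Tm (Γ ,, B) C) (u : Tm (Γ ,, A) B) → weak₁ t [ u ] ≡ sub (lastSub u) t
  weak₁-[] t u = P.trans ([]≡sub (weak₁ t) u) (P.trans (sub-rename _ _ t) (sub-cong (λ { here → refl ; (there v) → refl }) t))

  bind-ret-bind : ∀ {Γ A B C} (p : Tm Γ (Tᵗ A)) (u : Tm (Γ ,, A) B) (q : Tm (Γ ,, B) (Tᵗ C)) →
                  Φ ⊢ bind (bind p (ret u)) q ≈ bind p (sub (lastSub u) q)
  bind-ret-bind p u q = ≈trans (bind-assoc _ _ _) (c-bind ≈refl (≈trans (ret-bind _ _) (≡⇒≈ (weak₁-[] q u))))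

-- The term model

module SyntacticCategory (Sg : Signature) (Φ : Syntax.EqSet Sg) where
  open Syntax Sg
  open Substitution Sg
  open Derivable Sg Φ public

  private variable
    A B C D G X Y Z : Type
    Δ : Ctx

  v₀ : ∀ {Δ A} → Tm (Δ ,, A) A
  v₀ = var here

  v₁ : ∀ {Δ A B} → Tm (Δ ,, A ,, B) A
  v₁ = var (there here)

  v₂ : ∀ {Δ A B C} → Tm (Δ ,, A ,, B ,, C) A
  v₂ = var (there (there here))

  infix 4 _⇒ˢ_
  _⇒ˢ_ : Type → Type → Set
  A ⇒ˢ B = Tm ([] ,, A) B

  idˢ : A ⇒ˢ A
  idˢ = v₀

  _∘ˢ_ : B ⇒ˢ C → A ⇒ˢ B → A ⇒ˢ C
  g ∘ˢ f = g ⟪ f ⟫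

  π₁ˢ : A ×ᵗ B ⇒ˢ A
  π₁ˢ = fst v₀

  π₂ˢ : A ×ᵗ B ⇒ˢ B
  π₂ˢ = snd v₀

  [_,_]ˢ : A ⇒ˢ C → B ⇒ˢ C → A +ᵗ B ⇒ˢ C
  [ f , g ]ˢ = case v₀ (f ⟪ v₀ ⟫) (g ⟪ v₀ ⟫)

  distˢ : X ×ᵗ (Y +ᵗ Z) ⇒ˢ (X ×ᵗ Y) +ᵗ (X ×ᵗ Z)
  distˢ = case (snd v₀) (inl (pair (fst v₁) v₀)) (inr (pair (fst v₁) v₀))

  _⋆ˢ : A ⇒ˢ Tᵗ B → Tᵗ A ⇒ˢ Tᵗ B
  f ⋆ˢ = bind v₀ (f ⟪ v₀ ⟫)

  τˢ : A ×ᵗ Tᵗ B ⇒ˢ Tᵗ (A ×ᵗ B)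
  τˢ = bind (snd v₀) (ret (pair (fst v₁) v₀))

  coitˢ : X ⇒ˢ Tᵗ (X +ᵗ A) → X ⇒ˢ Tνᵗ A
  coitˢ f = unfold v₀ (f ⟪ v₀ ⟫)

  Tmapˢ : A ⇒ˢ B → Tᵗ A ⇒ˢ Tᵗ B
  Tmapˢ g = ret g ⋆ˢ

  _×ˢ_ : A ⇒ˢ C → B ⇒ˢ D → A ×ᵗ B ⇒ˢ C ×ᵗ D
  f ×ˢ g = pair (f ∘ˢ π₁ˢ) (g ∘ˢ π₂ˢ)

  αˢ : (A ×ᵗ B) ×ᵗ C ⇒ˢ A ×ᵗ (B ×ᵗ C)
  αˢ = pair (fst (fst v₀)) (pair (snd (fst v₀)) (snd v₀))

  ϖˢ : Tᵗ A ×ᵗ Tᵗ A ⇒ˢ Tᵗ A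
  ϖˢ = plus (fst v₀) (snd v₀)

  dist⁻¹ˢ : (X ×ᵗ Y) +ᵗ (X ×ᵗ Z) ⇒ˢ X ×ᵗ (Y +ᵗ Z)
  dist⁻¹ˢ = [ pair π₁ˢ (inl v₀ ∘ˢ π₂ˢ) , pair π₁ˢ (inr v₀ ∘ˢ π₂ˢ) ]ˢ

  open DerivableReasoning

  ⋆ˢ-⟪⟫ : (q : A ⇒ˢ Tᵗ B) (M : Tm Δ (Tᵗ A)) → q ⋆ˢ ⟪ M ⟫ ≡ bind M (q ⟪ v₀ ⟫)
  ⋆ˢ-⟪⟫ q M = cong (bind M) (sub-⟪⟫ _ q v₀)

  [,]ˢ-⟪⟫ : (f : A ⇒ˢ C) (g : B ⇒ˢ C) (M : Tm Δ (A +ᵗ B)) → [ f , g ]ˢ ⟪ M ⟫ ≡ case M (f ⟪ v₀ ⟫) (g ⟪ v₀ ⟫)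
  [,]ˢ-⟪⟫ f g M = cong₂ (case M) (sub-⟪⟫ _ f v₀) (sub-⟪⟫ _ g v₀)

  ×ˢ-⟪⟫ : (f : A ⇒ˢ C) (g : B ⇒ˢ D) (M : Tm Δ (A ×ᵗ B)) → (f ×ˢ g) ⟪ M ⟫ ≡ pair (f ⟪ fst M ⟫) (g ⟪ snd M ⟫)
  ×ˢ-⟪⟫ f g M = cong₂ pair (⟪⟫⟪⟫ f (fst v₀) M) (⟪⟫⟪⟫ g (snd v₀) M)

  τˢ-⟪pair⟫ : (p : G ⇒ˢ Tᵗ A) → Φ ⊢ τˢ ⟪ pair v₀ p ⟫ ≈ bind p (ret (pair v₁ v₀))
  τˢ-⟪pair⟫ p = c-bind (snd-β _ _) (c-ret (c-pair (fst-β _ _) ≈refl))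

  assocˢ : (f : A ⇒ˢ B) (g : B ⇒ˢ C) (h : C ⇒ˢ D) → Φ ⊢ (h ∘ˢ g) ∘ˢ f ≈ h ∘ˢ (g ∘ˢ f)
  assocˢ f g h = ≡⇒≈ (⟪⟫⟪⟫ h g f)

  identityʳˢ : (f : A ⇒ˢ B) → Φ ⊢ f ∘ˢ idˢ ≈ f
  identityʳˢ f = ≡⇒≈ (⟪var⟫ f)

  inject₁ˢ : (f : A ⇒ˢ C) (g : B ⇒ˢ C) → Φ ⊢ [ f , g ]ˢ ∘ˢ inl v₀ ≈ f
  inject₁ˢ f g = begin
    [ f , g ]ˢ ⟪ inl v₀ ⟫ ≡⟨ [,]ˢ-⟪⟫ f g _ ⟩
    case (inl v₀) (f ⟪ v₀ ⟫) (g ⟪ v₀ ⟫) ≈⟨ case-inl _ _ _ ⟩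
    (f ⟪ v₀ ⟫) [ v₀ ] ≡⟨ P.trans ([]-⟪var⟫ f v₀) (⟪var⟫ f) ⟩
    f ∎

  inject₂ˢ : (f : A ⇒ˢ C) (g : B ⇒ˢ C) → Φ ⊢ [ f , g ]ˢ ∘ˢ inr v₀ ≈ g
  inject₂ˢ f g = begin
    [ f , g ]ˢ ⟪ inr v₀ ⟫ ≡⟨ [,]ˢ-⟪⟫ f g _ ⟩
    case (inr v₀) (f ⟪ v₀ ⟫) (g ⟪ v₀ ⟫) ≈⟨ case-inr _ _ _ ⟩
    (g ⟪ v₀ ⟫) [ v₀ ] ≡⟨ P.trans ([]-⟪var⟫ g v₀) (⟪var⟫ g) ⟩
    g ∎

  []-uniqueˢ : (f : A ⇒ˢ C) (g : B ⇒ˢ C) (h : A +ᵗ B ⇒ˢ C) →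
                Φ ⊢ h ∘ˢ inl v₀ ≈ f → Φ ⊢ h ∘ˢ inr v₀ ≈ g → Φ ⊢ h ≈ [ f , g ]ˢ
  []-uniqueˢ {A} {C} {B} f g h e1 e2 = begin
    h ≡⟨ P.sym (⟪var⟫ h) ⟩
    h ⟪ v₀ ⟫ ≈⟨ ⟪⟫-≈ {f = h} ≈refl (≈sym (case-η v₀)) ⟩
    h ⟪ case v₀ (inl v₀) (inr v₀) ⟫ ≡⟨ P.sym ([]-⟪var⟫ h _) ⟩
    t' [ case v₀ (inl v₀) (inr v₀) ] ≈⟨ ≈sym (case-nat v₀ t' (inl v₀) (inr v₀)) ⟩
    case v₀ (t' [ inl v₀ ]ᵂ) (t' [ inr v₀ ]ᵂ) ≈⟨ c-case ≈refl inl-branch inr-branch ⟩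
    case v₀ (f ⟪ v₀ ⟫) (g ⟪ v₀ ⟫) ∎
    where
      t' : Tm ([] ,, (A +ᵗ B) ,, (A +ᵗ B)) C
      t' = h ⟪ v₀ ⟫
      inl-branch : Φ ⊢ t' [ inl v₀ ]ᵂ ≈ f ⟪ v₀ ⟫
      inl-branch = ≈trans (≡⇒≈ (P.trans ([]ᵂ≡sub t' _) (P.trans (sub-⟪⟫ _ h v₀) (P.sym (⟪⟫⟪⟫ h (inl v₀) v₀))))) (⟪⟫-≈ {u = v₀} e1 ≈refl)
      inr-branch : Φ ⊢ t' [ inr v₀ ]ᵂ ≈ g ⟪ v₀ ⟫
      inr-branch = ≈trans (≡⇒≈ (P.trans ([]ᵂ≡sub t' _) (P.trans (sub-⟪⟫ _ h v₀) (P.sym (⟪⟫⟪⟫ h (inr v₀) v₀))))) (⟪⟫-≈ {u = v₀} e2 ≈refl)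

  []-extˢ : (h k : A +ᵗ B ⇒ˢ C) → Φ ⊢ h ∘ˢ inl v₀ ≈ k ∘ˢ inl v₀ → Φ ⊢ h ∘ˢ inr v₀ ≈ k ∘ˢ inr v₀ → Φ ⊢ h ≈ k
  []-extˢ h k e1 e2 = ≈trans ([]-uniqueˢ _ _ h e1 e2)
    (≈sym ([]-uniqueˢ _ _ k ≈refl ≈refl))

  ⟨⟩-uniqueˢ : (f : X ⇒ˢ A) (g : X ⇒ˢ B) (h : X ⇒ˢ A ×ᵗ B) →
                Φ ⊢ π₁ˢ ∘ˢ h ≈ f → Φ ⊢ π₂ˢ ∘ˢ h ≈ g → Φ ⊢ h ≈ pair f g
  ⟨⟩-uniqueˢ f g h e1 e2 = ≈trans (≈sym (pair-η h)) (c-pair e1 e2)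

  dist∘canˢ : Φ ⊢ distˢ {X} {Y} {Z} ∘ˢ dist⁻¹ˢ ≈ idˢ
  dist∘canˢ = []-extˢ _ _
    (begin
      distˢ ⟪ dist⁻¹ˢ ⟫ ⟪ inl v₀ ⟫ ≡⟨ ⟪⟫⟪⟫ distˢ dist⁻¹ˢ _ ⟩
      distˢ ⟪ dist⁻¹ˢ ⟪ inl v₀ ⟫ ⟫ ≈⟨ ⟪⟫-≈ {f = distˢ} ≈refl (inject₁ˢ (pair π₁ˢ (inl v₀ ∘ˢ π₂ˢ)) (pair π₁ˢ (inr v₀ ∘ˢ π₂ˢ))) ⟩
      distˢ ⟪ pair (fst v₀) (inl (snd v₀)) ⟫ ≈⟨ c-case (snd-β _ _) ≈refl ≈refl ⟩
      case (inl (snd v₀)) (inl (pair (fst (pair (fst v₁) (inl (snd v₁)))) v₀)) (inr (pair (fst (pair (fst v₁) (inl (snd v₁)))) v₀))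
        ≈⟨ case-inl _ _ _ ⟩
      inl (pair (fst (pair (fst v₀) (inl (snd v₀)))) (snd v₀)) ≈⟨ c-inl (≈trans (c-pair (fst-β _ _) ≈refl) (pair-η _)) ⟩
      inl v₀ ∎)
    (begin
      distˢ ⟪ dist⁻¹ˢ ⟫ ⟪ inr v₀ ⟫ ≡⟨ ⟪⟫⟪⟫ distˢ dist⁻¹ˢ _ ⟩
      distˢ ⟪ dist⁻¹ˢ ⟪ inr v₀ ⟫ ⟫ ≈⟨ ⟪⟫-≈ {f = distˢ} ≈refl (inject₂ˢ (pair π₁ˢ (inl v₀ ∘ˢ π₂ˢ)) (pair π₁ˢ (inr v₀ ∘ˢ π₂ˢ))) ⟩
      distˢ ⟪ pair (fst v₀) (inr (snd v₀)) ⟫ ≈⟨ c-case (snd-β _ _) ≈refl ≈refl ⟩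
      case (inr (snd v₀)) (inl (pair (fst (pair (fst v₁) (inr (snd v₁)))) v₀)) (inr (pair (fst (pair (fst v₁) (inr (snd v₁)))) v₀))
        ≈⟨ case-inr _ _ _ ⟩
      inr (pair (fst (pair (fst v₀) (inr (snd v₀)))) (snd v₀)) ≈⟨ c-inr (≈trans (c-pair (fst-β _ _) ≈refl) (pair-η _)) ⟩
      inr v₀ ∎)

  can∘distˢ : Φ ⊢ dist⁻¹ˢ {X} {Y} {Z} ∘ˢ distˢ ≈ idˢ
  can∘distˢ {X} {Y} {Z} = begin
    dist⁻¹ˢ ⟪ distˢ ⟫ ≡⟨⟩
    t' [ case (snd v₀) (inl (pair (fst v₁) v₀)) (inr (pair (fst v₁) v₀)) ] ≈⟨ ≈sym (case-nat _ t' _ _) ⟩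
    case (snd v₀) (t' [ inl (pair (fst v₁) v₀) ]ᵂ) (t' [ inr (pair (fst v₁) v₀) ]ᵂ)
      ≈⟨ c-case ≈refl (≈trans (case-inl _ _ _) (c-pair (fst-β _ _) (c-inl (snd-β _ _))))
                      (≈trans (case-inr _ _ _) (c-pair (fst-β _ _) (c-inr (snd-β _ _)))) ⟩
    case (snd v₀) (t'' [ inl v₀ ]ᵂ) (t'' [ inr v₀ ]ᵂ) ≈⟨ case-nat _ t'' _ _ ⟩
    t'' [ case (snd v₀) (inl v₀) (inr v₀) ] ≈⟨ c-pair ≈refl (case-η _) ⟩
    pair (fst v₀) (snd v₀) ≈⟨ pair-η _ ⟩
    v₀ ∎
    where
      t' : Tm ([] ,, (X ×ᵗ (Y +ᵗ Z)) ,, ((X ×ᵗ Y) +ᵗ (X ×ᵗ Z))) (X ×ᵗ (Y +ᵗ Z))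
      t' = case v₀ (pair (fst v₀) (inl (snd v₀))) (pair (fst v₀) (inr (snd v₀)))
      t'' : Tm ([] ,, (X ×ᵗ (Y +ᵗ Z)) ,, (Y +ᵗ Z)) (X ×ᵗ (Y +ᵗ Z))
      t'' = pair (fst v₁) v₀

  ⋆-ηˢ : (f : A ⇒ˢ Tᵗ B) → Φ ⊢ (f ⋆ˢ) ∘ˢ ret v₀ ≈ f
  ⋆-ηˢ f = begin
    f ⋆ˢ ⟪ ret v₀ ⟫ ≡⟨ ⋆ˢ-⟪⟫ f _ ⟩
    bind (ret v₀) (f ⟪ v₀ ⟫) ≈⟨ ret-bind _ _ ⟩
    (f ⟪ v₀ ⟫) [ v₀ ] ≡⟨ P.trans ([]-⟪var⟫ f v₀) (⟪var⟫ f) ⟩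
    f ∎

  η-⋆ˢ : Φ ⊢ (ret v₀) ⋆ˢ ≈ idˢ {Tᵗ A}
  η-⋆ˢ = bind-ret _

  ⋆-assocˢ : (f : A ⇒ˢ Tᵗ B) (g : B ⇒ˢ Tᵗ C) → Φ ⊢ ((g ⋆ˢ) ∘ˢ f) ⋆ˢ ≈ (g ⋆ˢ) ∘ˢ (f ⋆ˢ)
  ⋆-assocˢ f g = begin
    bind v₀ ((g ⋆ˢ ⟪ f ⟫) ⟪ v₀ ⟫) ≡⟨ cong (bind v₀) (P.trans (⟪⟫⟪⟫ (g ⋆ˢ) f v₀) (⋆ˢ-⟪⟫ g _)) ⟩
    bind v₀ (bind (f ⟪ v₀ ⟫) (g ⟪ v₀ ⟫)) ≡⟨ cong (λ z → bind v₀ (bind (f ⟪ v₀ ⟫) z)) (P.sym (rename-⟪⟫ _ g v₀)) ⟩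
    bind v₀ (bind (f ⟪ v₀ ⟫) (weak₁ (g ⟪ v₀ ⟫))) ≈⟨ ≈sym (bind-assoc _ _ _) ⟩
    bind (bind v₀ (f ⟪ v₀ ⟫)) (g ⟪ v₀ ⟫) ≡⟨ P.sym (⋆ˢ-⟪⟫ g _) ⟩
    g ⋆ˢ ⟪ f ⋆ˢ ⟫ ∎

  τ-ηˢ : Φ ⊢ τˢ ∘ˢ (idˢ ×ˢ ret v₀) ≈ ret (v₀ {A = A ×ᵗ B})
  τ-ηˢ = ≈trans (c-bind (snd-β _ _) (c-ret (c-pair (fst-β _ _) ≈refl)))
            (≈trans (ret-bind _ _) (c-ret (pair-η _)))

  τ-unitˢ : Φ ⊢ Tmapˢ π₂ˢ ∘ˢ τˢ ≈ π₂ˢ {A} {Tᵗ B}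
  τ-unitˢ = ≈trans (bind-ret-bind _ _ _) (≈trans (c-bind ≈refl (c-ret (snd-β _ _))) (bind-ret _))

  τ-naturalˢ : (f : A ⇒ˢ C) (g : B ⇒ˢ D) → Φ ⊢ τˢ ∘ˢ (f ×ˢ Tmapˢ g) ≈ Tmapˢ (f ×ˢ g) ∘ˢ τˢ
  τ-naturalˢ f g = begin
    τˢ ⟪ pair (f ⟪ fst v₀ ⟫) (Tmapˢ g ⟪ snd v₀ ⟫) ⟫ ≈⟨ c-bind (snd-β _ _) (c-ret (c-pair (fst-β _ _) ≈refl)) ⟩
    bind (Tmapˢ g ⟪ snd v₀ ⟫) (ret (pair (rename there (f ⟪ fst v₀ ⟫)) v₀))
      ≡⟨ cong₂ bind (⋆ˢ-⟪⟫ (ret g) _) (cong (λ z → ret (pair z v₀)) (rename-⟪⟫ there f (fst v₀))) ⟩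
    bind (bind (snd v₀) (ret (g ⟪ v₀ ⟫))) (ret (pair (f ⟪ fst v₁ ⟫) v₀)) ≈⟨ bind-ret-bind _ _ _ ⟩
    bind (snd v₀) (sub (lastSub (g ⟪ v₀ ⟫)) (ret (pair (f ⟪ fst v₁ ⟫) v₀)))
      ≡⟨ cong (λ z → bind (snd v₀) (ret (pair z (g ⟪ v₀ ⟫)))) (sub-⟪⟫ _ f (fst v₁)) ⟩
    bind (snd v₀) (ret (pair (f ⟪ fst v₁ ⟫) (g ⟪ v₀ ⟫))) ≈⟨ c-bind ≈refl (c-ret (c-pair (⟪⟫-≈ {f = f} ≈refl (fst-β _ _)) (⟪⟫-≈ {f = g} ≈refl (snd-β _ _)))) ⟨
    bind (snd v₀) (ret (pair (f ⟪ fst (pair (fst v₁) v₀) ⟫) (g ⟪ snd (pair (fst v₁) v₀) ⟫)))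
      ≡⟨ cong (λ z → bind (snd v₀) (ret z)) (P.sym (P.trans (sub-⟪⟫ _ (f ×ˢ g) v₀) (×ˢ-⟪⟫ f g _))) ⟩
    bind (snd v₀) (sub (lastSub (pair (fst v₁) v₀)) (ret ((f ×ˢ g) ⟪ v₀ ⟫))) ≈⟨ bind-ret-bind _ _ _ ⟨
    bind τˢ (ret ((f ×ˢ g) ⟪ v₀ ⟫)) ≡⟨ P.sym (⋆ˢ-⟪⟫ (ret (f ×ˢ g)) _) ⟩
    Tmapˢ (f ×ˢ g) ⟪ τˢ ⟫ ∎

  τ-assocˢ : Φ ⊢ Tmapˢ (αˢ {A} {B} {C}) ∘ˢ τˢ ≈ τˢ ∘ˢ ((idˢ ×ˢ τˢ) ∘ˢ αˢ)
  τ-assocˢ {A} {B} {C} = ≈trans lhs (≈sym rhs)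
    where
      common : Tm ([] ,, ((A ×ᵗ B) ×ᵗ Tᵗ C)) (Tᵗ (A ×ᵗ (B ×ᵗ C)))
      common = bind (snd v₀) (ret (pair (fst (fst v₁)) (pair (snd (fst v₁)) v₀)))
      lhs : Φ ⊢ Tmapˢ αˢ ∘ˢ τˢ ≈ common
      lhs = ≈trans (bind-ret-bind _ _ _) (c-bind ≈refl (c-ret (c-pair (c-fst (fst-β _ _))
              (c-pair (c-snd (fst-β _ _)) (snd-β _ _)))))
      rhs : Φ ⊢ τˢ ∘ˢ ((idˢ ×ˢ τˢ) ∘ˢ αˢ) ≈ common
      rhs = ≈trans (c-bind (snd-β _ _) ≈refl) (≈trans (bind-ret-bind _ _ _)
             (c-bind (≈trans (c-snd (snd-β _ _)) (snd-β _ _))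
                     (c-ret (c-pair (≈trans (fst-β _ _) (fst-β _ _))
                                    (c-pair (≈trans (c-fst (snd-β _ _)) (fst-β _ _)) ≈refl)))))

  τ-⋆ˢ : (f : B ⇒ˢ Tᵗ C) → Φ ⊢ τˢ {A} ∘ˢ (idˢ ×ˢ (f ⋆ˢ)) ≈ ((τˢ ∘ˢ (idˢ ×ˢ f)) ⋆ˢ) ∘ˢ τˢ
  τ-⋆ˢ {B} {C} {A} f = ≈trans lhs (≈sym rhs)
    where
      common : Tm ([] ,, (A ×ᵗ Tᵗ B)) (Tᵗ (A ×ᵗ C))
      common = bind (snd v₀) (bind (f ⟪ v₀ ⟫) (ret (pair (fst v₂) v₀)))
      lhs : Φ ⊢ τˢ ∘ˢ (idˢ ×ˢ (f ⋆ˢ)) ≈ common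
      lhs = begin
        τˢ ⟪ pair (fst v₀) (f ⋆ˢ ⟪ snd v₀ ⟫) ⟫ ≈⟨ c-bind (snd-β _ _) (c-ret (c-pair (fst-β _ _) ≈refl)) ⟩
        bind (f ⋆ˢ ⟪ snd v₀ ⟫) (ret (pair (fst v₁) v₀)) ≡⟨ cong (λ z → bind z (ret (pair (fst v₁) v₀))) (⋆ˢ-⟪⟫ f _) ⟩
        bind (bind (snd v₀) (f ⟪ v₀ ⟫)) (ret (pair (fst v₁) v₀)) ≈⟨ bind-assoc _ _ _ ⟩
        common ∎
      K : A ×ᵗ B ⇒ˢ Tᵗ (A ×ᵗ C)
      K = τˢ ∘ˢ (idˢ ×ˢ f)
      N : Tm ([] ,, (A ×ᵗ Tᵗ B) ,, B) (A ×ᵗ B)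
      N = pair (fst v₁) v₀
      rhs : Φ ⊢ (K ⋆ˢ) ∘ˢ τˢ ≈ common
      rhs = begin
        K ⋆ˢ ⟪ τˢ ⟫ ≡⟨ ⋆ˢ-⟪⟫ K _ ⟩
        bind τˢ (K ⟪ v₀ ⟫) ≈⟨ bind-ret-bind _ _ _ ⟩
        bind (snd v₀) (sub (lastSub N) (K ⟪ v₀ ⟫)) ≡⟨ cong (bind (snd v₀)) (P.trans (sub-⟪⟫ _ K v₀) (⟪⟫⟪⟫ τˢ (idˢ ×ˢ f) N)) ⟩
        bind (snd v₀) (τˢ ⟪ pair (fst N) ((f ⟪ snd v₀ ⟫) ⟪ N ⟫) ⟫)
          ≡⟨ cong (λ z → bind (snd v₀) (τˢ ⟪ pair (fst N) z ⟫)) (⟪⟫⟪⟫ f (snd v₀) N) ⟩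
        bind (snd v₀) (τˢ ⟪ pair (fst N) (f ⟪ snd N ⟫) ⟫)
          ≈⟨ c-bind ≈refl (≈trans (c-bind (snd-β _ _) (c-ret (c-pair (≈trans (fst-β _ _) (fst-β _ _)) ≈refl)))
                                  (c-bind (⟪⟫-≈ {f = f} ≈refl (snd-β _ _)) ≈refl)) ⟩
        common ∎

  δ-naturalˢ : (f : A ⇒ˢ B) → Φ ⊢ Tmapˢ f ∘ˢ nil {Γ = [] ,, unit} {A = A} ≈ nil {A = B}
  δ-naturalˢ f = bind-nil _

  ϖ-naturalˢ : (f : A ⇒ˢ B) → Φ ⊢ Tmapˢ f ∘ˢ ϖˢ ≈ ϖˢ ∘ˢ (Tmapˢ f ×ˢ Tmapˢ f)
  ϖ-naturalˢ f = begin
    Tmapˢ f ⟪ ϖˢ ⟫ ≡⟨ ⋆ˢ-⟪⟫ (ret f) _ ⟩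
    bind ϖˢ (ret (f ⟪ v₀ ⟫)) ≈⟨ bind-plus _ _ _ ⟩
    plus (bind (fst v₀) (ret (f ⟪ v₀ ⟫))) (bind (snd v₀) (ret (f ⟪ v₀ ⟫)))
      ≡⟨ P.sym (cong₂ plus (⋆ˢ-⟪⟫ (ret f) _) (⋆ˢ-⟪⟫ (ret f) _)) ⟩
    plus (Tmapˢ f ⟪ fst v₀ ⟫) (Tmapˢ f ⟪ snd v₀ ⟫) ≈⟨ c-plus (fst-β _ _) (snd-β _ _) ⟨
    ϖˢ ⟪ Tmapˢ f ×ˢ Tmapˢ f ⟫ ∎

  ϖ-unitˢ : (f : X ⇒ˢ Tᵗ A) → Φ ⊢ ϖˢ ∘ˢ pair f (nil ∘ˢ star) ≈ f
  ϖ-unitˢ f = ≈trans (c-plus (fst-β _ _) (snd-β _ _)) (plus-nil _)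

  ϖ-commˢ : (f g : X ⇒ˢ Tᵗ A) → Φ ⊢ ϖˢ ∘ˢ pair f g ≈ ϖˢ ∘ˢ pair g f
  ϖ-commˢ f g = ≈trans (c-plus (fst-β _ _) (snd-β _ _)) (≈trans (plus-comm _ _) (≈sym (c-plus (fst-β _ _) (snd-β _ _))))

  ϖ-idemˢ : (f : X ⇒ˢ Tᵗ A) → Φ ⊢ ϖˢ ∘ˢ pair f f ≈ f
  ϖ-idemˢ f = ≈trans (c-plus (fst-β _ _) (snd-β _ _)) (plus-idem _)

  ϖ-assocˢ : (f g h : X ⇒ˢ Tᵗ A) → Φ ⊢ ϖˢ ∘ˢ pair f (ϖˢ ∘ˢ pair g h) ≈ ϖˢ ∘ˢ pair (ϖˢ ∘ˢ pair f g) h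
  ϖ-assocˢ f g h = ≈trans (c-plus (fst-β _ _) (≈trans (snd-β _ _) (c-plus (fst-β _ _) (snd-β _ _))))
    (≈trans (plus-assoc _ _ _) (≈sym (c-plus (≈trans (fst-β _ _) (c-plus (fst-β _ _) (snd-β _ _))) (snd-β _ _))))

  ⋆-δˢ : (f : A ⇒ˢ Tᵗ B) → Φ ⊢ (f ⋆ˢ) ∘ˢ nil {Γ = [] ,, unit} {A = A} ≈ nil
  ⋆-δˢ f = bind-nil _

  ⋆-ϖˢ : (f : A ⇒ˢ Tᵗ B) → Φ ⊢ (f ⋆ˢ) ∘ˢ ϖˢ ≈ ϖˢ ∘ˢ pair ((f ⋆ˢ) ∘ˢ π₁ˢ) ((f ⋆ˢ) ∘ˢ π₂ˢ)
  ⋆-ϖˢ f = begin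
    f ⋆ˢ ⟪ ϖˢ ⟫ ≡⟨ ⋆ˢ-⟪⟫ f _ ⟩
    bind ϖˢ (f ⟪ v₀ ⟫) ≈⟨ bind-plus _ _ _ ⟩
    plus (bind (fst v₀) (f ⟪ v₀ ⟫)) (bind (snd v₀) (f ⟪ v₀ ⟫)) ≡⟨ P.sym (cong₂ plus (⋆ˢ-⟪⟫ f _) (⋆ˢ-⟪⟫ f _)) ⟩
    plus (f ⋆ˢ ⟪ fst v₀ ⟫) (f ⋆ˢ ⟪ snd v₀ ⟫) ≈⟨ c-plus (fst-β _ _) (snd-β _ _) ⟨
    ϖˢ ⟪ pair ((f ⋆ˢ) ∘ˢ π₁ˢ) ((f ⋆ˢ) ∘ˢ π₂ˢ) ⟫ ∎

  τ-δˢ : (f : X ⇒ˢ A) → Φ ⊢ τˢ ∘ˢ (f ×ˢ nil {Γ = [] ,, unit} {A = B}) ≈ nil ∘ˢ star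
  τ-δˢ f = ≈trans (c-bind (snd-β _ _) ≈refl) (bind-nil _)

  τ-ϖˢ : (f : X ⇒ˢ A) → Φ ⊢ τˢ ∘ˢ (f ×ˢ ϖˢ {B}) ≈ ϖˢ ∘ˢ pair (τˢ ∘ˢ (f ×ˢ π₁ˢ)) (τˢ ∘ˢ (f ×ˢ π₂ˢ))
  τ-ϖˢ f = ≈trans (c-bind (snd-β _ _) (c-ret (c-pair (fst-β _ _) ≈refl)))
    (≈trans (bind-plus _ _ _)
      (≈sym (≈trans (c-plus (fst-β _ _) (snd-β _ _))
        (c-plus (c-bind (snd-β _ _) (c-ret (c-pair (fst-β _ _) ≈refl)))
                (c-bind (snd-β _ _) (c-ret (c-pair (fst-β _ _) ≈refl)))))))

  Tmapˢ-[inl,inr]ˢ : (h : X ⇒ˢ Tνᵗ A) (f : X ⇒ˢ Tᵗ (X +ᵗ A)) →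
         Φ ⊢ Tmapˢ [ inl h , inr v₀ ]ˢ ∘ˢ f ≈ bind f (case v₀ (ret (inl (h ⟪ v₀ ⟫))) (ret (inr v₀)))
  Tmapˢ-[inl,inr]ˢ h f = begin
    Tmapˢ [ inl h , inr v₀ ]ˢ ⟪ f ⟫ ≡⟨ ⋆ˢ-⟪⟫ (ret [ inl h , inr v₀ ]ˢ) f ⟩
    bind f (ret ([ inl h , inr v₀ ]ˢ ⟪ v₀ ⟫)) ≡⟨ cong (λ z → bind f (ret z)) ([,]ˢ-⟪⟫ (inl h) (inr v₀) v₀) ⟩
    bind f (ret (case v₀ (inl (h ⟪ v₀ ⟫)) (inr v₀))) ≈⟨ c-bind ≈refl (≈sym (case-nat v₀ (ret v₀) _ _)) ⟩
    bind f (case v₀ (ret (inl (h ⟪ v₀ ⟫))) (ret (inr v₀))) ∎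

  coitˢ≡unfold : (f : X ⇒ˢ Tᵗ (X +ᵗ A)) → coitˢ f ≡ unfold v₀ (weak₁ f)
  coitˢ≡unfold f = cong (unfold v₀) (P.sym (rename-as-⟪⟫ (ext there) f))

  coit-homˢ : (f : X ⇒ˢ Tᵗ (X +ᵗ A)) → Φ ⊢ out v₀ ∘ˢ coitˢ f ≈ Tmapˢ [ inl (coitˢ f) , inr v₀ ]ˢ ∘ˢ f
  coit-homˢ f = begin
    out (coitˢ f) ≈⟨ coit← (coitˢ f) f (≡⇒≈ (coitˢ≡unfold f)) ⟩
    bind f (case v₀ (ret (inl (rename coitRen (coitˢ f)))) (ret (inr v₀)))
      ≡⟨ cong (λ z → bind f (case v₀ (ret (inl z)) (ret (inr v₀)))) (rename-as-⟪⟫ coitRen (coitˢ f)) ⟩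
    bind f (case v₀ (ret (inl (coitˢ f ⟪ v₀ ⟫))) (ret (inr v₀))) ≈⟨ Tmapˢ-[inl,inr]ˢ (coitˢ f) f ⟨
    Tmapˢ [ inl (coitˢ f) , inr v₀ ]ˢ ∘ˢ f ∎

  coit-uniqueˢ : (f : X ⇒ˢ Tᵗ (X +ᵗ A)) (h : X ⇒ˢ Tνᵗ A) →
                  Φ ⊢ out v₀ ∘ˢ h ≈ Tmapˢ [ inl h , inr v₀ ]ˢ ∘ˢ f → Φ ⊢ h ≈ coitˢ f
  coit-uniqueˢ f h e = ≈trans (coit→ h f (≈trans e (≈trans (Tmapˢ-[inl,inr]ˢ h f)
      (≡⇒≈ (cong (λ z → bind f (case v₀ (ret (inl z)) (ret (inr v₀)))) (P.sym (rename-as-⟪⟫ coitRen h)))))))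
    (≡⇒≈ (P.sym (coitˢ≡unfold f)))

  bind-via-τˢ : (p : G ⇒ˢ Tᵗ A) (q : G ×ᵗ A ⇒ˢ Tᵗ B) →
                Φ ⊢ q ⋆ˢ ⟪ τˢ ⟪ pair v₀ p ⟫ ⟫ ≈ bind p (q ⟪ pair v₁ v₀ ⟫)
  bind-via-τˢ p q = begin
    q ⋆ˢ ⟪ τˢ ⟪ pair v₀ p ⟫ ⟫ ≡⟨ ⋆ˢ-⟪⟫ q _ ⟩
    bind (τˢ ⟪ pair v₀ p ⟫) (q ⟪ v₀ ⟫) ≈⟨ c-bind (τˢ-⟪pair⟫ p) ≈refl ⟩
    bind (bind p (ret (pair v₁ v₀))) (q ⟪ v₀ ⟫) ≈⟨ bind-assoc _ _ _ ⟩
    bind p (bind (ret (pair v₁ v₀)) (weak₁ (q ⟪ v₀ ⟫))) ≡⟨ cong (λ z → bind p (bind (ret (pair v₁ v₀)) z)) (rename-⟪⟫ _ q v₀) ⟩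
    bind p (bind (ret (pair v₁ v₀)) (q ⟪ v₀ ⟫)) ≈⟨ c-bind ≈refl (ret-bind _ _) ⟩
    bind p ((q ⟪ v₀ ⟫) [ pair v₁ v₀ ]) ≡⟨ cong (bind p) ([]-⟪var⟫ q _) ⟩
    bind p (q ⟪ pair v₁ v₀ ⟫) ∎

  case-via-distˢ : (s : G ⇒ˢ A +ᵗ B) (t : G ×ᵗ A ⇒ˢ C) (u : G ×ᵗ B ⇒ˢ C) →
                   Φ ⊢ [ t , u ]ˢ ⟪ distˢ ⟪ pair v₀ s ⟫ ⟫ ≈ case s (t ⟪ pair v₁ v₀ ⟫) (u ⟪ pair v₁ v₀ ⟫)
  case-via-distˢ {G} {A} {B} {C} s t u = begin
    [ t , u ]ˢ ⟪ distˢ ⟪ pair v₀ s ⟫ ⟫ ≡⟨ cong₂ (case _) (sub-⟪⟫ _ t v₀) (sub-⟪⟫ _ u v₀) ⟩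
    case (distˢ ⟪ pair v₀ s ⟫) (t ⟪ v₀ ⟫) (u ⟪ v₀ ⟫)
      ≈⟨ c-case (c-case (snd-β _ _) (c-inl (c-pair (fst-β _ _) ≈refl)) (c-inr (c-pair (fst-β _ _) ≈refl))) ≈refl ≈refl ⟩
    case (case s inl-pair inr-pair) (t ⟪ v₀ ⟫) (u ⟪ v₀ ⟫) ≡⟨ P.sym (P.trans ([]≡sub t' _) (cong₂ (case _) (sub-⟪⟫ _ t v₀) (sub-⟪⟫ _ u v₀))) ⟩
    t' [ case s inl-pair inr-pair ] ≈⟨ ≈sym (case-nat s t' inl-pair inr-pair) ⟩
    case s (t' [ inl-pair ]ᵂ) (t' [ inr-pair ]ᵂ) ≈⟨ c-case ≈refl inl-branch inr-branch ⟩
    case s (t ⟪ pair v₁ v₀ ⟫) (u ⟪ pair v₁ v₀ ⟫) ∎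
    where
      inl-pair : Tm ([] ,, G ,, A) ((G ×ᵗ A) +ᵗ (G ×ᵗ B))
      inl-pair = inl (pair v₁ v₀)
      inr-pair : Tm ([] ,, G ,, B) ((G ×ᵗ A) +ᵗ (G ×ᵗ B))
      inr-pair = inr (pair v₁ v₀)
      t' : Tm ([] ,, G ,, ((G ×ᵗ A) +ᵗ (G ×ᵗ B))) C
      t' = case v₀ (t ⟪ v₀ ⟫) (u ⟪ v₀ ⟫)
      inl-branch : Φ ⊢ t' [ inl-pair ]ᵂ ≈ t ⟪ pair v₁ v₀ ⟫
      inl-branch = begin
        t' [ inl-pair ]ᵂ ≡⟨ P.trans ([]ᵂ≡sub t' inl-pair) (cong₂ (case _) (sub-⟪⟫ _ t v₀) (sub-⟪⟫ _ u v₀)) ⟩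
        case inl-pair (t ⟪ v₀ ⟫) (u ⟪ v₀ ⟫) ≈⟨ case-inl _ _ _ ⟩
        (t ⟪ v₀ ⟫) [ pair v₁ v₀ ] ≡⟨ []-⟪var⟫ t _ ⟩
        t ⟪ pair v₁ v₀ ⟫ ∎
      inr-branch : Φ ⊢ t' [ inr-pair ]ᵂ ≈ u ⟪ pair v₁ v₀ ⟫
      inr-branch = begin
        t' [ inr-pair ]ᵂ ≡⟨ P.trans ([]ᵂ≡sub t' inr-pair) (cong₂ (case _) (sub-⟪⟫ _ t v₀) (sub-⟪⟫ _ u v₀)) ⟩
        case inr-pair (t ⟪ v₀ ⟫) (u ⟪ v₀ ⟫) ≈⟨ case-inr _ _ _ ⟩
        (u ⟪ v₀ ⟫) [ pair v₁ v₀ ] ≡⟨ []-⟪var⟫ u _ ⟩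
        u ⟪ pair v₁ v₀ ⟫ ∎
module TermModel (Sg : Signature) (Φ : Syntax.EqSet Sg) (o ℓ e : Level) where
  open Syntax Sg
  open Signature Sg
  open Substitution Sg
  open SyntacticCategory Sg Φ

  -- Lifted so that the term model lives at whatever levels the models are quantified over.
  Obˢ : Set o
  Obˢ = Lift o Type

  Homˢ : Obˢ → Obˢ → Set ℓ
  Homˢ X Y = Lift ℓ (lower X ⇒ˢ lower Y)

  _≈ˢ_ : ∀ {X Y} → Homˢ X Y → Homˢ X Y → Set e
  f ≈ˢ g = Lift e (Φ ⊢ lower f ≈ lower g)

  cat : DistCat o ℓ e
  cat = record
    { Obj = Obˢ
    ; Hom = Homˢ
    ; _≈_ = _≈ˢ_
    ; ≈-equiv = record
        { refl = lift ≈refl ; sym = λ d → lift (≈sym (lower d)) ; trans = λ d d' → lift (≈trans (lower d) (lower d')) }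
    ; id = lift idˢ
    ; _∘_ = λ g f → lift (lower g ∘ˢ lower f)
    ; assoc = λ {_} {_} {_} {_} {f} {g} {h} → lift (assocˢ (lower f) (lower g) (lower h))
    ; identityˡ = lift ≈refl
    ; identityʳ = λ {_} {_} {f} → lift (identityʳˢ (lower f))
    ; ∘-resp-≈ = λ p q → lift (⟪⟫-≈ (lower p) (lower q))
    ; 𝟙 = lift unit
    ; ! = lift star
    ; !-unique = λ f → lift (unit-η _)
    ; _⊗_ = λ X Y → lift (lower X ×ᵗ lower Y)
    ; π₁ = lift π₁ˢ
    ; π₂ = lift π₂ˢ
    ; ⟨_,_⟩ = λ f g → lift (pair (lower f) (lower g))
    ; project₁ = lift (fst-β _ _)
    ; project₂ = lift (snd-β _ _)
    ; ⟨⟩-unique = λ p q → lift (⟨⟩-uniqueˢ _ _ _ (lower p) (lower q))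
    ; _⊕_ = λ X Y → lift (lower X +ᵗ lower Y)
    ; i₁ = lift (inl v₀)
    ; i₂ = lift (inr v₀)
    ; [_,_] = λ f g → lift [ lower f , lower g ]ˢ
    ; inject₁ = λ {_} {_} {_} {f} {g} → lift (inject₁ˢ (lower f) (lower g))
    ; inject₂ = λ {_} {_} {_} {f} {g} → lift (inject₂ˢ (lower f) (lower g))
    ; []-unique = λ p q → lift ([]-uniqueˢ _ _ _ (lower p) (lower q))
    ; dist = lift distˢ
    ; dist∘can = lift dist∘canˢ
    ; can∘dist = lift can∘distˢ
    }

  mon : StrongMonad cat
  mon = record
    { T = λ X → lift (Tᵗ (lower X))
    ; η = lift (ret v₀)
    ; _⋆ = λ f → lift (lower f ⋆ˢ)
    ; ⋆-resp-≈ = λ p → lift (c-bind ≈refl (⟪⟫-≈ (lower p) ≈refl))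
    ; ⋆-η = λ {_} {_} {f} → lift (⋆-ηˢ (lower f))
    ; η-⋆ = lift η-⋆ˢ
    ; ⋆-assoc = λ {_} {_} {_} {f} {g} → lift (⋆-assocˢ (lower f) (lower g))
    ; τ = lift τˢ
    ; τ-natural = λ {_} {_} {_} {_} {f} {g} → lift (τ-naturalˢ (lower f) (lower g))
    ; τ-unit = lift τ-unitˢ
    ; τ-assoc = lift τ-assocˢ
    ; τ-η = lift τ-ηˢ
    ; τ-⋆ = λ {_} {_} {_} {f} → lift (τ-⋆ˢ (lower f))
    }

  sadd : SemiAdditive cat mon
  sadd = record
    { δ = lift nil
    ; ϖ = lift ϖˢ
    ; δ-natural = λ {_} {_} {f} → lift (δ-naturalˢ (lower f))
    ; ϖ-natural = λ {_} {_} {f} → lift (ϖ-naturalˢ (lower f))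
    ; ϖ-unit = λ {_} {_} {f} → lift (ϖ-unitˢ (lower f))
    ; ϖ-comm = λ {_} {_} {f} {g} → lift (ϖ-commˢ (lower f) (lower g))
    ; ϖ-idem = λ {_} {_} {f} → lift (ϖ-idemˢ (lower f))
    ; ϖ-assoc = λ {_} {_} {f} {g} {h} → lift (ϖ-assocˢ (lower f) (lower g) (lower h))
    ; ⋆-δ = λ {_} {_} {f} → lift (⋆-δˢ (lower f))
    ; ⋆-ϖ = λ {_} {_} {f} → lift (⋆-ϖˢ (lower f))
    ; τ-δ = λ {_} {_} {_} {f} → lift (τ-δˢ (lower f))
    ; τ-ϖ = λ {_} {_} {_} {f} → lift (τ-ϖˢ (lower f))
    }

  fin : FinalCoalgebras cat mon
  fin = record
    { R = λ X → lift (Tνᵗ (lower X))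
    ; outC = lift (out v₀)
    ; coit = λ f → lift (coitˢ (lower f))
    ; coit-hom = λ {_} {_} {f} → lift (coit-homˢ (lower f))
    ; coit-unique = λ {_} {_} {f} {h} p → lift (coit-uniqueˢ (lower f) (lower h) (lower p))
    }

  str : Structure o ℓ e
  str = record { cat = cat ; mon = mon ; sadd = sadd ; fin = fin }


  open StructureProperties str
    using (_≈_; _∘_; π₁; π₂; ⟨_,_⟩; η; i₁; i₂; coit; coit-unique; trans≈;
           bindₘ; caseₘ; unfoldₘ; unfoldCoalg; unfoldₘ-coit; bindₘ-coit-rule)

  private variable
    A B G : Type

  -- The unfolding of Q with the context G and the seed packed into one variable of type G ×ᵗ A
  unfoldPacked : G ×ᵗ A ⇒ˢ Tᵗ (A +ᵗ B) → G ×ᵗ A ⇒ˢ Tνᵗ B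
  unfoldPacked Q = unfold (snd v₀) (Q ⟪ pair (fst v₁) v₀ ⟫)

  unfoldPacked-step : G ×ᵗ A ⇒ˢ Tᵗ (A +ᵗ B) → G ×ᵗ A ⇒ˢ Tᵗ (Tνᵗ B +ᵗ B)
  unfoldPacked-step Q = bind Q (case v₀ (ret (inl (unfoldPacked Q ⟪ pair (fst v₂) v₀ ⟫))) (ret (inr v₀)))

  out-unfoldPacked : (Q : G ×ᵗ A ⇒ˢ Tᵗ (A +ᵗ B)) → Φ ⊢ out (unfoldPacked Q) ≈ unfoldPacked-step Q
  out-unfoldPacked {G} {A} {B} Q = begin
    out (unfoldPacked Q)  ≡⟨ cong out (P.sym unpack-p₀) ⟩
    out (sub unpack p₀)   ≈⟨ ≈subst unpack (coit← p₀ q₀ ≈refl) ⟩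
    bind (sub unpack q₀) (case v₀ (ret (inl (sub (exts (exts unpack)) (rename coitRen p₀)))) (ret (inr v₀)))
                          ≈⟨ c-bind unpack-q₀ (c-case ≈refl (c-ret (c-inl unpack-coitRen-p₀)) ≈refl) ⟩
    unfoldPacked-step Q   ∎
    where
      open DerivableReasoning
      -- the coiteration rule applies to the unpacked unfolding p₀ in context G, A
      q₀ : Tm ([] ,, G ,, A) (Tᵗ (A +ᵗ B))
      q₀ = Q ⟪ pair v₁ v₀ ⟫
      p₀ : Tm ([] ,, G ,, A) (Tνᵗ B)
      p₀ = unfold v₀ (weak₁ q₀)
      unpack : Sub ([] ,, G ,, A) ([] ,, G ×ᵗ A)
      unpack here         = snd v₀
      unpack (there here) = fst v₀
      unpack-p₀ : sub unpack p₀ ≡ unfoldPacked Q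
      unpack-p₀ = cong (unfold (snd v₀))
        (P.trans (cong (sub (exts unpack)) (rename-⟪⟫ (ext there) Q (pair v₁ v₀))) (sub-⟪⟫ (exts unpack) Q _))
      unpack-q₀ : Φ ⊢ sub unpack q₀ ≈ Q
      unpack-q₀ = ≈trans (≡⇒≈ (sub-⟪⟫ unpack Q (pair v₁ v₀))) (≈trans (⟪⟫-≈ {f = Q} ≈refl (pair-η _)) (≡⇒≈ (⟪var⟫ Q)))
      M : Tm ([] ,, G ×ᵗ A ,, A +ᵗ B ,, A) (G ×ᵗ A)
      M = pair (fst v₂) v₀
      pointwise : ∀ {C} (v : ([] ,, G ,, A) ∋ C) → Φ ⊢ exts (exts unpack) (coitRen v) ≈ sub (onlySub M) (unpack v)
      pointwise here         = ≈sym (snd-β _ _)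
      pointwise (there here) = ≈sym (fst-β _ _)
      unpack-coitRen-p₀ : Φ ⊢ sub (exts (exts unpack)) (rename coitRen p₀) ≈ unfoldPacked Q ⟪ M ⟫
      unpack-coitRen-p₀ = ≈trans (≡⇒≈ (sub-rename _ coitRen p₀)) (≈trans (sub-≈ pointwise p₀)
        (≡⇒≈ (P.trans (P.sym (sub-sub (onlySub M) unpack p₀)) (cong (_⟪ M ⟫) unpack-p₀))))

  coitRuleₘ-unfoldPacked : (Q : G ×ᵗ A ⇒ˢ Tᵗ (A +ᵗ B)) →
    Φ ⊢ lower (bindₘ (lift Q) (caseₘ π₂ (η ∘ (i₁ ∘ (lift (unfoldPacked Q) ∘ ⟨ π₁ ∘ (π₁ ∘ π₁) , π₂ ⟩))) (η ∘ (i₂ ∘ π₂))))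
      ≈ unfoldPacked-step Q
  coitRuleₘ-unfoldPacked {G} {A} {B} Q = begin
    Kᵗ ⋆ˢ ⟪ τˢ ⟪ pair v₀ Q ⟫ ⟫  ≈⟨ bind-via-τˢ Q Kᵗ ⟩
    bind Q (Kᵗ ⟪ N ⟫)          ≈⟨ c-bind ≈refl (⟪⟫-≈ (case-via-distˢ (snd v₀) (ret (inl Z')) (ret (inr (snd v₀)))) ≈refl) ⟩
    bind Q (case (snd N) (ret (inl (sub (exts (onlySub N)) (Z' ⟪ pair v₁ v₀ ⟫)))) (ret (inr (snd N'))))
      ≡⟨ cong (λ z → bind Q (case (snd N) (ret (inl z)) (ret (inr (snd N')))))
              (P.trans (sub-⟪⟫ _ Z' (pair v₁ v₀)) (⟪⟫⟪⟫ (unfoldPacked Q) _ N')) ⟩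
    bind Q (case (snd N) (ret (inl (unfoldPacked Q ⟪ pair (fst (fst (fst N'))) (snd N') ⟫))) (ret (inr (snd N'))))
      ≈⟨ c-bind ≈refl (c-case (snd-β _ _)
           (c-ret (c-inl (⟪⟫-≈ {f = unfoldPacked Q} ≈refl (c-pair (c-fst (≈trans (c-fst (fst-β _ _)) (fst-β _ _))) (snd-β _ _)))))
           (c-ret (c-inr (snd-β _ _)))) ⟩
    unfoldPacked-step Q ∎
    where
      open DerivableReasoning
      N : Tm ([] ,, G ×ᵗ A ,, A +ᵗ B) ((G ×ᵗ A) ×ᵗ (A +ᵗ B))
      N = pair v₁ v₀
      N' : ∀ {C} → Tm ([] ,, G ×ᵗ A ,, A +ᵗ B ,, C) (((G ×ᵗ A) ×ᵗ (A +ᵗ B)) ×ᵗ C)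
      N' = pair (rename there N) v₀
      Z' : ((G ×ᵗ A) ×ᵗ (A +ᵗ B)) ×ᵗ A ⇒ˢ Tνᵗ B
      Z' = unfoldPacked Q ⟪ pair (fst (fst (fst v₀))) (snd v₀) ⟫
      Kᵗ : (G ×ᵗ A) ×ᵗ (A +ᵗ B) ⇒ˢ Tᵗ (Tνᵗ B +ᵗ B)
      Kᵗ = [ ret (inl Z') , ret (inr (snd v₀)) ]ˢ ⟪ distˢ ⟪ pair v₀ (snd v₀) ⟫ ⟫

  unfoldPacked≈coit : (Q : G ×ᵗ A ⇒ˢ Tᵗ (A +ᵗ B)) → lift (unfoldPacked Q) ≈ coit (unfoldCoalg (lift Q))
  unfoldPacked≈coit Q = coit-unique (trans≈ (lift (out-unfoldPacked Q))
    (trans≈ (lift (≈sym (coitRuleₘ-unfoldPacked Q))) (bindₘ-coit-rule {P = lift (unfoldPacked Q)} (lift ≈refl))))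

  unfoldₘ-term : (P : G ⇒ˢ A) (Q : G ×ᵗ A ⇒ˢ Tᵗ (A +ᵗ B)) →
                 Φ ⊢ lower (unfoldₘ (lift P) (lift Q)) ≈ unfold P (Q ⟪ pair v₁ v₀ ⟫)
  unfoldₘ-term P Q = begin
    lower (unfoldₘ (lift P) (lift Q))        ≈⟨ lower (unfoldₘ-coit {p = lift P} {q = lift Q}) ⟩
    lower (coit (unfoldCoalg (lift Q))) ⟪ pair v₀ P ⟫ ≈⟨ ⟪⟫-≈ (≈sym (lower (unfoldPacked≈coit Q))) ≈refl ⟩
    unfoldPacked Q ⟪ pair v₀ P ⟫              ≡⟨ cong (unfold (snd (pair v₀ P))) (sub-⟪⟫ _ Q (pair (fst v₁) v₀)) ⟩
    unfold (snd (pair v₀ P)) (Q ⟪ pair (fst (pair v₁ (rename there P))) v₀ ⟫)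
      ≈⟨ c-unfold (snd-β _ _) (⟪⟫-≈ {f = Q} ≈refl (c-pair (fst-β _ _) ≈refl)) ⟩
    unfold P (Q ⟪ pair v₁ v₀ ⟫)              ∎
    where open DerivableReasoning

  atomˢ : Atom → Obˢ
  atomˢ w = lift (atom w)

  -- The type underlying the term-model interpretation of A; it is A itself, but only propositionally.
  ⌊_⌋ : Type → Type
  ⌊ A ⌋ = lower (Interp.⟦_⟧ty str atomˢ A)

  ⌊⌋≡ : ∀ A → ⌊ A ⌋ ≡ A
  ⌊⌋≡ (atom w) = refl
  ⌊⌋≡ unit     = refl
  ⌊⌋≡ (A ×ᵗ B) = cong₂ _×ᵗ_ (⌊⌋≡ A) (⌊⌋≡ B)
  ⌊⌋≡ (A +ᵗ B) = cong₂ _+ᵗ_ (⌊⌋≡ A) (⌊⌋≡ B)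
  ⌊⌋≡ (Tᵗ A)   = cong Tᵗ (⌊⌋≡ A)
  ⌊⌋≡ (Tνᵗ A)  = cong Tνᵗ (⌊⌋≡ A)

  cast : ∀ {Γ X Y} → X ≡ Y → Tm Γ X → Tm Γ Y
  cast = P.subst (Tm _)

  model : Model Sg o ℓ e
  model = record
    { str   = str
    ; atomI = atomˢ
    ; funI  = λ {A} {B} f → lift (cast (P.sym (⌊⌋≡ B)) (app f (cast (⌊⌋≡ A) v₀)))
    }

-- Completeness

module Completeness (Sg : Signature) (Φ : Syntax.EqSet Sg) (o ℓ e : Level) where
  open Syntax Sg
  open Substitution Sg
  open SyntacticCategory Sg Φ
  open TermModel Sg Φ o ℓ e using (model; ⌊_⌋; ⌊⌋≡; cast; unfoldₘ-term)
  open Semantics Sg model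

  private variable
    Δ Θ : Ctx
    X X' Y Y' C C' : Type

  cast-sub : (σ : Sub Δ Θ) (eq : X ≡ Y) (t : Tm Δ X) → sub σ (cast eq t) ≡ cast eq (sub σ t)
  cast-sub σ refl t = refl
  cast-rename : (ρ : Ren Δ Θ) (eq : X ≡ Y) (t : Tm Δ X) → rename ρ (cast eq t) ≡ cast eq (rename ρ t)
  cast-rename ρ refl t = refl
  cast-sym-cast : (eq : X ≡ Y) (t : Tm Δ Y) → cast eq (cast (P.sym eq) t) ≡ t
  cast-sym-cast refl t = refl
  cast-cast-sym : (eq : X ≡ Y) (t : Tm Δ X) → cast (P.sym eq) (cast eq t) ≡ t
  cast-cast-sym refl t = refl
  cast-≈ : (eq : X ≡ Y) {t s : Tm Δ X} → Φ ⊢ t ≈ s → Φ ⊢ cast eq t ≈ cast eq s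
  cast-≈ refl d = d

  cast-pair : (a : X ≡ X') (b : Y ≡ Y') (t : Tm Δ X) (u : Tm Δ Y) →
              cast (cong₂ _×ᵗ_ a b) (pair t u) ≡ pair (cast a t) (cast b u)
  cast-pair refl refl t u = refl
  cast-fst : (a : X ≡ X') (b : Y ≡ Y') (t : Tm Δ (X ×ᵗ Y)) → cast a (fst t) ≡ fst (cast (cong₂ _×ᵗ_ a b) t)
  cast-fst refl refl t = refl
  cast-snd : (a : X ≡ X') (b : Y ≡ Y') (t : Tm Δ (X ×ᵗ Y)) → cast b (snd t) ≡ snd (cast (cong₂ _×ᵗ_ a b) t)
  cast-snd refl refl t = refl
  cast-inl : (a : X ≡ X') (b : Y ≡ Y') (t : Tm Δ X) → cast (cong₂ _+ᵗ_ a b) (inl t) ≡ inl (cast a t)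
  cast-inl refl refl t = refl
  cast-inr : (a : X ≡ X') (b : Y ≡ Y') (t : Tm Δ Y) → cast (cong₂ _+ᵗ_ a b) (inr t) ≡ inr (cast b t)
  cast-inr refl refl t = refl
  cast-ret : (a : X ≡ X') (t : Tm Δ X) → cast (cong Tᵗ a) (ret t) ≡ ret (cast a t)
  cast-ret refl t = refl
  cast-nil : (a : X ≡ X') → cast {Δ} (cong Tᵗ a) nil ≡ nil
  cast-nil refl = refl
  cast-plus : (a : X ≡ X') (p q : Tm Δ (Tᵗ X)) →
              cast (cong Tᵗ a) (plus p q) ≡ plus (cast (cong Tᵗ a) p) (cast (cong Tᵗ a) q)
  cast-plus refl p q = refl
  cast-out : (a : X ≡ X') (p : Tm Δ (Tνᵗ X)) →
             cast (cong Tᵗ (cong₂ _+ᵗ_ (cong Tνᵗ a) a)) (out p) ≡ out (cast (cong Tνᵗ a) p)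
  cast-out refl p = refl

  lastSub-var : (t : Tm (Δ ,, X) C) → sub (lastSub v₀) t ≡ t
  lastSub-var t = P.trans (sub-cong (λ { here → refl ; (there v) → refl }) t) (sub-var t)

  -- Under a binder the bound variable is cast back, hence the substitution lastSub (cast … v₀).
  cast-case : (a : X ≡ X') (b : Y ≡ Y') (c : C ≡ C') (s : Tm Δ (X +ᵗ Y)) (t : Tm (Δ ,, X) C) (u : Tm (Δ ,, Y) C) →
              cast c (case s t u) ≡ case (cast (cong₂ _+ᵗ_ a b) s) (sub (lastSub (cast (P.sym a) v₀)) (cast c t))
                                                                   (sub (lastSub (cast (P.sym b) v₀)) (cast c u))
  cast-case refl refl refl s t u = P.sym (cong₂ (case s) (lastSub-var t) (lastSub-var u))

  cast-bind : (a : X ≡ X') (b : Y ≡ Y') (p : Tm Δ (Tᵗ X)) (q : Tm (Δ ,, X) (Tᵗ Y)) →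
              cast (cong Tᵗ b) (bind p q) ≡ bind (cast (cong Tᵗ a) p) (sub (lastSub (cast (P.sym a) v₀)) (cast (cong Tᵗ b) q))
  cast-bind refl refl p q = P.sym (cong (bind p) (lastSub-var q))

  cast-unfold : (a : X ≡ X') (b : Y ≡ Y') (p : Tm Δ X) (q : Tm (Δ ,, X) (Tᵗ (X +ᵗ Y))) →
                cast (cong Tνᵗ b) (unfold p q)
                  ≡ unfold (cast a p) (sub (lastSub (cast (P.sym a) v₀)) (cast (cong Tᵗ (cong₂ _+ᵗ_ a b)) q))
  cast-unfold refl refl p q = P.sym (cong (unfold p) (lastSub-var q))

  ↓_ : ∀ {A} → Tm Δ ⌊ A ⌋ → Tm Δ A
  ↓_ {A = A} = cast (⌊⌋≡ A)
  ↑_ : ∀ {A} → Tm Δ A → Tm Δ ⌊ A ⌋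
  ↑_ {A = A} = cast (P.sym (⌊⌋≡ A))

  ⌊_⌋ᶜ : Ctx → Type
  ⌊ Γ ⌋ᶜ = lower ⟦ Γ ⟧ctx

  -- The term model interprets a term in context Γ as a term in the single variable of type ⌊ Γ ⌋ᶜ;
  -- projections replaces each variable of Γ by its projection out of that tuple.
  projections : ∀ {Γ} → Sub Γ ([] ,, ⌊ Γ ⌋ᶜ)
  projections v = ↓ (lower ⟦ v ⟧var)

  projections-exts : ∀ {Γ A B} (v : (Γ ,, A) ∋ B) → Φ ⊢ projections v ⟪ pair v₁ (↑ v₀) ⟫ ≈ exts projections v
  projections-exts {A = A} here = ≈trans (≡⇒≈ (cast-sub _ (⌊⌋≡ A) (snd v₀)))
    (≈trans (cast-≈ (⌊⌋≡ A) (snd-β _ _)) (≡⇒≈ (cast-sym-cast (⌊⌋≡ A) v₀)))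
  projections-exts {B = B} (there v) =
    ≈trans (≡⇒≈ (P.trans (cast-sub _ (⌊⌋≡ B) _) (cong (cast (⌊⌋≡ B)) (⟪⟫⟪⟫ (lower ⟦ v ⟧var) (fst v₀) _))))
      (≈trans (cast-≈ (⌊⌋≡ B) (⟪⟫-≈ {f = lower ⟦ v ⟧var} ≈refl (fst-β _ _)))
        (≡⇒≈ (P.sym (P.trans (cast-rename there (⌊⌋≡ B) _) (cong (cast (⌊⌋≡ B)) (rename-as-⟪⟫ there (lower ⟦ v ⟧var)))))))

  interpretation-binder : ∀ {Γ A C} (t : Tm (Γ ,, A) C) → Φ ⊢ ↓ (lower ⟦ t ⟧tm) ≈ sub projections t →
                          Φ ⊢ sub (lastSub (↑ v₀)) (↓ (lower ⟦ t ⟧tm ⟪ pair v₁ v₀ ⟫)) ≈ sub (exts projections) t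
  interpretation-binder {C = C} t ih = begin
    sub (lastSub (↑ v₀)) (↓ (⟦t⟧ ⟪ pair v₁ v₀ ⟫))  ≡⟨ P.trans (cast-sub _ (⌊⌋≡ C) _) (cong (cast (⌊⌋≡ C)) (sub-⟪⟫ _ ⟦t⟧ _)) ⟩
    ↓ (⟦t⟧ ⟪ pair v₁ (↑ v₀) ⟫)                     ≡⟨ P.sym (cast-sub _ (⌊⌋≡ C) ⟦t⟧) ⟩
    (↓ ⟦t⟧) ⟪ pair v₁ (↑ v₀) ⟫                     ≈⟨ ⟪⟫-≈ ih ≈refl ⟩
    sub projections t ⟪ pair v₁ (↑ v₀) ⟫           ≡⟨ sub-sub _ projections t ⟩
    sub (λ v → projections v ⟪ pair v₁ (↑ v₀) ⟫) t ≈⟨ sub-≈ projections-exts t ⟩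
    sub (exts projections) t                       ∎
    where
      open DerivableReasoning
      ⟦t⟧ = lower ⟦ t ⟧tm

  interpretation : ∀ {Γ A} (t : Tm Γ A) → Φ ⊢ ↓ (lower ⟦ t ⟧tm) ≈ sub projections t
  interpretation (var v) = ≈refl
  interpretation {A = B} (app {A = A} f t) = ≈trans (≡⇒≈ cast-app) (c-app f (interpretation t))
    where
      cast-app : ↓ (lower ⟦ app f t ⟧tm) ≡ app f (↓ (lower ⟦ t ⟧tm))
      cast-app = P.trans (cong (cast (⌊⌋≡ B)) (cast-sub _ (P.sym (⌊⌋≡ B)) (app f (cast (⌊⌋≡ A) v₀))))
        (P.trans (cast-sym-cast (⌊⌋≡ B) _) (cong (app f) (cast-sub _ (⌊⌋≡ A) v₀)))
  interpretation star = ≈refl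
  interpretation {A = A ×ᵗ B} (pair t u) =
    ≈trans (≡⇒≈ (cast-pair (⌊⌋≡ A) (⌊⌋≡ B) _ _)) (c-pair (interpretation t) (interpretation u))
  interpretation {A = A} (fst {B = B} t) = ≈trans (≡⇒≈ (cast-fst (⌊⌋≡ A) (⌊⌋≡ B) _)) (c-fst (interpretation t))
  interpretation {A = B} (snd {A = A} t) = ≈trans (≡⇒≈ (cast-snd (⌊⌋≡ A) (⌊⌋≡ B) _)) (c-snd (interpretation t))
  interpretation {A = A +ᵗ B} (inl t) = ≈trans (≡⇒≈ (cast-inl (⌊⌋≡ A) (⌊⌋≡ B) _)) (c-inl (interpretation t))
  interpretation {A = A +ᵗ B} (inr t) = ≈trans (≡⇒≈ (cast-inr (⌊⌋≡ A) (⌊⌋≡ B) _)) (c-inr (interpretation t))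
  interpretation {A = C} (case {A = A} {B = B} s t u) =
    ≈trans (cast-≈ (⌊⌋≡ C) (case-via-distˢ (lower ⟦ s ⟧tm) (lower ⟦ t ⟧tm) (lower ⟦ u ⟧tm)))
      (≈trans (≡⇒≈ (cast-case (⌊⌋≡ A) (⌊⌋≡ B) (⌊⌋≡ C) _ _ _))
        (c-case (interpretation s) (interpretation-binder t (interpretation t)) (interpretation-binder u (interpretation u))))
  interpretation {A = Tᵗ A} (ret t) = ≈trans (≡⇒≈ (cast-ret (⌊⌋≡ A) _)) (c-ret (interpretation t))
  interpretation {A = Tᵗ B} (bind {A = A} p q) =
    ≈trans (cast-≈ (⌊⌋≡ (Tᵗ B)) (bind-via-τˢ (lower ⟦ p ⟧tm) (lower ⟦ q ⟧tm)))
      (≈trans (≡⇒≈ (cast-bind (⌊⌋≡ A) (⌊⌋≡ B) _ _)) (c-bind (interpretation p) (interpretation-binder q (interpretation q))))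
  interpretation {A = Tᵗ A} nil = ≡⇒≈ (cast-nil (⌊⌋≡ A))
  interpretation {A = Tᵗ A} (plus p q) = ≈trans (cast-≈ (⌊⌋≡ (Tᵗ A)) (c-plus (fst-β _ _) (snd-β _ _)))
    (≈trans (≡⇒≈ (cast-plus (⌊⌋≡ A) _ _)) (c-plus (interpretation p) (interpretation q)))
  interpretation {A = Tᵗ (Tνᵗ A +ᵗ A)} (out p) = ≈trans (≡⇒≈ (cast-out (⌊⌋≡ A) _)) (c-out (interpretation p))
  interpretation {A = Tνᵗ B} (unfold {A = A} p q) =
    ≈trans (cast-≈ (⌊⌋≡ (Tνᵗ B)) (unfoldₘ-term (lower ⟦ p ⟧tm) (lower ⟦ q ⟧tm)))
      (≈trans (≡⇒≈ (cast-unfold (⌊⌋≡ A) (⌊⌋≡ B) _ _))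
        (c-unfold (interpretation p) (interpretation-binder q (interpretation q))))

  tuple : ∀ Γ → Tm Γ ⌊ Γ ⌋ᶜ
  tuple []      = star
  tuple (A ∷ Γ) = pair (rename there (tuple Γ)) (↑ v₀)

  projections-tuple : ∀ {Γ A} (v : Γ ∋ A) → Φ ⊢ projections v ⟪ tuple Γ ⟫ ≈ var v
  projections-tuple {A ∷ Γ} here = ≈trans (≡⇒≈ (cast-sub _ (⌊⌋≡ A) (snd v₀)))
    (≈trans (cast-≈ (⌊⌋≡ A) (snd-β _ _)) (≡⇒≈ (cast-sym-cast (⌊⌋≡ A) v₀)))
  projections-tuple {B ∷ Γ} {A} (there v) =
    ≈trans (≡⇒≈ unfold-tuple) (≈trans (cast-≈ (⌊⌋≡ A) (⟪⟫-≈ {f = ⟦v⟧} ≈refl (fst-β _ _)))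
      (≈trans (≡⇒≈ weaken) (rename-≈ there (projections-tuple v))))
    where
      ⟦v⟧ : Tm ([] ,, ⌊ Γ ⌋ᶜ) ⌊ A ⌋
      ⟦v⟧ = lower ⟦ v ⟧var
      unfold-tuple : projections {B ∷ Γ} (there v) ⟪ tuple (B ∷ Γ) ⟫ ≡ cast (⌊⌋≡ A) (⟦v⟧ ⟪ fst (tuple (B ∷ Γ)) ⟫)
      unfold-tuple = P.trans (cast-sub (onlySub (tuple (B ∷ Γ))) (⌊⌋≡ A) (⟦v⟧ ⟪ fst v₀ ⟫))
        (cong (cast (⌊⌋≡ A)) (⟪⟫⟪⟫ ⟦v⟧ (fst v₀) (tuple (B ∷ Γ))))
      weaken : cast (⌊⌋≡ A) (⟦v⟧ ⟪ rename there (tuple Γ) ⟫) ≡ rename there (projections v ⟪ tuple Γ ⟫)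
      weaken = P.trans (cong (cast (⌊⌋≡ A)) (P.sym (rename-⟪⟫ there ⟦v⟧ (tuple Γ))))
        (P.trans (P.sym (cast-rename there (⌊⌋≡ A) (⟦v⟧ ⟪ tuple Γ ⟫)))
          (cong (rename there) (P.sym (cast-sub (onlySub (tuple Γ)) (⌊⌋≡ A) ⟦v⟧))))

  ≈-from-projections : ∀ {Γ A} {t s : Tm Γ A} → Φ ⊢ sub projections t ≈ sub projections s → Φ ⊢ t ≈ s
  ≈-from-projections {Γ} {t = t} {s} d = ≈trans (≈sym (retract t)) (≈trans (⟪⟫-≈ d ≈refl) (retract s))
    where
      retract : ∀ {A} (u : Tm Γ A) → Φ ⊢ sub projections u ⟪ tuple Γ ⟫ ≈ u
      retract u = ≈trans (≡⇒≈ (sub-sub _ projections u)) (≈trans (sub-≈ projections-tuple u) (≡⇒≈ (sub-var u)))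

  model-satisfies : SatisfiesAll Sg model Φ
  model-satisfies (_▷_≐_ Γ {A} t s) t≈s = lift (≈trans (≡⇒≈ (P.sym (cast-cast-sym (⌊⌋≡ A) (lower ⟦ t ⟧tm))))
    (≈trans (cast-≈ (P.sym (⌊⌋≡ A)) (≈trans (interpretation t) (≈trans (≈subst projections (hyp t≈s)) (≈sym (interpretation s)))))
      (≡⇒≈ (cast-cast-sym (⌊⌋≡ A) (lower ⟦ s ⟧tm)))))

  complete : ∀ {Γ A} (t s : Tm Γ A) → Satisfies Sg model (Γ ▷ t ≐ s) → Φ ⊢ t ≈ s
  complete {A = A} t s ⟦t⟧≈⟦s⟧ = ≈-from-projections
    (≈trans (≈sym (interpretation t)) (≈trans (cast-≈ (⌊⌋≡ A) (lower ⟦t⟧≈⟦s⟧)) (interpretation s)))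

theorem1 : (Sg : Signature) (Φ : Syntax.EqSet Sg) {Γ : Syntax.Ctx Sg} {A : Syntax.Type Sg}
           (t s : Syntax.Tm Sg Γ A) {o ℓ e : Level} →
           (Syntax._⊢_≈_ Sg Φ t s)
             ⇔ ((M : Model Sg o ℓ e) → SatisfiesAll Sg M Φ → Satisfies Sg M (Syntax._▷_≐_ Γ t s))
theorem1 Sg Φ t s {o} {ℓ} {e} = mk⇔
  (λ t≈s M M⊨Φ → Soundness.sound Sg M Φ M⊨Φ t≈s)
  (λ valid → complete t s (valid model model-satisfies))
  where
    open TermModel Sg Φ o ℓ e using (model)
    open Completeness Sg Φ o ℓ e using (complete; model-satisfies)
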